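{- Let $\triangleright_a:\mathrm{Lie}(V)\otimes\mathrm{Lie}(V)\to\mathrm{Lie}(V)$ be the map defined in the context. Then $(\mathrm{Lie}(V),[\cdot,\cdot],\triangleright_a)$ is a post-Lie algebra.
   Context: $V=\{v_0,v_1,v_2,\dots\}$. For $\mathbf k=(k_1,\dots,k_d),\mathbf l=(l_1,\dots,l_d)\in\mathbb Z_{\ge0}^d$ set $|\mathbf k|=k_1+\dots+k_d$ and define the ari multiplicity $\mathrm m_{\mathbf k,\mathbf l}=(-1)^{|\mathbf k|+|\mathbf l|}\prod_{i=1}^d\binom{k_i-1}{l_i-1}$, where $\binom{k-1}{l-1}$ is the usual binomial coefficient for $k,l\ge1$ (zero if $l>k$), $\binom{ -1}{ -1}=1$, and $\binom{k-1}{ -1}=\binom{ -1}{l-1}=0$ for $k,l>0$; $\mathrm m_{\emptyset,\emptyset}=1$. Let $M(V)$ be the free magma on $V$ with product $\star$ and $M(V)_{\mathbb Q}$ its $\mathbb Q$-span. An element $t\in M(V)$ is a bracketing of letters $v_{k_1},\dots,v_{k_d}$ (in left-to-right order); write $t=t(\mathbf k)$ and let $t(\mathbf l)$ denote the same bracketing with the letters replaced by $v_{l_1},\dots,v_{l_d}$. Define $t(\mathbf k)\triangleright_a v_0=0$ and, for $s\ge1$, $t(\mathbf k)\triangleright_a v_s=\sum_{\mathbf l\in\mathbb Z_{\ge0}^d}\mathrm m_{\mathbf k,\mathbf l}\,v_{s+|\mathbf k|-|\mathbf l|}\star t(\mathbf l)$ (a finite sum). Extend $\triangleright_a$ linearly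 in the first argument and as a derivation of $(M(V)_{\mathbb Q},\star)$ in the second argument. Let $\mathrm{Lie}:M(V)_{\mathbb Q}\to\mathrm{Lie}(V)$ be the surjective homomorphism onto the free Lie algebra which is the identity on $V$ and maps $a\star b\mapsto[a,b]$. Then $\triangleright_a$ descends to a well-defined bilinear map $\triangleright_a$ on $\mathrm{Lie}(V)$ with $\mathrm{Lie}(x\triangleright_a y)=\mathrm{Lie}(x)\triangleright_a\mathrm{Lie}(y)$; this is the map in the claim. A post-Lie algebra is a Lie algebra $(\mathfrak g,[\cdot,\cdot])$ with bilinear $\triangleright$ such that $x\triangleright[y,z]=[x\triangleright y,z]+[y,x\triangleright z]$ and $[x,y]\triangleright z=x\triangleright(y\triangleright z)-(x\triangleright y)\triangleright z-y\triangleright(x\triangleright z)+(y\triangleright x)\triangleright z$. -}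

module Defs where

open import Data.Nat as ℕ using (ℕ; zero; suc; _∸_)
open import Data.Nat.Combinatorics using (_C_)
open import Data.Integer using (+_)
open import Data.Rational as ℚ using (ℚ; 0ℚ; 1ℚ; -_; _/_)
open import Data.List using (List; []; _∷_; _++_; map; concatMap; upTo)
open import Data.Nat.ListAction using (sum)
open import Data.Product using (_×_; _,_)
open import Relation.Binary.PropositionalEquality using (_≡_)

-- The free magma M(V) on V = {v₀, v₁, v₂, …}; (v i) is the letter v_i.

infixl 7 _⋆_
data M : Set where
  v   : ℕ → M
  _⋆_ : M → M → M

-- M(V)_ℚ : formal finite ℚ-linear combinations of magma elements,
-- represented by lists of (coefficient, basis element).  Equality of
-- vectors is the vector-space equivalence included in _≈_ below.

Lin : Set
Lin = List (ℚ × M)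

⟦_⟧ : M → Lin
⟦ t ⟧ = (1ℚ , t) ∷ []

𝟘 : Lin
𝟘 = []

infixl 6 _⊕_ _⊖_
_⊕_ : Lin → Lin → Lin
_⊕_ = _++_

infix 8 _·_
_·_ : ℚ → Lin → Lin
q · x = map (λ { (a , t) → (q ℚ.* a , t) }) x

⊝_ : Lin → Lin
⊝ x = (- 1ℚ) · x

_⊖_ : Lin → Lin → Lin
x ⊖ y = x ⊕ (⊝ y)

infixl 7 _⋆ₗ_
_⋆ₗ_ : Lin → Lin → Lin
x ⋆ₗ y = concatMap (λ { (a , t) → map (λ { (b , u) → (a ℚ.* b , t ⋆ u) }) y }) x

-- Lie(V) = M(V)_ℚ / (two-sided ideal generated by a⋆a and the Jacobi
-- elements), presented as a setoid: x ≈ y means Lie(x) = Lie(y).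
-- The first group of constructors makes Lin the free ℚ-vector space on
-- M (up to ≈); the congruences under ⋆ₗ make the generated relation an
-- ideal; alt and jacobi are the generators of the ideal.

infix 4 _≈_
data _≈_ : Lin → Lin → Set where
  ≈-refl   : ∀ {x} → x ≈ x
  ≈-sym    : ∀ {x y} → x ≈ y → y ≈ x
  ≈-trans  : ∀ {x y z} → x ≈ y → y ≈ z → x ≈ z
  ⊕-cong   : ∀ {x x′ y y′} → x ≈ x′ → y ≈ y′ → x ⊕ y ≈ x′ ⊕ y′
  ⊕-swap   : ∀ x y → x ⊕ y ≈ y ⊕ x
  merge    : ∀ a b t → (a , t) ∷ (b , t) ∷ [] ≈ (a ℚ.+ b , t) ∷ []
  zero-co  : ∀ t → (0ℚ , t) ∷ [] ≈ []
  ⋆-congˡ  : ∀ {x x′} y → x ≈ x′ → x ⋆ₗ y ≈ x′ ⋆ₗ y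
  ⋆-congʳ  : ∀ x {y y′} → y ≈ y′ → x ⋆ₗ y ≈ x ⋆ₗ y′
  alt      : ∀ x → x ⋆ₗ x ≈ 𝟘
  jacobi   : ∀ x y z →
             x ⋆ₗ (y ⋆ₗ z) ⊕ y ⋆ₗ (z ⋆ₗ x) ⊕ z ⋆ₗ (x ⋆ₗ y) ≈ 𝟘

letters : M → List ℕ
letters (v k)   = k ∷ []
letters (t ⋆ u) = letters t ++ letters u

∣_∣ : List ℕ → ℕ
∣ ks ∣ = sum ks

-- t(l): same bracketing with the letters replaced, in order, by l
-- (returns the remaining unused labels as well)
relabel′ : M → List ℕ → M × List ℕ
relabel′ (v k)   []       = v k , []
relabel′ (v k)   (l ∷ ls) = v l , ls
relabel′ (t ⋆ u) ls with relabel′ t ls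
... | t′ , ls′ with relabel′ u ls′
...   | u′ , ls″ = t′ ⋆ u′ , ls″

relabel : M → List ℕ → M
relabel t ls with relabel′ t ls
... | t′ , _ = t′

-- binomial (k-1 choose l-1) with the stated conventions
binom₋₁ : ℕ → ℕ → ℕ
binom₋₁ zero    zero    = 1
binom₋₁ zero    (suc l) = 0
binom₋₁ (suc k) zero    = 0
binom₋₁ (suc k) (suc l) = k C l

sgn : ℕ → ℚ
sgn zero    = 1ℚ
sgn (suc n) = - sgn n

ℕ→ℚ : ℕ → ℚ
ℕ→ℚ n = + n / 1

prodBinom : List ℕ → List ℕ → ℕ
prodBinom []       []       = 1
prodBinom (k ∷ ks) (l ∷ ls) = binom₋₁ k l ℕ.* prodBinom ks ls
prodBinom _        _        = 0

mult : List ℕ → List ℕ → ℚ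
mult ks ls = sgn (∣ ks ∣ ℕ.+ ∣ ls ∣) ℚ.* ℕ→ℚ (prodBinom ks ls)

-- all l with 0 ≤ l_i ≤ k_i (a box containing every l with m_{k,l} ≠ 0)
box : List ℕ → List (List ℕ)
box []       = [] ∷ []
box (k ∷ ks) = concatMap (λ l → map (l ∷_) (box ks)) (upTo (suc k))

act-v : M → ℕ → Lin
act-v t zero    = 𝟘
act-v t (suc s) =
  map (λ ls → (mult ks ls , v ((suc s ℕ.+ ∣ ks ∣) ∸ ∣ ls ∣) ⋆ relabel t ls))
      (box ks)
  where ks = letters t

act-M : M → M → Lin
act-M t (v s)   = act-v t s
act-M t (u ⋆ w) = act-M t u ⋆ₗ ⟦ w ⟧ ⊕ ⟦ u ⟧ ⋆ₗ act-M t w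

infixr 8 _▷ₐ_
_▷ₐ_ : Lin → Lin → Lin
x ▷ₐ y = concatMap (λ { (a , t) →
           concatMap (λ { (b , u) → (a ℚ.* b) · act-M t u }) y }) x

record IsPostLie {A : Set} (_≃_ : A → A → Set)
                 (_+_ : A → A → A) (O : A) (_∙_ : ℚ → A → A)
                 (⁅_,_⁆ : A → A → A) (_▷_ : A → A → A) : Set where
  field
    ⁅⁆-cong  : ∀ {x x′ y y′} → x ≃ x′ → y ≃ y′ → ⁅ x , y ⁆ ≃ ⁅ x′ , y′ ⁆
    ⁅⁆-alt   : ∀ x → ⁅ x , x ⁆ ≃ O
    ⁅⁆-jac   : ∀ x y z →
      ((⁅ x , ⁅ y , z ⁆ ⁆ + ⁅ y , ⁅ z , x ⁆ ⁆) + ⁅ z , ⁅ x , y ⁆ ⁆) ≃ O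
    ▷-cong   : ∀ {x x′ y y′} → x ≃ x′ → y ≃ y′ → (x ▷ y) ≃ (x′ ▷ y′)
    ▷-+ˡ     : ∀ x y z → ((x + y) ▷ z) ≃ ((x ▷ z) + (y ▷ z))
    ▷-+ʳ     : ∀ x y z → (x ▷ (y + z)) ≃ ((x ▷ y) + (x ▷ z))
    ▷-∙ˡ     : ∀ q x y → ((q ∙ x) ▷ y) ≃ (q ∙ (x ▷ y))
    ▷-∙ʳ     : ∀ q x y → (x ▷ (q ∙ y)) ≃ (q ∙ (x ▷ y))
    derivation : ∀ x y z →
      (x ▷ ⁅ y , z ⁆) ≃ (⁅ x ▷ y , z ⁆ + ⁅ y , x ▷ z ⁆)
    bracket-▷  : ∀ x y z →
      (⁅ x , y ⁆ ▷ z) ≃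
        ((((x ▷ (y ▷ z)) + ((- 1ℚ) ∙ ((x ▷ y) ▷ z)))
           + ((- 1ℚ) ∙ (y ▷ (x ▷ z))))
           + ((y ▷ x) ▷ z))

-- For n ≥ 1 the action of a tree on a letter is t ▷ v_n = Σₑ v_{n+e} ⋆ Eₑ(t), where
-- E(t) = e^{−X∂} t = Σₑ Eₑ(t) Xᵉ is the flow of the derivation ∂ v_k = (k − 1) v_{k−1}: the ari
-- multiplicities m_{k,l} are exactly the coefficients of e^{−X∂} on letters.  Since ∂ is a
-- derivation, E is a magma morphism into polynomials over M(V)_ℚ, so it respects the Lie relations
-- and ▷ is well defined in its left argument; in its right argument ▷ is a derivation by
-- construction, which is also the first post-Lie axiom.  Each t ▷ − commutes with ∂, hence with E,
-- which gives E(t ▷ y) = (t ▷ −) applied coefficientwise to E(y).  In the second axiom both sides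
-- are derivations in z, so it suffices to take z a letter, where after these substitutions it is
-- the Jacobi identity v ⋆ (a ⋆ b) = (v ⋆ a) ⋆ b − (v ⋆ b) ⋆ a.

module Submission where

open import Data.Nat as ℕ using (ℕ; zero; suc; _∸_; _≤_; _<_; z≤n; s≤s)
import Data.Nat.Properties as ℕP
open import Data.Nat.Combinatorics using (_C_; nCn≡1; nC1≡n; nCk+nC[k+1]≡[n+1]C[k+1])
open import Data.Nat.Combinatorics.Specification using (k>n⇒nCk≡0)
import Data.Nat.Coprimality as C
open import Data.Integer as ℤ using (+_)
import Data.Integer.Properties as ℤP
open import Data.Sum using (inj₁; inj₂)
open import Data.Rational as ℚ using (ℚ; 0ℚ; 1ℚ; ½)
import Data.Rational.Properties as ℚP
open import Data.List using (List; []; _∷_; _++_; map; concatMap; length; upTo; take; drop)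
open import Data.List.Relation.Unary.All as All using (All; []; _∷_)
import Data.List.Relation.Unary.All.Properties as AllP
open import Data.Nat.ListAction using (sum)
open import Data.Nat.ListAction.Properties using (sum-++)
import Data.List.Properties as ListP
open import Data.Product using (_×_; _,_; proj₁; proj₂)
open import Data.Empty using (⊥-elim)
open import Data.Bool using (if_then_else_)
open import Level using (0ℓ)
open import Function using (_∘_)
open import Relation.Nullary using (Dec; yes; no; does; ¬_)
open import Relation.Nullary.Decidable using (dec⇒maybe)
open import Relation.Binary.Structures using (IsDecEquivalence)
open import Relation.Binary.Bundles using (Setoid)
import Relation.Binary.Reasoning.Setoid
open import Relation.Binary.TypeClasses using (_≟_)
open import Relation.Binary.PropositionalEquality
open import Relation.Binary.PropositionalEquality.Properties using (isDecEquivalence)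
open import Relation.Binary.Definitions using (DecidableEquality)
open import Data.Product.Properties using (≡-dec)
open import Tactic.RingSolver using (solve-∀)
import Data.Nat.Tactic.RingSolver as ℕ-Solver
open import Tactic.RingSolver.Core.AlmostCommutativeRing
  using (AlmostCommutativeRing; fromCommutativeRing)
open import Defs

-- The zero test lets the solver cancel terms such as (−1)·c + c.
ℚ-ring : AlmostCommutativeRing 0ℓ 0ℓ
ℚ-ring = fromCommutativeRing ℚP.+-*-commutativeRing (λ q → dec⇒maybe (0ℚ ℚ.≟ q))

-- Free ℚ-vector spaces

DecEq : Set → Set
DecEq B = IsDecEquivalence {A = B} _≡_

FV : Set → Set
FV B = List (ℚ × B)

module _ {B : Set} ⦃ _ : DecEq B ⦄ where

  δ : B → B → ℚ
  δ w b = if does (w ≟ b) then 1ℚ else 0ℚ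

  coef : B → FV B → ℚ
  coef w []            = 0ℚ
  coef w ((a , b) ∷ x) = a ℚ.* δ w b ℚ.+ coef w x

  infix 4 _≐_
  record _≐_ (x y : FV B) : Set where
    constructor mk≐
    field coef-≡ : ∀ w → coef w x ≡ coef w y
  open _≐_ public

  infix 8 _•_
  _•_ : ℚ → FV B → FV B
  q • x = map (λ p → (q ℚ.* proj₁ p , proj₂ p)) x

  ⟨_⟩ : B → FV B
  ⟨ b ⟩ = (1ℚ , b) ∷ []

  ≐-refl : ∀ {x} → x ≐ x
  ≐-refl = mk≐ λ _ → refl

  ≐-sym : ∀ {x y} → x ≐ y → y ≐ x
  ≐-sym p = mk≐ λ w → sym (coef-≡ p w)

  ≐-trans : ∀ {x y z} → x ≐ y → y ≐ z → x ≐ z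
  ≐-trans p q = mk≐ λ w → trans (coef-≡ p w) (coef-≡ q w)

  ≡⇒≐ : ∀ {x y} → x ≡ y → x ≐ y
  ≡⇒≐ refl = ≐-refl

  δ-refl : ∀ b → δ b b ≡ 1ℚ
  δ-refl b with b ≟ b
  ... | yes _ = refl
  ... | no b≢b = ⊥-elim (b≢b refl)

  δ-≢ : ∀ {w b} → w ≢ b → δ w b ≡ 0ℚ
  δ-≢ {w} {b} w≢b with w ≟ b
  ... | yes w≡b = ⊥-elim (w≢b w≡b)
  ... | no _    = refl

  a*δ≡0 : ∀ a {w b} → w ≢ b → a ℚ.* δ w b ≡ 0ℚ
  a*δ≡0 a w≢b = trans (cong (a ℚ.*_) (δ-≢ w≢b)) (ℚP.*-zeroʳ a)

  coef-++ : ∀ w x y → coef w (x ++ y) ≡ coef w x ℚ.+ coef w y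
  coef-++ w []            y = sym (ℚP.+-identityˡ _)
  coef-++ w ((a , b) ∷ x) y =
    trans (cong (a ℚ.* δ w b ℚ.+_) (coef-++ w x y)) (sym (ℚP.+-assoc (a ℚ.* δ w b) (coef w x) (coef w y)))

  coef-• : ∀ w q x → coef w (q • x) ≡ q ℚ.* coef w x
  coef-• w q []            = sym (ℚP.*-zeroʳ q)
  coef-• w q ((a , b) ∷ x) = trans (cong (q ℚ.* a ℚ.* δ w b ℚ.+_) (coef-• w q x)) (lemma q a (δ w b) (coef w x))
    where
    lemma : ∀ q a d c → q ℚ.* a ℚ.* d ℚ.+ q ℚ.* c ≡ q ℚ.* (a ℚ.* d ℚ.+ c)
    lemma = solve-∀ ℚ-ring

  ++-cong : ∀ {x x′ y y′} → x ≐ x′ → y ≐ y′ → x ++ y ≐ x′ ++ y′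
  ++-cong {x} {x′} {y} {y′} p q = mk≐ λ w → begin
    coef w (x ++ y)             ≡⟨ coef-++ w x y ⟩
    coef w x ℚ.+ coef w y       ≡⟨ cong₂ ℚ._+_ (coef-≡ p w) (coef-≡ q w) ⟩
    coef w x′ ℚ.+ coef w y′     ≡⟨ coef-++ w x′ y′ ⟨
    coef w (x′ ++ y′)           ∎
    where open ≡-Reasoning

  ++-congˡ : ∀ {x x′} y → x ≐ x′ → x ++ y ≐ x′ ++ y
  ++-congˡ y p = ++-cong p (≐-refl {y})

  ++-congʳ : ∀ x {y y′} → y ≐ y′ → x ++ y ≐ x ++ y′
  ++-congʳ x = ++-cong (≐-refl {x})

  ++-comm : ∀ x y → x ++ y ≐ y ++ x
  ++-comm x y = mk≐ λ w → trans (coef-++ w x y) (trans (ℚP.+-comm (coef w x) (coef w y)) (sym (coef-++ w y x)))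

  •-cong : ∀ q {x y} → x ≐ y → q • x ≐ q • y
  •-cong q {x} {y} p = mk≐ λ w → trans (coef-• w q x) (trans (cong (q ℚ.*_) (coef-≡ p w)) (sym (coef-• w q y)))

  •-++ : ∀ q x y → q • (x ++ y) ≡ q • x ++ q • y
  •-++ q x y = ListP.map-++ _ x y

  •-• : ∀ q r x → q • (r • x) ≐ (q ℚ.* r) • x
  •-• q r x = mk≐ λ w → begin
    coef w (q • (r • x))      ≡⟨ coef-• w q (r • x) ⟩
    q ℚ.* coef w (r • x)      ≡⟨ cong (q ℚ.*_) (coef-• w r x) ⟩
    q ℚ.* (r ℚ.* coef w x)    ≡⟨ ℚP.*-assoc q r _ ⟨
    q ℚ.* r ℚ.* coef w x      ≡⟨ coef-• w (q ℚ.* r) x ⟨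
    coef w ((q ℚ.* r) • x)    ∎
    where open ≡-Reasoning

  •-distribʳ : ∀ a c x → a • x ++ c • x ≐ (a ℚ.+ c) • x
  •-distribʳ a c x = mk≐ λ w → begin
    coef w (a • x ++ c • x)               ≡⟨ coef-++ w (a • x) (c • x) ⟩
    coef w (a • x) ℚ.+ coef w (c • x)     ≡⟨ cong₂ ℚ._+_ (coef-• w a x) (coef-• w c x) ⟩
    a ℚ.* coef w x ℚ.+ c ℚ.* coef w x     ≡⟨ ℚP.*-distribʳ-+ (coef w x) a c ⟨
    (a ℚ.+ c) ℚ.* coef w x                ≡⟨ coef-• w (a ℚ.+ c) x ⟨
    coef w ((a ℚ.+ c) • x)                ∎
    where open ≡-Reasoning

  0•-zero : ∀ x → 0ℚ • x ≐ []
  0•-zero x = mk≐ λ w → trans (coef-• w 0ℚ x) (ℚP.*-zeroˡ (coef w x))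

  1•-identity : ∀ x → 1ℚ • x ≐ x
  1•-identity x = mk≐ λ w → trans (coef-• w 1ℚ x) (ℚP.*-identityˡ (coef w x))

  •-cong-scalar : ∀ {q r} x → q ≡ r → q • x ≐ r • x
  •-cong-scalar x refl = ≐-refl

  •-cancel : ∀ c .⦃ _ : ℚ.NonZero c ⦄ {x y} → c • x ≐ c • y → x ≐ y
  •-cancel c {x} {y} cx≐cy = ≐-trans (unscale x) (≐-trans (•-cong (ℚ.1/ c) cx≐cy) (≐-sym (unscale y)))
    where
    unscale : ∀ z → z ≐ (ℚ.1/ c) • (c • z)
    unscale z = ≐-sym (≐-trans (•-• (ℚ.1/ c) c z) (≐-trans (•-cong-scalar z (ℚP.*-inverseˡ c)) (1•-identity z)))

  •-comm : ∀ q r x → q • (r • x) ≐ r • (q • x)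
  •-comm q r x = ≐-trans (•-• q r x) (≐-trans (•-cong-scalar x (ℚP.*-comm q r)) (≐-sym (•-• r q x)))

  •-inverse : ∀ x → (ℚ.- 1ℚ) • x ++ x ≐ []
  •-inverse x = mk≐ λ w → begin
    coef w ((ℚ.- 1ℚ) • x ++ x)               ≡⟨ coef-++ w ((ℚ.- 1ℚ) • x) x ⟩
    coef w ((ℚ.- 1ℚ) • x) ℚ.+ coef w x       ≡⟨ cong (ℚ._+ coef w x) (coef-• w (ℚ.- 1ℚ) x) ⟩
    (ℚ.- 1ℚ) ℚ.* coef w x ℚ.+ coef w x       ≡⟨ lemma (coef w x) ⟩
    0ℚ                                       ∎
    where
    open ≡-Reasoning
    lemma : ∀ c → (ℚ.- 1ℚ) ℚ.* c ℚ.+ c ≡ 0ℚ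
    lemma = solve-∀ ℚ-ring

  ≐-add-sub : ∀ x y → x ≐ (x ++ y) ++ (ℚ.- 1ℚ) • y
  ≐-add-sub x y = mk≐ λ w → begin
    coef w x                                             ≡⟨ lemma (coef w x) (coef w y) ⟩
    (coef w x ℚ.+ coef w y) ℚ.+ (ℚ.- 1ℚ) ℚ.* coef w y    ≡⟨ cong₂ ℚ._+_ (coef-++ w x y) (coef-• w (ℚ.- 1ℚ) y) ⟨
    coef w (x ++ y) ℚ.+ coef w ((ℚ.- 1ℚ) • y)            ≡⟨ coef-++ w (x ++ y) ((ℚ.- 1ℚ) • y) ⟨
    coef w ((x ++ y) ++ (ℚ.- 1ℚ) • y)                    ∎
    where
    open ≡-Reasoning
    lemma : ∀ a b → a ≡ (a ℚ.+ b) ℚ.+ (ℚ.- 1ℚ) ℚ.* b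
    lemma = solve-∀ ℚ-ring

  module ≐-Reasoning where
    open import Relation.Binary.Reasoning.Base.Single _≐_ ≐-refl ≐-trans public hiding (step-∼)
    open import Relation.Binary.Reasoning.Syntax using (module ≋-syntax)
    open ≋-syntax _IsRelatedTo_ _IsRelatedTo_ ∼-go ≐-sym public

  ++-interchange : ∀ a b c d → (a ++ b) ++ (c ++ d) ≐ (a ++ c) ++ (b ++ d)
  ++-interchange a b c d = begin
    (a ++ b) ++ (c ++ d)   ≡⟨ ListP.++-assoc a b (c ++ d) ⟩
    a ++ (b ++ (c ++ d))   ≡⟨ cong (a ++_) (ListP.++-assoc b c d) ⟨
    a ++ ((b ++ c) ++ d)   ≋⟨ ++-cong (≐-refl {a}) (++-cong (++-comm b c) (≐-refl {d})) ⟩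
    a ++ ((c ++ b) ++ d)   ≡⟨ cong (a ++_) (ListP.++-assoc c b d) ⟩
    a ++ (c ++ (b ++ d))   ≡⟨ ListP.++-assoc a c (b ++ d) ⟨
    (a ++ c) ++ (b ++ d)   ∎
    where open ≐-Reasoning

  single≐• : ∀ a b → (a , b) ∷ [] ≐ a • ⟨ b ⟩
  single≐• a b = mk≐ λ w → cong (λ r → r ℚ.* δ w b ℚ.+ 0ℚ) (sym (ℚP.*-identityʳ a))

  merge≐ : ∀ a c b → (a , b) ∷ (c , b) ∷ [] ≐ (a ℚ.+ c , b) ∷ []
  merge≐ a c b = mk≐ λ w → lemma a c (δ w b)
    where
    lemma : ∀ a c d → a ℚ.* d ℚ.+ (c ℚ.* d ℚ.+ 0ℚ) ≡ (a ℚ.+ c) ℚ.* d ℚ.+ 0ℚ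
    lemma = solve-∀ ℚ-ring

  zero≐ : ∀ b → (0ℚ , b) ∷ [] ≐ []
  zero≐ b = mk≐ λ w → trans (ℚP.+-identityʳ _) (ℚP.*-zeroˡ (δ w b))

  -- ≐ is contained in every relation closed under the vector-space rules; this is how coefficient
  -- computations are transported to ≈.
  record IsVectorRelation (R : FV B → FV B → Set) : Set where
    field
      refl′  : ∀ {x} → R x x
      sym′   : ∀ {x y} → R x y → R y x
      trans′ : ∀ {x y z} → R x y → R y z → R x z
      ++-cong′ : ∀ {x x′ y y′} → R x x′ → R y y′ → R (x ++ y) (x′ ++ y′)
      ++-comm′ : ∀ x y → R (x ++ y) (y ++ x)
      merge′ : ∀ a c b → R ((a , b) ∷ (c , b) ∷ []) ((a ℚ.+ c , b) ∷ [])
      zero′  : ∀ b → R ((0ℚ , b) ∷ []) []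

  ≐-isVectorRelation : IsVectorRelation _≐_
  ≐-isVectorRelation = record
    { refl′ = ≐-refl ; sym′ = ≐-sym ; trans′ = ≐-trans ; ++-cong′ = ++-cong
    ; ++-comm′ = ++-comm ; merge′ = merge≐ ; zero′ = zero≐ }

  remove : B → FV B → FV B
  remove b [] = []
  remove b ((a , c) ∷ x) with b ≟ c
  ... | yes _ = remove b x
  ... | no _  = (a , c) ∷ remove b x

  length-remove : ∀ b x → length (remove b x) ≤ length x
  length-remove b [] = z≤n
  length-remove b ((a , c) ∷ x) with b ≟ c
  ... | yes _ = ℕP.m≤n⇒m≤1+n (length-remove b x)
  ... | no _  = s≤s (length-remove b x)

  coef-remove-≡ : ∀ b x → coef b (remove b x) ≡ 0ℚ
  coef-remove-≡ b [] = refl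
  coef-remove-≡ b ((a , c) ∷ x) with b ≟ c
  ... | yes _   = coef-remove-≡ b x
  ... | no b≢c  = cong₂ ℚ._+_ (a*δ≡0 a b≢c) (coef-remove-≡ b x)

  coef-remove-≢ : ∀ {w b} → w ≢ b → ∀ x → coef w (remove b x) ≡ coef w x
  coef-remove-≢ w≢b [] = refl
  coef-remove-≢ {w} {b} w≢b ((a , c) ∷ x) with b ≟ c
  ... | yes refl = begin
    coef w (remove b x)               ≡⟨ coef-remove-≢ w≢b x ⟩
    coef w x                          ≡⟨ ℚP.+-identityˡ (coef w x) ⟨
    0ℚ ℚ.+ coef w x                   ≡⟨ cong (ℚ._+ coef w x) (a*δ≡0 a w≢b) ⟨
    a ℚ.* δ w b ℚ.+ coef w x          ∎
    where open ≡-Reasoning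
  ... | no _ = cong (a ℚ.* δ w c ℚ.+_) (coef-remove-≢ w≢b x)

  remove-≐ : ∀ b {x y} → x ≐ y → remove b x ≐ remove b y
  remove-≐ b {x} {y} p = mk≐ λ w → case (w ≟ b)
    where
    case : ∀ {w} → Dec (w ≡ b) → coef w (remove b x) ≡ coef w (remove b y)
    case (yes refl) = trans (coef-remove-≡ b x) (sym (coef-remove-≡ b y))
    case {w} (no w≢b) = trans (coef-remove-≢ w≢b x) (trans (coef-≡ p w) (sym (coef-remove-≢ w≢b y)))

  module _ {R : FV B → FV B → Set} (isVR : IsVectorRelation R) where
    open IsVectorRelation isVR

    gather : ∀ b x → R x ((coef b x , b) ∷ remove b x)
    gather b [] = sym′ (zero′ b)
    gather b ((a , c) ∷ x) with b ≟ c
    ... | yes refl = trans′ (++-cong′ {x = (a , b) ∷ []} refl′ (gather b x))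
                       (subst (λ r → R ((a , b) ∷ (coef b x , b) ∷ remove b x) ((r , b) ∷ remove b x))
                              (cong (ℚ._+ coef b x) (sym (ℚP.*-identityʳ a)))
                              (++-cong′ (merge′ a (coef b x) b) refl′))
    ... | no b≢c = trans′ (++-cong′ {x = (a , c) ∷ []} refl′ (gather b x))
                     (subst (λ r → R ((a , c) ∷ (coef b x , b) ∷ remove b x) ((r , b) ∷ (a , c) ∷ remove b x))
                            (trans (sym (ℚP.+-identityˡ (coef b x))) (cong (ℚ._+ coef b x) (sym (ℚP.*-zeroʳ a))))
                            (++-cong′ {x = (a , c) ∷ (coef b x , b) ∷ []}
                                      (++-comm′ ((a , c) ∷ []) ((coef b x , b) ∷ [])) refl′))

    private
      shorter : ∀ b a x n → length x ≤ n → length (remove b ((a , b) ∷ x)) ≤ n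
      shorter b a x n lx with b ≟ b
      ... | yes _   = ℕP.≤-trans (length-remove b x) lx
      ... | no b≢b  = ⊥-elim (b≢b refl)

    ≐[]⇒R : ∀ n y → length y ≤ n → y ≐ [] → R y []
    ≐[]⇒R n [] _ _ = refl′
    ≐[]⇒R (suc n) ((a , b) ∷ y) (s≤s ly) p = trans′ (gather b ((a , b) ∷ y))
      (subst (λ r → R ((r , b) ∷ remove b ((a , b) ∷ y)) []) (sym (coef-≡ p b))
        (trans′ (++-cong′ {x = (0ℚ , b) ∷ []} (zero′ b) refl′)
                (≐[]⇒R n (remove b ((a , b) ∷ y)) (shorter b a y n ly) (remove-≐ b p))))

    ≐⇒R-bounded : ∀ n x y → length x ≤ n → x ≐ y → R x y
    ≐⇒R-bounded n [] y _ p = sym′ (≐[]⇒R (length y) y ℕP.≤-refl (≐-sym p))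
    ≐⇒R-bounded (suc n) ((a , b) ∷ x) y (s≤s lx) p =
      trans′ (gather b ((a , b) ∷ x))
        (trans′ (subst (λ r → R ((coef b ((a , b) ∷ x) , b) ∷ remove b ((a , b) ∷ x)) ((r , b) ∷ remove b y))
                       (coef-≡ p b)
                       (++-cong′ {x = (coef b ((a , b) ∷ x) , b) ∷ []} refl′
                          (≐⇒R-bounded n (remove b ((a , b) ∷ x)) (remove b y) (shorter b a x n lx) (remove-≐ b p))))
                (sym′ (gather b y)))

    ≐⇒R : ∀ {x y} → x ≐ y → R x y
    ≐⇒R {x} {y} = ≐⇒R-bounded (length x) x y ℕP.≤-refl

  record IsLinearRelation (R : FV B → FV B → Set) : Set where
    field
      isVectorRelation : IsVectorRelation R
      •-cong′          : ∀ q {x y} → R x y → R (q • x) (q • y)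

  ≐-isLinearRelation : IsLinearRelation _≐_
  ≐-isLinearRelation = record { isVectorRelation = ≐-isVectorRelation ; •-cong′ = •-cong }

-- Linear and bilinear maps

module _ {B C : Set} ⦃ _ : DecEq B ⦄ ⦃ _ : DecEq C ⦄ where

  record IsLinear (L : FV B → FV C) : Set where
    field
      ++-homo : ∀ x y → L (x ++ y) ≐ L x ++ L y
      []-homo : L [] ≐ []
      •-homo  : ∀ q x → L (q • x) ≐ q • L x
      ≐-cong  : ∀ {x y} → x ≐ y → L x ≐ L y

  open IsLinear public

  extend : (B → FV C) → FV B → FV C
  extend f = concatMap (λ p → proj₁ p • f (proj₂ p))

  extend-++ : ∀ f x y → extend f (x ++ y) ≡ extend f x ++ extend f y
  extend-++ f = ListP.concatMap-++ _

  extend-⟨⟩ : ∀ f b → extend f ⟨ b ⟩ ≐ f b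
  extend-⟨⟩ f b = ≐-trans (≡⇒≐ (ListP.++-identityʳ (1ℚ • f b))) (1•-identity (f b))

  extend-• : ∀ f q x → extend f (q • x) ≐ q • extend f x
  extend-• f q []            = ≐-refl
  extend-• f q ((a , b) ∷ x) = ≐-trans (++-cong (≐-sym (•-• q a (f b))) (extend-• f q x))
                                       (≡⇒≐ (sym (•-++ q (a • f b) (extend f x))))

  extend-≐ : ∀ f {x y} → x ≐ y → extend f x ≐ extend f y
  extend-≐ f = ≐⇒R record
    { refl′ = ≐-refl ; sym′ = ≐-sym ; trans′ = ≐-trans
    ; ++-cong′ = λ {x} {x′} {y} {y′} p q →
        ≐-trans (≡⇒≐ (extend-++ f x y)) (≐-trans (++-cong p q) (≡⇒≐ (sym (extend-++ f x′ y′))))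
    ; ++-comm′ = λ x y →
        ≐-trans (≡⇒≐ (extend-++ f x y)) (≐-trans (++-comm (extend f x) (extend f y)) (≡⇒≐ (sym (extend-++ f y x))))
    ; merge′ = λ a c b → ≐-trans (≡⇒≐ (cong (a • f b ++_) (ListP.++-identityʳ (c • f b))))
                           (≐-trans (•-distribʳ a c (f b)) (≡⇒≐ (sym (ListP.++-identityʳ ((a ℚ.+ c) • f b)))))
    ; zero′ = λ b → ≐-trans (≡⇒≐ (ListP.++-identityʳ (0ℚ • f b))) (0•-zero (f b)) }

  extend-isLinear : ∀ f → IsLinear (extend f)
  extend-isLinear f = record
    { ++-homo = λ x y → ≡⇒≐ (extend-++ f x y) ; []-homo = ≐-refl
    ; •-homo = extend-• f ; ≐-cong = extend-≐ f }

  linear-single : ∀ {L} → IsLinear L → ∀ a b → L ((a , b) ∷ []) ≐ a • L ⟨ b ⟩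
  linear-single L-lin a b = ≐-trans (≐-cong L-lin (single≐• a b)) (•-homo L-lin a ⟨ b ⟩)

  module _ {R : FV C → FV C → Set} (isLR : IsLinearRelation R) where
    open IsLinearRelation isLR
    open IsVectorRelation isVectorRelation

    linear-unique-up-to : ∀ {L K} → IsLinear L → IsLinear K →
                          (∀ b → R (L ⟨ b ⟩) (K ⟨ b ⟩)) → ∀ x → R (L x) (K x)
    linear-unique-up-to L-lin K-lin p [] = ≐⇒R isVectorRelation (≐-trans ([]-homo L-lin) (≐-sym ([]-homo K-lin)))
    linear-unique-up-to {L} {K} L-lin K-lin p ((a , b) ∷ x) =
      trans′ (≐⇒R isVectorRelation (≐-trans (++-homo L-lin ((a , b) ∷ []) x) (++-cong (linear-single L-lin a b) ≐-refl)))
        (trans′ (++-cong′ (•-cong′ a (p b)) (linear-unique-up-to L-lin K-lin p x))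
          (≐⇒R isVectorRelation (≐-sym (≐-trans (++-homo K-lin ((a , b) ∷ []) x) (++-cong (linear-single K-lin a b) ≐-refl)))))

  linear-unique : ∀ {L K} → IsLinear L → IsLinear K → (∀ b → L ⟨ b ⟩ ≐ K ⟨ b ⟩) → ∀ x → L x ≐ K x
  linear-unique = linear-unique-up-to ≐-isLinearRelation

module _ {B : Set} ⦃ _ : DecEq B ⦄ where

  id-isLinear : IsLinear {B} (λ x → x)
  id-isLinear = record { ++-homo = λ _ _ → ≐-refl ; []-homo = ≐-refl ; •-homo = λ _ _ → ≐-refl ; ≐-cong = λ p → p }

module _ {B C : Set} ⦃ _ : DecEq B ⦄ ⦃ _ : DecEq C ⦄ where

  []-isLinear : IsLinear {B} {C} (λ _ → [])
  []-isLinear = record { ++-homo = λ _ _ → ≐-refl ; []-homo = ≐-refl ; •-homo = λ _ _ → ≐-refl ; ≐-cong = λ _ → ≐-refl }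

  +-isLinear : ∀ {L K : FV B → FV C} → IsLinear L → IsLinear K → IsLinear (λ x → L x ++ K x)
  +-isLinear {L} {K} L-lin K-lin = record
    { ++-homo = λ x y → ≐-trans (++-cong (++-homo L-lin x y) (++-homo K-lin x y)) (++-interchange (L x) (L y) (K x) (K y))
    ; []-homo = ++-cong ([]-homo L-lin) ([]-homo K-lin)
    ; •-homo  = λ q x → ≐-trans (++-cong (•-homo L-lin q x) (•-homo K-lin q x)) (≡⇒≐ (sym (•-++ q (L x) (K x))))
    ; ≐-cong  = λ p → ++-cong (≐-cong L-lin p) (≐-cong K-lin p) }

  •-isLinear : ∀ {L : FV B → FV C} q → IsLinear L → IsLinear (λ x → q • L x)
  •-isLinear {L} q L-lin = record
    { ++-homo = λ x y → ≐-trans (•-cong q (++-homo L-lin x y)) (≡⇒≐ (•-++ q (L x) (L y)))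
    ; []-homo = •-cong q ([]-homo L-lin)
    ; •-homo  = λ r x → ≐-trans (•-cong q (•-homo L-lin r x)) (•-comm q r (L x))
    ; ≐-cong  = λ p → •-cong q (≐-cong L-lin p) }

module _ {B C D : Set} ⦃ _ : DecEq B ⦄ ⦃ _ : DecEq C ⦄ ⦃ _ : DecEq D ⦄ where

  ∘-isLinear : ∀ {L : FV C → FV D} {K : FV B → FV C} → IsLinear L → IsLinear K → IsLinear (λ x → L (K x))
  ∘-isLinear {L} {K} L-lin K-lin = record
    { ++-homo = λ x y → ≐-trans (≐-cong L-lin (++-homo K-lin x y)) (++-homo L-lin (K x) (K y))
    ; []-homo = ≐-trans (≐-cong L-lin ([]-homo K-lin)) ([]-homo L-lin)
    ; •-homo  = λ q x → ≐-trans (≐-cong L-lin (•-homo K-lin q x)) (•-homo L-lin q (K x))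
    ; ≐-cong  = λ p → ≐-cong L-lin (≐-cong K-lin p) }

module _ {B C : Set} ⦃ _ : DecEq B ⦄ ⦃ _ : DecEq C ⦄ where

  extend-cong : ∀ {f g : B → FV C} → (∀ b → f b ≐ g b) → ∀ x → extend f x ≐ extend g x
  extend-cong p []            = ≐-refl
  extend-cong p ((a , b) ∷ x) = ++-cong (•-cong a (p b)) (extend-cong p x)

  extend-++ᶠ : ∀ (f g : B → FV C) x → extend (λ b → f b ++ g b) x ≐ extend f x ++ extend g x
  extend-++ᶠ f g []            = ≐-refl
  extend-++ᶠ f g ((a , b) ∷ x) =
    ≐-trans (++-cong (≡⇒≐ (•-++ a (f b) (g b))) (extend-++ᶠ f g x))
            (++-interchange (a • f b) (a • g b) (extend f x) (extend g x))

  extend-•ᶠ : ∀ q (f : B → FV C) x → extend (λ b → q • f b) x ≐ q • extend f x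
  extend-•ᶠ q f []            = ≐-refl
  extend-•ᶠ q f ((a , b) ∷ x) =
    ≐-trans (++-cong (•-comm a q (f b)) (extend-•ᶠ q f x)) (≡⇒≐ (sym (•-++ q (a • f b) (extend f x))))

  extend-[]ᶠ : ∀ x → extend {B} {C} (λ _ → []) x ≡ []
  extend-[]ᶠ []            = refl
  extend-[]ᶠ ((a , b) ∷ x) = extend-[]ᶠ x

module _ {A B : Set} ⦃ _ : DecEq B ⦄ where

  concatMap-≐ : ∀ {f g : A → FV B} → (∀ a → f a ≐ g a) → ∀ xs → concatMap f xs ≐ concatMap g xs
  concatMap-≐ p []       = ≐-refl
  concatMap-≐ p (a ∷ xs) = ++-cong (p a) (concatMap-≐ p xs)

module _ {B C : Set} ⦃ _ : DecEq B ⦄ ⦃ _ : DecEq C ⦄ where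

  IsLinear-≐ : ∀ {L K : FV B → FV C} → (∀ x → L x ≐ K x) → IsLinear K → IsLinear L
  IsLinear-≐ {L} {K} L≐K K-lin = record
    { ++-homo = λ x y → ≐-trans (L≐K (x ++ y)) (≐-trans (++-homo K-lin x y) (++-cong (≐-sym (L≐K x)) (≐-sym (L≐K y))))
    ; []-homo = ≐-trans (L≐K []) ([]-homo K-lin)
    ; •-homo  = λ q x → ≐-trans (L≐K (q • x)) (≐-trans (•-homo K-lin q x) (•-cong q (≐-sym (L≐K x))))
    ; ≐-cong  = λ {x} {y} p → ≐-trans (L≐K x) (≐-trans (≐-cong K-lin p) (≐-sym (L≐K y))) }

module _ {B₁ B₂ C : Set} ⦃ _ : DecEq B₁ ⦄ ⦃ _ : DecEq B₂ ⦄ ⦃ _ : DecEq C ⦄ where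

  extend₂ : (B₁ → B₂ → FV C) → FV B₁ → FV B₂ → FV C
  extend₂ F x y = extend (λ b → extend (F b) y) x

  extend₂-linearˡ : ∀ F y → IsLinear (λ x → extend₂ F x y)
  extend₂-linearˡ F y = extend-isLinear (λ b → extend (F b) y)

  extend₂-linearʳ : ∀ F x → IsLinear (extend₂ F x)
  extend₂-linearʳ F x = record
    { ++-homo = λ y y′ → ≐-trans (extend-cong (λ b → ≡⇒≐ (extend-++ (F b) y y′)) x)
                                 (extend-++ᶠ (λ b → extend (F b) y) (λ b → extend (F b) y′) x)
    ; []-homo = ≡⇒≐ (extend-[]ᶠ x)
    ; •-homo  = λ q y → ≐-trans (extend-cong (λ b → extend-• (F b) q y) x) (extend-•ᶠ q (λ b → extend (F b) y) x)
    ; ≐-cong  = λ p → extend-cong (λ b → extend-≐ (F b) p) x }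

  extend₂-⟨⟩ : ∀ F b c → extend₂ F ⟨ b ⟩ ⟨ c ⟩ ≐ F b c
  extend₂-⟨⟩ F b c = ≐-trans (extend-⟨⟩ (λ b → extend (F b) ⟨ c ⟩) b) (extend-⟨⟩ (F b) c)

  extend₂-pairs : ∀ F x y →
    concatMap (λ p → concatMap (λ q → (proj₁ p ℚ.* proj₁ q) • F (proj₂ p) (proj₂ q)) y) x ≐ extend₂ F x y
  extend₂-pairs F x y = concatMap-≐ (λ { (a , b) → inner a b y }) x
    where
    inner : ∀ a b y → concatMap (λ q → (a ℚ.* proj₁ q) • F b (proj₂ q)) y ≐ a • extend (F b) y
    inner a b []            = ≐-refl
    inner a b ((c , d) ∷ y) = ≐-trans (++-cong (≐-sym (•-• a c (F b d))) (inner a b y))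
                                      (≡⇒≐ (sym (•-++ a (c • F b d) (extend (F b) y))))

  module _ {R : FV C → FV C → Set} (isLR : IsLinearRelation R) where

    bilinear-unique-up-to : ∀ {F K : FV B₁ → FV B₂ → FV C} →
      (∀ y → IsLinear (λ x → F x y)) → (∀ x → IsLinear (F x)) →
      (∀ y → IsLinear (λ x → K x y)) → (∀ x → IsLinear (K x)) →
      (∀ b c → R (F ⟨ b ⟩ ⟨ c ⟩) (K ⟨ b ⟩ ⟨ c ⟩)) → ∀ x y → R (F x y) (K x y)
    bilinear-unique-up-to Fˡ Fʳ Kˡ Kʳ p x y =
      linear-unique-up-to isLR (Fˡ y) (Kˡ y) (λ b → linear-unique-up-to isLR (Fʳ ⟨ b ⟩) (Kʳ ⟨ b ⟩) (p b) y) x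

  bilinear-unique : ∀ {F K : FV B₁ → FV B₂ → FV C} →
    (∀ y → IsLinear (λ x → F x y)) → (∀ x → IsLinear (F x)) →
    (∀ y → IsLinear (λ x → K x y)) → (∀ x → IsLinear (K x)) →
    (∀ b c → F ⟨ b ⟩ ⟨ c ⟩ ≐ K ⟨ b ⟩ ⟨ c ⟩) → ∀ x y → F x y ≐ K x y
  bilinear-unique = bilinear-unique-up-to ≐-isLinearRelation

module _ {B : Set} ⦃ _ : DecEq B ⦄ {_∙_ : FV B → FV B → FV B}
         (∙-linearˡ : ∀ y → IsLinear (_∙ y)) (∙-linearʳ : ∀ x → IsLinear (x ∙_)) where

  leibniz-from-basis : ∀ {L} → IsLinear L → (∀ b c → L (⟨ b ⟩ ∙ ⟨ c ⟩) ≐ L ⟨ b ⟩ ∙ ⟨ c ⟩ ++ ⟨ b ⟩ ∙ L ⟨ c ⟩) →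
                       ∀ x y → L (x ∙ y) ≐ L x ∙ y ++ x ∙ L y
  leibniz-from-basis {L} L-lin = bilinear-unique
    (λ y → ∘-isLinear L-lin (∙-linearˡ y)) (λ x → ∘-isLinear L-lin (∙-linearʳ x))
    (λ y → +-isLinear (∘-isLinear (∙-linearˡ y) L-lin) (∙-linearˡ (L y)))
    (λ x → +-isLinear (∙-linearʳ (L x)) (∘-isLinear (∙-linearʳ x) L-lin))

-- The magma algebra M(V)_ℚ

_≟M_ : DecidableEquality M
v k ≟M v l with k ℕ.≟ l
... | yes refl = yes refl
... | no k≢l   = no λ { refl → k≢l refl }
v _ ≟M (_ ⋆ _) = no λ ()
(_ ⋆ _) ≟M v _ = no λ ()
(t ⋆ u) ≟M (t′ ⋆ u′) with t ≟M t′ | u ≟M u′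
... | yes refl | yes refl = yes refl
... | no t≢t′  | _        = no λ { refl → t≢t′ refl }
... | yes _    | no u≢u′  = no λ { refl → u≢u′ refl }

instance
  M-decEq : DecEq M
  M-decEq = isDecEquivalence _≟M_

  ℕ-decEq : DecEq ℕ
  ℕ-decEq = isDecEquivalence ℕ._≟_

  ℕ×M-decEq : DecEq (ℕ × M)
  ℕ×M-decEq = isDecEquivalence (≡-dec ℕ._≟_ _≟M_)

⋆ₗ≐extend₂ : ∀ x y → x ⋆ₗ y ≐ extend₂ (λ t u → ⟨ t ⋆ u ⟩) x y
⋆ₗ≐extend₂ x y = ≐-trans (concatMap-≐ (λ { (a , t) → row a t }) x) (extend₂-pairs (λ t u → ⟨ t ⋆ u ⟩) x y)
  where
  row : ∀ a t → map (λ q → (a ℚ.* proj₁ q , t ⋆ proj₂ q)) y ≐ concatMap (λ q → (a ℚ.* proj₁ q) • ⟨ t ⋆ proj₂ q ⟩) y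
  row a t = ≐-trans (≡⇒≐ (trans (sym (ListP.concatMap-pure (map _ y))) (ListP.concatMap-map _ _ y)))
                    (concatMap-≐ (λ q → single≐• (a ℚ.* proj₁ q) (t ⋆ proj₂ q)) y)

⋆-linearˡ : ∀ y → IsLinear (_⋆ₗ y)
⋆-linearˡ y = IsLinear-≐ (λ x → ⋆ₗ≐extend₂ x y) (extend₂-linearˡ (λ t u → ⟨ t ⋆ u ⟩) y)

⋆-linearʳ : ∀ x → IsLinear (x ⋆ₗ_)
⋆-linearʳ x = IsLinear-≐ (⋆ₗ≐extend₂ x) (extend₂-linearʳ (λ t u → ⟨ t ⋆ u ⟩) x)

⋆-cong≐ : ∀ {x x′ y y′} → x ≐ x′ → y ≐ y′ → x ⋆ₗ y ≐ x′ ⋆ₗ y′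
⋆-cong≐ {x′ = x′} {y = y} p q = ≐-trans (≐-cong (⋆-linearˡ y) p) (≐-cong (⋆-linearʳ x′) q)

δ-⋆ : ∀ w₁ w₂ t u → δ (w₁ ⋆ w₂) (t ⋆ u) ≡ δ w₁ t ℚ.* δ w₂ u
δ-⋆ w₁ w₂ t u = by-cases (w₁ ≟M t) (w₂ ≟M u)
  where
  by-cases : Dec (w₁ ≡ t) → Dec (w₂ ≡ u) → δ (w₁ ⋆ w₂) (t ⋆ u) ≡ δ w₁ t ℚ.* δ w₂ u
  by-cases (yes refl) (yes refl) = trans (δ-refl (w₁ ⋆ w₂)) (sym (cong₂ ℚ._*_ (δ-refl w₁) (δ-refl w₂)))
  by-cases (no w₁≢t)  _          = trans (δ-≢ {w = w₁ ⋆ w₂} {b = t ⋆ u} λ { refl → w₁≢t refl })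
                                         (sym (trans (cong (ℚ._* δ w₂ u) (δ-≢ w₁≢t)) (ℚP.*-zeroˡ (δ w₂ u))))
  by-cases (yes _)    (no w₂≢u)  = trans (δ-≢ {w = w₁ ⋆ w₂} {b = t ⋆ u} λ { refl → w₂≢u refl })
                                         (sym (trans (cong (δ w₁ t ℚ.*_) (δ-≢ w₂≢u)) (ℚP.*-zeroʳ (δ w₁ t))))

coef-v-⋆ₗ : ∀ k x y → coef (v k) (x ⋆ₗ y) ≡ 0ℚ
coef-v-⋆ₗ k []            y = refl
coef-v-⋆ₗ k ((a , t) ∷ x) y = trans (coef-++ (v k) (map (λ q → (a ℚ.* proj₁ q , t ⋆ proj₂ q)) y) (x ⋆ₗ y))
                                    (trans (cong₂ ℚ._+_ (row y) (coef-v-⋆ₗ k x y)) (ℚP.+-identityʳ 0ℚ))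
  where
  row : ∀ y → coef (v k) (map (λ q → (a ℚ.* proj₁ q , t ⋆ proj₂ q)) y) ≡ 0ℚ
  row []            = refl
  row ((b , u) ∷ y) = trans (cong₂ ℚ._+_ (a*δ≡0 (a ℚ.* b) {v k} {t ⋆ u} (λ ())) (row y)) (ℚP.+-identityʳ 0ℚ)

coef-⋆-⋆ₗ : ∀ w₁ w₂ x y → coef (w₁ ⋆ w₂) (x ⋆ₗ y) ≡ coef w₁ x ℚ.* coef w₂ y
coef-⋆-⋆ₗ w₁ w₂ []            y = sym (ℚP.*-zeroˡ (coef w₂ y))
coef-⋆-⋆ₗ w₁ w₂ ((a , t) ∷ x) y = begin
  coef (w₁ ⋆ w₂) (r ++ x ⋆ₗ y)
    ≡⟨ coef-++ (w₁ ⋆ w₂) r (x ⋆ₗ y) ⟩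
  coef (w₁ ⋆ w₂) r ℚ.+ coef (w₁ ⋆ w₂) (x ⋆ₗ y)
    ≡⟨ cong₂ ℚ._+_ (row y) (coef-⋆-⋆ₗ w₁ w₂ x y) ⟩
  a ℚ.* δ w₁ t ℚ.* coef w₂ y ℚ.+ coef w₁ x ℚ.* coef w₂ y
    ≡⟨ ℚP.*-distribʳ-+ (coef w₂ y) (a ℚ.* δ w₁ t) (coef w₁ x) ⟨
  (a ℚ.* δ w₁ t ℚ.+ coef w₁ x) ℚ.* coef w₂ y ∎
  where
  open ≡-Reasoning
  r = map (λ q → (a ℚ.* proj₁ q , t ⋆ proj₂ q)) y
  row : ∀ y → coef (w₁ ⋆ w₂) (map (λ q → (a ℚ.* proj₁ q , t ⋆ proj₂ q)) y) ≡ a ℚ.* δ w₁ t ℚ.* coef w₂ y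
  row []            = sym (ℚP.*-zeroʳ (a ℚ.* δ w₁ t))
  row ((b , u) ∷ y) = begin
    a ℚ.* b ℚ.* δ (w₁ ⋆ w₂) (t ⋆ u) ℚ.+ coef (w₁ ⋆ w₂) (map (λ q → (a ℚ.* proj₁ q , t ⋆ proj₂ q)) y)
      ≡⟨ cong₂ (λ d r → a ℚ.* b ℚ.* d ℚ.+ r) (δ-⋆ w₁ w₂ t u) (row y) ⟩
    a ℚ.* b ℚ.* (δ w₁ t ℚ.* δ w₂ u) ℚ.+ a ℚ.* δ w₁ t ℚ.* coef w₂ y
      ≡⟨ lemma a b (δ w₁ t) (δ w₂ u) (coef w₂ y) ⟩
    a ℚ.* δ w₁ t ℚ.* (b ℚ.* δ w₂ u ℚ.+ coef w₂ y) ∎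
    where
    lemma : ∀ a b d₁ d₂ c → a ℚ.* b ℚ.* (d₁ ℚ.* d₂) ℚ.+ a ℚ.* d₁ ℚ.* c ≡ a ℚ.* d₁ ℚ.* (b ℚ.* d₂ ℚ.+ c)
    lemma = solve-∀ ℚ-ring

-- Identities in M(V)_ℚ are checked coefficientwise: coefᴱ computes the coefficients of an
-- expression symbolically, reducing ≐ to an identity between rationals.
infixl 6 _⊕ᴱ_
infixl 7 _⋆ᴱ_
infix  8 _·ᴱ_

data Expr : Set where
  ‵_   : Lin → Expr
  _⊕ᴱ_ : Expr → Expr → Expr
  _⋆ᴱ_ : Expr → Expr → Expr
  _·ᴱ_ : ℚ → Expr → Expr

⟦_⟧ᴱ : Expr → Lin
⟦ ‵ x ⟧ᴱ    = x
⟦ e ⊕ᴱ f ⟧ᴱ = ⟦ e ⟧ᴱ ⊕ ⟦ f ⟧ᴱ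
⟦ e ⋆ᴱ f ⟧ᴱ = ⟦ e ⟧ᴱ ⋆ₗ ⟦ f ⟧ᴱ
⟦ q ·ᴱ e ⟧ᴱ = q · ⟦ e ⟧ᴱ

coefᴱ : M → Expr → ℚ
coefᴱ w         (‵ x)    = coef w x
coefᴱ w         (e ⊕ᴱ f) = coefᴱ w e ℚ.+ coefᴱ w f
coefᴱ (v k)     (e ⋆ᴱ f) = 0ℚ
coefᴱ (w₁ ⋆ w₂) (e ⋆ᴱ f) = coefᴱ w₁ e ℚ.* coefᴱ w₂ f
coefᴱ w         (q ·ᴱ e) = q ℚ.* coefᴱ w e

coef-⟦⟧ᴱ : ∀ w e → coef w ⟦ e ⟧ᴱ ≡ coefᴱ w e
coef-⟦⟧ᴱ w         (‵ x)    = refl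
coef-⟦⟧ᴱ w         (e ⊕ᴱ f) = trans (coef-++ w ⟦ e ⟧ᴱ ⟦ f ⟧ᴱ) (cong₂ ℚ._+_ (coef-⟦⟧ᴱ w e) (coef-⟦⟧ᴱ w f))
coef-⟦⟧ᴱ (v k)     (e ⋆ᴱ f) = coef-v-⋆ₗ k ⟦ e ⟧ᴱ ⟦ f ⟧ᴱ
coef-⟦⟧ᴱ (w₁ ⋆ w₂) (e ⋆ᴱ f) = trans (coef-⋆-⋆ₗ w₁ w₂ ⟦ e ⟧ᴱ ⟦ f ⟧ᴱ) (cong₂ ℚ._*_ (coef-⟦⟧ᴱ w₁ e) (coef-⟦⟧ᴱ w₂ f))
coef-⟦⟧ᴱ w         (q ·ᴱ e) = trans (coef-• w q ⟦ e ⟧ᴱ) (cong (q ℚ.*_) (coef-⟦⟧ᴱ w e))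

≐-byCoef : ∀ e f → (∀ w → coefᴱ w e ≡ coefᴱ w f) → ⟦ e ⟧ᴱ ≐ ⟦ f ⟧ᴱ
≐-byCoef e f p = mk≐ λ w → trans (coef-⟦⟧ᴱ w e) (trans (p w) (sym (coef-⟦⟧ᴱ w f)))

-- The Lie relation ≈

≈-setoid : Setoid 0ℓ 0ℓ
≈-setoid = record { Carrier = Lin ; _≈_ = _≈_
                  ; isEquivalence = record { refl = ≈-refl ; sym = ≈-sym ; trans = ≈-trans } }

module ≈-Reasoning = Relation.Binary.Reasoning.Setoid ≈-setoid

≈-isVectorRelation : IsVectorRelation _≈_
≈-isVectorRelation = record
  { refl′ = ≈-refl ; sym′ = ≈-sym ; trans′ = ≈-trans ; ++-cong′ = ⊕-cong
  ; ++-comm′ = ⊕-swap ; merge′ = merge ; zero′ = zero-co }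

≐⇒≈ : ∀ {x y} → x ≐ y → x ≈ y
≐⇒≈ = ≐⇒R ≈-isVectorRelation

⋆-cong : ∀ {x x′ y y′} → x ≈ x′ → y ≈ y′ → x ⋆ₗ y ≈ x′ ⋆ₗ y′
⋆-cong {x′ = x′} {y = y} p q = ≈-trans (⋆-congˡ y p) (⋆-congʳ x′ q)

jacobiator : Lin → Lin → Lin → Lin
jacobiator x y z = x ⋆ₗ (y ⋆ₗ z) ⊕ y ⋆ₗ (z ⋆ₗ x) ⊕ z ⋆ₗ (x ⋆ₗ y)

module _ {C : Set} ⦃ _ : DecEq C ⦄ {R : FV C → FV C → Set} (isVR : IsVectorRelation R)
         {L : Lin → FV C} (L-lin : IsLinear L)
         (⋆ˡ-resp : ∀ {x x′} y → x ≈ x′ → R (L x) (L x′) → R (L (x ⋆ₗ y)) (L (x′ ⋆ₗ y)))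
         (⋆ʳ-resp : ∀ x {y y′} → y ≈ y′ → R (L y) (L y′) → R (L (x ⋆ₗ y)) (L (x ⋆ₗ y′)))
         (alt-resp : ∀ x → R (L (x ⋆ₗ x)) (L 𝟘))
         (jacobi-resp : ∀ x y z → R (L (jacobiator x y z)) (L 𝟘)) where
  open IsVectorRelation isVR

  linear-respects-≈ : ∀ {x y} → x ≈ y → R (L x) (L y)
  linear-respects-≈ ≈-refl          = refl′
  linear-respects-≈ (≈-sym p)       = sym′ (linear-respects-≈ p)
  linear-respects-≈ (≈-trans p q)   = trans′ (linear-respects-≈ p) (linear-respects-≈ q)
  linear-respects-≈ (⊕-cong {x} {x′} {y} {y′} p q) =
    trans′ (≐⇒R isVR (++-homo L-lin x y))
      (trans′ (++-cong′ (linear-respects-≈ p) (linear-respects-≈ q)) (≐⇒R isVR (≐-sym (++-homo L-lin x′ y′))))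
  linear-respects-≈ (⊕-swap x y)    =
    trans′ (≐⇒R isVR (++-homo L-lin x y))
      (trans′ (++-comm′ (L x) (L y)) (≐⇒R isVR (≐-sym (++-homo L-lin y x))))
  linear-respects-≈ (merge a b t)   = ≐⇒R isVR (≐-cong L-lin (merge≐ a b t))
  linear-respects-≈ (zero-co t)     = ≐⇒R isVR (≐-cong L-lin (zero≐ t))
  linear-respects-≈ (⋆-congˡ y p)   = ⋆ˡ-resp y p (linear-respects-≈ p)
  linear-respects-≈ (⋆-congʳ x p)   = ⋆ʳ-resp x p (linear-respects-≈ p)
  linear-respects-≈ (alt x)         = alt-resp x
  linear-respects-≈ (jacobi x y z)  = jacobi-resp x y z

negate-zero : ∀ {x} → x ≈ 𝟘 → (ℚ.- 1ℚ) · x ≈ 𝟘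
negate-zero {x} x≈0 = begin
  (ℚ.- 1ℚ) · x           ≈⟨ ≐⇒≈ (≡⇒≐ (sym (ListP.++-identityʳ ((ℚ.- 1ℚ) · x)))) ⟩
  (ℚ.- 1ℚ) · x ⊕ 𝟘       ≈⟨ ⊕-cong ≈-refl (≈-sym x≈0) ⟩
  (ℚ.- 1ℚ) · x ⊕ x       ≈⟨ ≐⇒≈ (•-inverse x) ⟩
  𝟘                      ∎
  where open ≈-Reasoning

·-square-alt : ∀ c x → (c ℚ.* c) · (x ⋆ₗ x) ≈ 𝟘
·-square-alt c x = ≈-trans (≐⇒≈ (≐-sym cx⋆cx)) (alt (c · x))
  where
  cx⋆cx : (c · x) ⋆ₗ (c · x) ≐ (c ℚ.* c) · (x ⋆ₗ x)
  cx⋆cx = ≐-trans (•-homo (⋆-linearˡ (c · x)) c x)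
            (≐-trans (•-cong c (•-homo (⋆-linearʳ x) c x)) (•-• c c (x ⋆ₗ x)))

-- Every rational is a difference of two squares: q = a² − b² with a = (q+1)/2, b = (q−1)/2.
·-alt : ∀ q x → q · (x ⋆ₗ x) ≈ 𝟘
·-alt q x = begin
  q · X                                            ≈⟨ ≐⇒≈ split ⟩
  (a ℚ.* a) · X ⊕ (ℚ.- 1ℚ) · ((b ℚ.* b) · X)       ≈⟨ ⊕-cong (·-square-alt a x) (negate-zero (·-square-alt b x)) ⟩
  𝟘                                                ∎
  where
  open ≈-Reasoning
  X = x ⋆ₗ x
  a = (q ℚ.+ 1ℚ) ℚ.* ½
  b = (q ℚ.- 1ℚ) ℚ.* ½
  squares : q ≡ a ℚ.* a ℚ.+ (ℚ.- 1ℚ) ℚ.* (b ℚ.* b)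
  squares = lemma q
    where
    lemma : ∀ q → q ≡ (q ℚ.+ 1ℚ) ℚ.* ½ ℚ.* ((q ℚ.+ 1ℚ) ℚ.* ½) ℚ.+ (ℚ.- 1ℚ) ℚ.* ((q ℚ.- 1ℚ) ℚ.* ½ ℚ.* ((q ℚ.- 1ℚ) ℚ.* ½))
    lemma = solve-∀ ℚ-ring
  split : q · X ≐ (a ℚ.* a) · X ⊕ (ℚ.- 1ℚ) · ((b ℚ.* b) · X)
  split = ≐-trans (•-cong-scalar X squares)
            (≐-trans (≐-sym (•-distribʳ (a ℚ.* a) ((ℚ.- 1ℚ) ℚ.* (b ℚ.* b)) X))
                     (++-cong ≐-refl (≐-sym (•-• (ℚ.- 1ℚ) (b ℚ.* b) X))))

·-jacobi : ∀ q x y z → q · jacobiator x y z ≐ jacobiator (q · x) y z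
·-jacobi q x y z = begin
  q · (x ⋆ₗ (y ⋆ₗ z) ⊕ y ⋆ₗ (z ⋆ₗ x) ⊕ z ⋆ₗ (x ⋆ₗ y))
    ≡⟨ trans (•-++ q (x ⋆ₗ (y ⋆ₗ z) ⊕ y ⋆ₗ (z ⋆ₗ x)) (z ⋆ₗ (x ⋆ₗ y)))
             (cong (_⊕ q · (z ⋆ₗ (x ⋆ₗ y))) (•-++ q (x ⋆ₗ (y ⋆ₗ z)) (y ⋆ₗ (z ⋆ₗ x)))) ⟩
  q · (x ⋆ₗ (y ⋆ₗ z)) ⊕ q · (y ⋆ₗ (z ⋆ₗ x)) ⊕ q · (z ⋆ₗ (x ⋆ₗ y))
    ≋⟨ ++-cong (++-cong (≐-sym (•-homo (⋆-linearˡ (y ⋆ₗ z)) q x))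
                        (≐-trans (≐-sym (•-homo (⋆-linearʳ y) q (z ⋆ₗ x))) (≐-cong (⋆-linearʳ y) (≐-sym (•-homo (⋆-linearʳ z) q x)))))
               (≐-trans (≐-sym (•-homo (⋆-linearʳ z) q (x ⋆ₗ y))) (≐-cong (⋆-linearʳ z) (≐-sym (•-homo (⋆-linearˡ y) q x)))) ⟩
  (q · x) ⋆ₗ (y ⋆ₗ z) ⊕ y ⋆ₗ (z ⋆ₗ (q · x)) ⊕ z ⋆ₗ ((q · x) ⋆ₗ y) ∎
  where open ≐-Reasoning

·-cong : ∀ q {x y} → x ≈ y → q · x ≈ q · y
·-cong q = linear-respects-≈ ≈-isVectorRelation (•-isLinear q id-isLinear)
  (λ {x} {x′} y _ q·x≈q·x′ → ≈-trans (≐⇒≈ (≐-sym (•-homo (⋆-linearˡ y) q x)))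
                              (≈-trans (⋆-congˡ y q·x≈q·x′) (≐⇒≈ (•-homo (⋆-linearˡ y) q x′))))
  (λ x {y} {y′} _ q·y≈q·y′ → ≈-trans (≐⇒≈ (≐-sym (•-homo (⋆-linearʳ x) q y)))
                              (≈-trans (⋆-congʳ x q·y≈q·y′) (≐⇒≈ (•-homo (⋆-linearʳ x) q y′))))
  (·-alt q)
  (λ x y z → ≈-trans (≐⇒≈ (·-jacobi q x y z)) (jacobi (q · x) y z))

≈-isLinearRelation : IsLinearRelation _≈_
≈-isLinearRelation = record { isVectorRelation = ≈-isVectorRelation ; •-cong′ = ·-cong }

⋆-anticomm : ∀ x y → x ⋆ₗ y ⊕ y ⋆ₗ x ≈ 𝟘
⋆-anticomm x y = begin
  x ⋆ₗ y ⊕ y ⋆ₗ x                                     ≈⟨ ≐⇒≈ (≡⇒≐ (sym (ListP.++-identityʳ (x ⋆ₗ y ⊕ y ⋆ₗ x)))) ⟩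
  𝟘 ⊕ (x ⋆ₗ y ⊕ y ⋆ₗ x) ⊕ 𝟘                           ≈⟨ ⊕-cong (⊕-cong (≈-sym (alt x)) ≈-refl) (≈-sym (alt y)) ⟩
  x ⋆ₗ x ⊕ (x ⋆ₗ y ⊕ y ⋆ₗ x) ⊕ y ⋆ₗ y                 ≈⟨ ≐⇒≈ (≐-sym expand) ⟩
  (x ⊕ y) ⋆ₗ (x ⊕ y)                                  ≈⟨ alt (x ⊕ y) ⟩
  𝟘                                                   ∎
  where
  open ≈-Reasoning
  expand : (x ⊕ y) ⋆ₗ (x ⊕ y) ≐ x ⋆ₗ x ⊕ (x ⋆ₗ y ⊕ y ⋆ₗ x) ⊕ y ⋆ₗ y
  expand = ≐-trans (++-homo (⋆-linearˡ (x ⊕ y)) x y)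
    (≐-trans (++-cong (++-homo (⋆-linearʳ x) x y) (++-homo (⋆-linearʳ y) x y))
             (≡⇒≐ (trans (ListP.++-assoc (x ⋆ₗ x) (x ⋆ₗ y) (y ⋆ₗ x ⊕ y ⋆ₗ y))
                  (trans (cong (x ⋆ₗ x ⊕_) (sym (ListP.++-assoc (x ⋆ₗ y) (y ⋆ₗ x) (y ⋆ₗ y))))
                         (sym (ListP.++-assoc (x ⋆ₗ x) (x ⋆ₗ y ⊕ y ⋆ₗ x) (y ⋆ₗ y)))))))

⋆-antisym : ∀ x y → x ⋆ₗ y ≈ (ℚ.- 1ℚ) · (y ⋆ₗ x)
⋆-antisym x y = ≈-trans (≐⇒≈ (≐-add-sub (x ⋆ₗ y) (y ⋆ₗ x))) (⊕-cong (⋆-anticomm x y) ≈-refl)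

⋆-jacobi-right : ∀ V a b → V ⋆ₗ (a ⋆ₗ b) ≈ (V ⋆ₗ a) ⋆ₗ b ⊕ (ℚ.- 1ℚ) · ((V ⋆ₗ b) ⋆ₗ a)
⋆-jacobi-right V a b = begin
  V ⋆ₗ (a ⋆ₗ b)
    ≈⟨ ≐⇒≈ (≐-add-sub (V ⋆ₗ (a ⋆ₗ b)) (a ⋆ₗ (b ⋆ₗ V) ⊕ b ⋆ₗ (V ⋆ₗ a))) ⟩
  V ⋆ₗ (a ⋆ₗ b) ⊕ (a ⋆ₗ (b ⋆ₗ V) ⊕ b ⋆ₗ (V ⋆ₗ a)) ⊕ m1 · (a ⋆ₗ (b ⋆ₗ V) ⊕ b ⋆ₗ (V ⋆ₗ a))
    ≈⟨ ⊕-cong (≈-trans (≐⇒≈ (≡⇒≐ (sym (ListP.++-assoc (V ⋆ₗ (a ⋆ₗ b)) _ _)))) (jacobi V a b))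
              (·-cong m1 (⊕-cong t₁ t₂)) ⟩
  𝟘 ⊕ m1 · ((V ⋆ₗ b) ⋆ₗ a ⊕ m1 · ((V ⋆ₗ a) ⋆ₗ b))
    ≈⟨ ≐⇒≈ (≐-byCoef (m1 ·ᴱ (‵ Vb⋆a ⊕ᴱ m1 ·ᴱ ‵ Va⋆b)) (‵ Va⋆b ⊕ᴱ m1 ·ᴱ ‵ Vb⋆a)
                   (λ w → lemma (coef w Vb⋆a) (coef w Va⋆b))) ⟩
  (V ⋆ₗ a) ⋆ₗ b ⊕ m1 · ((V ⋆ₗ b) ⋆ₗ a) ∎
  where
  open ≈-Reasoning
  m1 = ℚ.- 1ℚ
  Va⋆b = (V ⋆ₗ a) ⋆ₗ b
  Vb⋆a = (V ⋆ₗ b) ⋆ₗ a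
  lemma : ∀ p q → (ℚ.- 1ℚ) ℚ.* (p ℚ.+ (ℚ.- 1ℚ) ℚ.* q) ≡ q ℚ.+ (ℚ.- 1ℚ) ℚ.* p
  lemma = solve-∀ ℚ-ring
  t₁ : a ⋆ₗ (b ⋆ₗ V) ≈ Vb⋆a
  t₁ = ≈-trans (⋆-antisym a (b ⋆ₗ V))
         (≈-trans (·-cong m1 (⋆-congˡ a (⋆-antisym b V)))
                  (≐⇒≈ (≐-byCoef (m1 ·ᴱ ((m1 ·ᴱ ‵ (V ⋆ₗ b)) ⋆ᴱ ‵ a)) (‵ (V ⋆ₗ b) ⋆ᴱ ‵ a) coefs)))
    where
    coefs : ∀ w → coefᴱ w (m1 ·ᴱ ((m1 ·ᴱ ‵ (V ⋆ₗ b)) ⋆ᴱ ‵ a)) ≡ coefᴱ w (‵ (V ⋆ₗ b) ⋆ᴱ ‵ a)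
    coefs (v k)     = ℚP.*-zeroʳ m1
    coefs (w₁ ⋆ w₂) = double-neg (coef w₁ (V ⋆ₗ b)) (coef w₂ a)
      where
      double-neg : ∀ p q → (ℚ.- 1ℚ) ℚ.* ((ℚ.- 1ℚ) ℚ.* p ℚ.* q) ≡ p ℚ.* q
      double-neg = solve-∀ ℚ-ring
  t₂ : b ⋆ₗ (V ⋆ₗ a) ≈ m1 · Va⋆b
  t₂ = ⋆-antisym b (V ⋆ₗ a)

-- The action ▷ₐ on M(V)_ℚ

▷ₐ≐extend₂ : ∀ x y → x ▷ₐ y ≐ extend₂ act-M x y
▷ₐ≐extend₂ = extend₂-pairs act-M

▷-linearˡ : ∀ y → IsLinear (_▷ₐ y)
▷-linearˡ y = IsLinear-≐ (λ x → ▷ₐ≐extend₂ x y) (extend₂-linearˡ act-M y)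

▷-linearʳ : ∀ x → IsLinear (x ▷ₐ_)
▷-linearʳ x = IsLinear-≐ (▷ₐ≐extend₂ x) (extend₂-linearʳ act-M x)

⟦⟧▷⟦⟧ : ∀ t u → ⟦ t ⟧ ▷ₐ ⟦ u ⟧ ≐ act-M t u
⟦⟧▷⟦⟧ t u = ≐-trans (▷ₐ≐extend₂ ⟦ t ⟧ ⟦ u ⟧) (extend₂-⟨⟩ act-M t u)

⟦⟧▷≐extend : ∀ t y → ⟦ t ⟧ ▷ₐ y ≐ extend (act-M t) y
⟦⟧▷≐extend t = linear-unique (▷-linearʳ ⟦ t ⟧) (extend-isLinear (act-M t))
                  (λ u → ≐-trans (⟦⟧▷⟦⟧ t u) (≐-sym (extend-⟨⟩ (act-M t) u)))

IsDerivationOnBasis : (M → Lin) → Set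
IsDerivationOnBasis d = ∀ t u → d (t ⋆ u) ≐ d t ⋆ₗ ⟦ u ⟧ ⊕ ⟦ t ⟧ ⋆ₗ d u

extend-leibniz : ∀ {d} → IsDerivationOnBasis d → ∀ x y → extend d (x ⋆ₗ y) ≐ extend d x ⋆ₗ y ⊕ x ⋆ₗ extend d y
extend-leibniz {d} d-⋆ = leibniz-from-basis ⋆-linearˡ ⋆-linearʳ (extend-isLinear d)
  (λ t u → ≐-trans (extend-⟨⟩ d (t ⋆ u))
           (≐-trans (d-⋆ t u) (≐-sym (++-cong (≐-cong (⋆-linearˡ ⟦ u ⟧) (extend-⟨⟩ d t))
                                              (≐-cong (⋆-linearʳ ⟦ t ⟧) (extend-⟨⟩ d u))))))

act-M-derivation : ∀ s → IsDerivationOnBasis (act-M s)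
act-M-derivation s t u = ≐-refl

▷-leibniz : ∀ x y z → x ▷ₐ (y ⋆ₗ z) ≐ (x ▷ₐ y) ⋆ₗ z ⊕ y ⋆ₗ (x ▷ₐ z)
▷-leibniz x y z = linear-unique (▷-linearˡ (y ⋆ₗ z))
  (+-isLinear (∘-isLinear (⋆-linearˡ z) (▷-linearˡ y)) (∘-isLinear (⋆-linearʳ y) (▷-linearˡ z)))
  (λ t → ≐-trans (⟦⟧▷≐extend t (y ⋆ₗ z))
         (≐-trans (extend-leibniz (act-M-derivation t) y z)
                  (≐-sym (++-cong (≐-cong (⋆-linearˡ z) (⟦⟧▷≐extend t y)) (≐-cong (⋆-linearʳ y) (⟦⟧▷≐extend t z))))))
  x

▷-jacobiator : ∀ x a b c → x ▷ₐ jacobiator a b c ≐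
  jacobiator (x ▷ₐ a) b c ⊕ jacobiator a (x ▷ₐ b) c ⊕ jacobiator a b (x ▷ₐ c)
▷-jacobiator x a b c = begin
  x ▷ₐ (a ⋆ₗ (b ⋆ₗ c) ⊕ b ⋆ₗ (c ⋆ₗ a) ⊕ c ⋆ₗ (a ⋆ₗ b))
    ≋⟨ ≐-trans (++-homo (▷-linearʳ x) (a ⋆ₗ (b ⋆ₗ c) ⊕ b ⋆ₗ (c ⋆ₗ a)) (c ⋆ₗ (a ⋆ₗ b)))
               (++-cong (++-homo (▷-linearʳ x) (a ⋆ₗ (b ⋆ₗ c)) (b ⋆ₗ (c ⋆ₗ a))) ≐-refl) ⟩
  x ▷ₐ (a ⋆ₗ (b ⋆ₗ c)) ⊕ x ▷ₐ (b ⋆ₗ (c ⋆ₗ a)) ⊕ x ▷ₐ (c ⋆ₗ (a ⋆ₗ b))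
    ≋⟨ ++-cong (++-cong (leibniz₂ a b c) (leibniz₂ b c a)) (leibniz₂ c a b) ⟩
  (T₁ ⊕ (T₂ ⊕ T₃)) ⊕ (T₄ ⊕ (T₅ ⊕ T₆)) ⊕ (T₇ ⊕ (T₈ ⊕ T₉))
    ≋⟨ ≐-byCoef ((‵ T₁ ⊕ᴱ (‵ T₂ ⊕ᴱ ‵ T₃)) ⊕ᴱ (‵ T₄ ⊕ᴱ (‵ T₅ ⊕ᴱ ‵ T₆)) ⊕ᴱ (‵ T₇ ⊕ᴱ (‵ T₈ ⊕ᴱ ‵ T₉)))
                ((‵ T₁ ⊕ᴱ ‵ T₆ ⊕ᴱ ‵ T₈) ⊕ᴱ (‵ T₂ ⊕ᴱ ‵ T₄ ⊕ᴱ ‵ T₉) ⊕ᴱ (‵ T₃ ⊕ᴱ ‵ T₅ ⊕ᴱ ‵ T₇))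
                (λ w → regroup (coef w T₁) (coef w T₂) (coef w T₃) (coef w T₄) (coef w T₅)
                               (coef w T₆) (coef w T₇) (coef w T₈) (coef w T₉)) ⟩
  (T₁ ⊕ T₆ ⊕ T₈) ⊕ (T₂ ⊕ T₄ ⊕ T₉) ⊕ (T₃ ⊕ T₅ ⊕ T₇) ∎
  where
  open ≐-Reasoning
  T₁ = (x ▷ₐ a) ⋆ₗ (b ⋆ₗ c)
  T₂ = a ⋆ₗ ((x ▷ₐ b) ⋆ₗ c)
  T₃ = a ⋆ₗ (b ⋆ₗ (x ▷ₐ c))
  T₄ = (x ▷ₐ b) ⋆ₗ (c ⋆ₗ a)
  T₅ = b ⋆ₗ ((x ▷ₐ c) ⋆ₗ a)
  T₆ = b ⋆ₗ (c ⋆ₗ (x ▷ₐ a))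
  T₇ = (x ▷ₐ c) ⋆ₗ (a ⋆ₗ b)
  T₈ = c ⋆ₗ ((x ▷ₐ a) ⋆ₗ b)
  T₉ = c ⋆ₗ (a ⋆ₗ (x ▷ₐ b))
  leibniz₂ : ∀ p q r → x ▷ₐ (p ⋆ₗ (q ⋆ₗ r)) ≐ (x ▷ₐ p) ⋆ₗ (q ⋆ₗ r) ⊕ (p ⋆ₗ ((x ▷ₐ q) ⋆ₗ r) ⊕ p ⋆ₗ (q ⋆ₗ (x ▷ₐ r)))
  leibniz₂ p q r = ≐-trans (▷-leibniz x p (q ⋆ₗ r))
    (++-cong ≐-refl (≐-trans (≐-cong (⋆-linearʳ p) (▷-leibniz x q r)) (++-homo (⋆-linearʳ p) ((x ▷ₐ q) ⋆ₗ r) (q ⋆ₗ (x ▷ₐ r)))))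
  regroup : ∀ t₁ t₂ t₃ t₄ t₅ t₆ t₇ t₈ t₉ →
    (t₁ ℚ.+ (t₂ ℚ.+ t₃)) ℚ.+ (t₄ ℚ.+ (t₅ ℚ.+ t₆)) ℚ.+ (t₇ ℚ.+ (t₈ ℚ.+ t₉)) ≡
    (t₁ ℚ.+ t₆ ℚ.+ t₈) ℚ.+ (t₂ ℚ.+ t₄ ℚ.+ t₉) ℚ.+ (t₃ ℚ.+ t₅ ℚ.+ t₇)
  regroup = solve-∀ ℚ-ring

▷-congʳ : ∀ x {y y′} → y ≈ y′ → x ▷ₐ y ≈ x ▷ₐ y′
▷-congʳ x = linear-respects-≈ ≈-isVectorRelation (▷-linearʳ x)
  (λ {a} {a′} b a≈a′ xa≈xa′ → ≈-trans (≐⇒≈ (▷-leibniz x a b))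
     (≈-trans (⊕-cong (⋆-congˡ b xa≈xa′) (⋆-congˡ (x ▷ₐ b) a≈a′)) (≐⇒≈ (≐-sym (▷-leibniz x a′ b)))))
  (λ a {b} {b′} b≈b′ xb≈xb′ → ≈-trans (≐⇒≈ (▷-leibniz x a b))
     (≈-trans (⊕-cong (⋆-congʳ (x ▷ₐ a) b≈b′) (⋆-congʳ a xb≈xb′)) (≐⇒≈ (≐-sym (▷-leibniz x a b′)))))
  (λ a → ≈-trans (≐⇒≈ (▷-leibniz x a a)) (≈-trans (⋆-anticomm (x ▷ₐ a) a) (≐⇒≈ (≐-sym ([]-homo (▷-linearʳ x))))))
  (λ a b c → ≈-trans (≐⇒≈ (▷-jacobiator x a b c))
               (≈-trans (⊕-cong (⊕-cong (jacobi (x ▷ₐ a) b c) (jacobi a (x ▷ₐ b) c)) (jacobi a b (x ▷ₐ c)))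
                        (≐⇒≈ (≐-sym ([]-homo (▷-linearʳ x))))))

-- Signs, binomials and multiplicities

ℕ→ℚ-mkℚ : ∀ n → ℕ→ℚ n ≡ ℚ.mkℚ (+ n) 0 (C.sym (C.1-coprimeTo n))
ℕ→ℚ-mkℚ n = ℚP.↥p/↧p≡p (ℚ.mkℚ (+ n) 0 (C.sym (C.1-coprimeTo n)))

ℕ→ℚ-+ : ∀ m n → ℕ→ℚ (m ℕ.+ n) ≡ ℕ→ℚ m ℚ.+ ℕ→ℚ n
ℕ→ℚ-+ m n = trans (cong (ℚ._/ 1) (cong₂ ℤ._+_ (sym (ℤP.*-identityʳ (+ m))) (sym (ℤP.*-identityʳ (+ n)))))
                  (sym (cong₂ ℚ._+_ (ℕ→ℚ-mkℚ m) (ℕ→ℚ-mkℚ n)))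

ℕ→ℚ-* : ∀ m n → ℕ→ℚ (m ℕ.* n) ≡ ℕ→ℚ m ℚ.* ℕ→ℚ n
ℕ→ℚ-* m n = trans (cong (ℚ._/ 1) (ℤP.pos-* m n)) (sym (cong₂ ℚ._*_ (ℕ→ℚ-mkℚ m) (ℕ→ℚ-mkℚ n)))

ℕ→ℚ-suc≢0 : ∀ n → ℕ→ℚ (suc n) ≢ 0ℚ
ℕ→ℚ-suc≢0 n eq with cong ℚ.numerator (trans (sym (ℕ→ℚ-mkℚ (suc n))) eq)
... | ()

sgn-+ : ∀ m n → sgn (m ℕ.+ n) ≡ sgn m ℚ.* sgn n
sgn-+ zero    n = sym (ℚP.*-identityˡ (sgn n))
sgn-+ (suc m) n = trans (cong ℚ.-_ (sgn-+ m n)) (ℚP.neg-distribˡ-* (sgn m) (sgn n))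

sgn-double : ∀ n → sgn (n ℕ.+ n) ≡ 1ℚ
sgn-double n = trans (sgn-+ n n) (square n)
  where
  square : ∀ n → sgn n ℚ.* sgn n ≡ 1ℚ
  square zero    = refl
  square (suc n) = trans (neg*neg (sgn n)) (square n)
    where
    neg*neg : ∀ s → (ℚ.- s) ℚ.* (ℚ.- s) ≡ s ℚ.* s
    neg*neg = solve-∀ ℚ-ring

[n∸k]*nCk≡[1+k]*nC[1+k] : ∀ n k → (n ∸ k) ℕ.* (n C k) ≡ suc k ℕ.* (n C suc k)
[n∸k]*nCk≡[1+k]*nC[1+k] zero    zero    = refl
[n∸k]*nCk≡[1+k]*nC[1+k] zero    (suc k) = sym (ℕP.*-zeroʳ (suc (suc k)))
[n∸k]*nCk≡[1+k]*nC[1+k] (suc n) zero    = trans (ℕP.*-identityʳ (suc n)) (sym (trans (ℕP.+-identityʳ _) (nC1≡n (suc n))))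
[n∸k]*nCk≡[1+k]*nC[1+k] (suc n) (suc k) with ℕP.<-≤-connex k n
... | inj₁ k<n = begin
  (n ∸ k) ℕ.* (suc n C suc k)
    ≡⟨ cong₂ ℕ._*_ n∸k≡1+d (pascal k) ⟩
  suc d ℕ.* (n C k ℕ.+ n C suc k)
    ≡⟨ ℕP.*-distribˡ-+ (suc d) (n C k) (n C suc k) ⟩
  suc d ℕ.* (n C k) ℕ.+ suc d ℕ.* (n C suc k)
    ≡⟨ cong (ℕ._+ suc d ℕ.* (n C suc k))
         (trans (cong (ℕ._* (n C k)) (sym n∸k≡1+d)) ([n∸k]*nCk≡[1+k]*nC[1+k] n k)) ⟩
  suc k ℕ.* (n C suc k) ℕ.+ suc d ℕ.* (n C suc k)
    ≡⟨ regroup k d (n C suc k) ⟩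
  suc (suc k) ℕ.* (n C suc k) ℕ.+ d ℕ.* (n C suc k)
    ≡⟨ cong (suc (suc k) ℕ.* (n C suc k) ℕ.+_) ([n∸k]*nCk≡[1+k]*nC[1+k] n (suc k)) ⟩
  suc (suc k) ℕ.* (n C suc k) ℕ.+ suc (suc k) ℕ.* (n C suc (suc k))
    ≡⟨ ℕP.*-distribˡ-+ (suc (suc k)) (n C suc k) (n C suc (suc k)) ⟨
  suc (suc k) ℕ.* (n C suc k ℕ.+ n C suc (suc k))
    ≡⟨ cong (suc (suc k) ℕ.*_) (pascal (suc k)) ⟨
  suc (suc k) ℕ.* (suc n C suc (suc k)) ∎
  where
  open ≡-Reasoning
  d = n ∸ suc k
  n∸k≡1+d : n ∸ k ≡ suc d
  n∸k≡1+d = ℕP.+-∸-assoc 1 k<n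
  pascal : ∀ j → suc n C suc j ≡ n C j ℕ.+ n C suc j
  pascal j = sym (nCk+nC[k+1]≡[n+1]C[k+1] n j)
  regroup : ∀ k d b → suc k ℕ.* b ℕ.+ suc d ℕ.* b ≡ suc (suc k) ℕ.* b ℕ.+ d ℕ.* b
  regroup = ℕ-Solver.solve-∀
... | inj₂ n≤k = begin
  (n ∸ k) ℕ.* (suc n C suc k)            ≡⟨ cong (ℕ._* (suc n C suc k)) (ℕP.m≤n⇒m∸n≡0 n≤k) ⟩
  0                                      ≡⟨ ℕP.*-zeroʳ (suc (suc k)) ⟨
  suc (suc k) ℕ.* 0                      ≡⟨ cong (suc (suc k) ℕ.*_) (k>n⇒nCk≡0 (s≤s (s≤s n≤k))) ⟨
  suc (suc k) ℕ.* (suc n C suc (suc k))  ∎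
  where open ≡-Reasoning

letterMult : ℕ → ℕ → ℚ
letterMult k l = mult (k ∷ []) (l ∷ [])

letterMult-diag : ∀ k → letterMult k k ≡ 1ℚ
letterMult-diag k = trans (cong₂ ℚ._*_ (sgn-double (k ℕ.+ 0)) (cong ℕ→ℚ (trans (ℕP.*-identityʳ (binom₋₁ k k)) (diag k))))
                          (ℚP.*-identityˡ 1ℚ)
  where
  diag : ∀ k → binom₋₁ k k ≡ 1
  diag zero    = refl
  diag (suc k) = nCn≡1 k

-- Coefficientwise form of ∂X (exp∂ᴹ (v k)) = − ∂ (exp∂ᴹ (v k)) below.
letterMult-step : ∀ k j → j < k → letterMult k j ℚ.* ℕ→ℚ (k ∸ j) ≡ (ℚ.- 1ℚ) ℚ.* (letterMult k (suc j) ℚ.* ℕ→ℚ j)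
letterMult-step (suc k) zero    _ = lemma (sgn (suc k ℕ.+ 0 ℕ.+ 0)) (ℕ→ℚ (suc k)) (letterMult (suc k) 1)
  where
  lemma : ∀ s x y → s ℚ.* 0ℚ ℚ.* x ≡ (ℚ.- 1ℚ) ℚ.* (y ℚ.* 0ℚ)
  lemma = solve-∀ ℚ-ring
letterMult-step (suc k) (suc j) _ = begin
  sgn A ℚ.* ℕ→ℚ ((k C j) ℕ.* 1) ℚ.* ℕ→ℚ (k ∸ j)
    ≡⟨ cong (λ n → sgn A ℚ.* ℕ→ℚ n ℚ.* ℕ→ℚ (k ∸ j)) (ℕP.*-identityʳ (k C j)) ⟩
  sgn A ℚ.* ℕ→ℚ (k C j) ℚ.* ℕ→ℚ (k ∸ j)
    ≡⟨ trans (ℚP.*-assoc (sgn A) _ _) (cong (sgn A ℚ.*_) (sym (ℕ→ℚ-* (k C j) (k ∸ j)))) ⟩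
  sgn A ℚ.* ℕ→ℚ ((k C j) ℕ.* (k ∸ j))
    ≡⟨ cong (λ n → sgn A ℚ.* ℕ→ℚ n) (trans (ℕP.*-comm (k C j) (k ∸ j)) ([n∸k]*nCk≡[1+k]*nC[1+k] k j)) ⟩
  sgn A ℚ.* ℕ→ℚ (suc j ℕ.* (k C suc j))
    ≡⟨ cong (sgn A ℚ.*_) (trans (ℕ→ℚ-* (suc j) (k C suc j)) (ℚP.*-comm (ℕ→ℚ (suc j)) _)) ⟩
  sgn A ℚ.* (ℕ→ℚ (k C suc j) ℚ.* ℕ→ℚ (suc j))
    ≡⟨ flip (sgn A) (ℕ→ℚ (k C suc j)) (ℕ→ℚ (suc j)) ⟩
  (ℚ.- 1ℚ) ℚ.* ((ℚ.- sgn A) ℚ.* ℕ→ℚ (k C suc j) ℚ.* ℕ→ℚ (suc j))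
    ≡⟨ cong (λ s → (ℚ.- 1ℚ) ℚ.* (s ℚ.* ℕ→ℚ (k C suc j) ℚ.* ℕ→ℚ (suc j))) (cong sgn (ℕP.+-suc (suc k ℕ.+ 0) (suc j ℕ.+ 0))) ⟨
  (ℚ.- 1ℚ) ℚ.* (sgn (suc k ℕ.+ 0 ℕ.+ suc (suc j ℕ.+ 0)) ℚ.* ℕ→ℚ (k C suc j) ℚ.* ℕ→ℚ (suc j))
    ≡⟨ cong (λ n → (ℚ.- 1ℚ) ℚ.* (sgn (suc k ℕ.+ 0 ℕ.+ suc (suc j ℕ.+ 0)) ℚ.* ℕ→ℚ n ℚ.* ℕ→ℚ (suc j))) (ℕP.*-identityʳ (k C suc j)) ⟨
  (ℚ.- 1ℚ) ℚ.* (sgn (suc k ℕ.+ 0 ℕ.+ suc (suc j ℕ.+ 0)) ℚ.* ℕ→ℚ ((k C suc j) ℕ.* 1) ℚ.* ℕ→ℚ (suc j)) ∎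
  where
  open ≡-Reasoning
  A = suc k ℕ.+ 0 ℕ.+ (suc j ℕ.+ 0)
  flip : ∀ s c j → s ℚ.* (c ℚ.* j) ≡ (ℚ.- 1ℚ) ℚ.* ((ℚ.- s) ℚ.* c ℚ.* j)
  flip = solve-∀ ℚ-ring

concatMap-concatMap : ∀ {A B C : Set} (f : B → List C) (g : A → List B) xs →
  concatMap f (concatMap g xs) ≡ concatMap (concatMap f ∘ g) xs
concatMap-concatMap f g []       = refl
concatMap-concatMap f g (x ∷ xs) = trans (ListP.concatMap-++ f (g x) (concatMap g xs))
                                         (cong (concatMap f (g x) ++_) (concatMap-concatMap f g xs))

box-++ : ∀ ks ks′ → box (ks ++ ks′) ≡ concatMap (λ ls → map (ls ++_) (box ks′)) (box ks)
box-++ []       ks′ = sym (trans (ListP.++-identityʳ (map ([] ++_) (box ks′))) (ListP.map-id (box ks′)))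
box-++ (k ∷ ks) ks′ = begin
  concatMap (λ l → map (l ∷_) (box (ks ++ ks′))) (upTo (suc k))
    ≡⟨ ListP.concatMap-cong (λ l → cong (map (l ∷_)) (box-++ ks ks′)) (upTo (suc k)) ⟩
  concatMap (λ l → map (l ∷_) (concatMap (λ ls → map (ls ++_) (box ks′)) (box ks))) (upTo (suc k))
    ≡⟨ ListP.concatMap-cong prepend (upTo (suc k)) ⟩
  concatMap (λ l → concatMap (λ ls → map (ls ++_) (box ks′)) (map (l ∷_) (box ks))) (upTo (suc k))
    ≡⟨ concatMap-concatMap (λ ls → map (ls ++_) (box ks′)) (λ l → map (l ∷_) (box ks)) (upTo (suc k)) ⟨
  concatMap (λ ls → map (ls ++_) (box ks′)) (concatMap (λ l → map (l ∷_) (box ks)) (upTo (suc k))) ∎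
  where
  open ≡-Reasoning
  prepend : ∀ l → map (l ∷_) (concatMap (λ ls → map (ls ++_) (box ks′)) (box ks)) ≡
                  concatMap (λ ls → map (ls ++_) (box ks′)) (map (l ∷_) (box ks))
  prepend l = trans (ListP.map-concatMap (l ∷_) (λ ls → map (ls ++_) (box ks′)) (box ks))
    (trans (ListP.concatMap-cong (λ ls → sym (ListP.map-∘ (box ks′))) (box ks))
           (sym (ListP.concatMap-map (λ ls → map (ls ++_) (box ks′)) (l ∷_) (box ks))))

InBox : List ℕ → List ℕ → Set
InBox ks ls = (length ls ≡ length ks) × (sum ls ≤ sum ks)

box-inBox : ∀ ks → All (InBox ks) (box ks)
box-inBox []       = (refl , z≤n) ∷ []
box-inBox (k ∷ ks) = AllP.concat⁺ (AllP.map⁺ (AllP.applyUpTo⁺₁ (λ l → l) (suc k)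
  (λ l<1+k → AllP.map⁺ (All.map (λ ok → cong suc (proj₁ ok) , ℕP.+-mono-≤ (ℕP.≤-pred l<1+k) (proj₂ ok)) (box-inBox ks)))))

relabel′-++ : ∀ t ls rest → length ls ≡ length (letters t) → relabel′ t (ls ++ rest) ≡ (relabel t ls , rest)
relabel′-++ (v k)   (l ∷ []) rest refl = refl
relabel′-++ (t ⋆ u) ls       rest len  =
  subst (λ ls → relabel′ (t ⋆ u) (ls ++ rest) ≡ (relabel (t ⋆ u) ls , rest)) (ListP.take++drop≡id n ls) split-rest
  where
  n = length (letters t)
  m = length (letters u)
  ls₁ = take n ls
  ls₂ = drop n ls
  len′ : length ls ≡ n ℕ.+ m
  len′ = trans len (ListP.length-++ (letters t))
  len₁ : length ls₁ ≡ n
  len₁ = trans (ListP.length-take n ls) (trans (cong (n ℕ.⊓_) len′) (ℕP.m≤n⇒m⊓n≡m (ℕP.m≤m+n n m)))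
  len₂ : length ls₂ ≡ m
  len₂ = trans (ListP.length-drop n ls) (trans (cong (_∸ n) len′) (ℕP.m+n∸m≡n n m))
  split : ∀ rest → relabel′ (t ⋆ u) ((ls₁ ++ ls₂) ++ rest) ≡ (relabel t ls₁ ⋆ relabel u ls₂ , rest)
  split rest rewrite ListP.++-assoc ls₁ ls₂ rest | relabel′-++ t ls₁ (ls₂ ++ rest) len₁ | relabel′-++ u ls₂ rest len₂ = refl
  split-rest : relabel′ (t ⋆ u) ((ls₁ ++ ls₂) ++ rest) ≡ (relabel (t ⋆ u) (ls₁ ++ ls₂) , rest)
  split-rest = trans (split rest) (cong (_, rest) (sym (cong proj₁
                 (trans (cong (relabel′ (t ⋆ u)) (sym (ListP.++-identityʳ (ls₁ ++ ls₂)))) (split [])))))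

relabel-⋆ : ∀ t u ls ls′ → length ls ≡ length (letters t) → length ls′ ≡ length (letters u) →
  relabel (t ⋆ u) (ls ++ ls′) ≡ relabel t ls ⋆ relabel u ls′
relabel-⋆ t u ls ls′ len len′ =
  cong proj₁ (trans (cong (relabel′ (t ⋆ u)) (sym (ListP.++-identityʳ (ls ++ ls′)))) (split ls′ len′))
  where
  split : ∀ ls′ → length ls′ ≡ length (letters u) →
          relabel′ (t ⋆ u) ((ls ++ ls′) ++ []) ≡ (relabel t ls ⋆ relabel u ls′ , [])
  split ls′ len′ rewrite ListP.++-assoc ls ls′ [] | relabel′-++ t ls (ls′ ++ []) len | relabel′-++ u ls′ [] len′ = refl

prodBinom-++ : ∀ ks ls ks′ ls′ → length ls ≡ length ks →
  prodBinom (ks ++ ks′) (ls ++ ls′) ≡ prodBinom ks ls ℕ.* prodBinom ks′ ls′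
prodBinom-++ []       []       ks′ ls′ _   = sym (ℕP.+-identityʳ (prodBinom ks′ ls′))
prodBinom-++ (k ∷ ks) (l ∷ ls) ks′ ls′ len =
  trans (cong (binom₋₁ k l ℕ.*_) (prodBinom-++ ks ls ks′ ls′ (ℕP.suc-injective len)))
        (sym (ℕP.*-assoc (binom₋₁ k l) (prodBinom ks ls) (prodBinom ks′ ls′)))

mult-++ : ∀ ks ls ks′ ls′ → length ls ≡ length ks → mult (ks ++ ks′) (ls ++ ls′) ≡ mult ks ls ℚ.* mult ks′ ls′
mult-++ ks ls ks′ ls′ len = begin
  sgn (∣ ks ++ ks′ ∣ ℕ.+ ∣ ls ++ ls′ ∣) ℚ.* ℕ→ℚ (prodBinom (ks ++ ks′) (ls ++ ls′))
    ≡⟨ cong₂ ℚ._*_ (trans (cong sgn sums) (sgn-+ (∣ ks ∣ ℕ.+ ∣ ls ∣) (∣ ks′ ∣ ℕ.+ ∣ ls′ ∣)))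
                   (trans (cong ℕ→ℚ (prodBinom-++ ks ls ks′ ls′ len)) (ℕ→ℚ-* (prodBinom ks ls) (prodBinom ks′ ls′))) ⟩
  sgn (∣ ks ∣ ℕ.+ ∣ ls ∣) ℚ.* sgn (∣ ks′ ∣ ℕ.+ ∣ ls′ ∣) ℚ.* (ℕ→ℚ (prodBinom ks ls) ℚ.* ℕ→ℚ (prodBinom ks′ ls′))
    ≡⟨ interchange (sgn (∣ ks ∣ ℕ.+ ∣ ls ∣)) (sgn (∣ ks′ ∣ ℕ.+ ∣ ls′ ∣)) (ℕ→ℚ (prodBinom ks ls)) (ℕ→ℚ (prodBinom ks′ ls′)) ⟩
  mult ks ls ℚ.* mult ks′ ls′ ∎
  where
  open ≡-Reasoning
  interchange : ∀ a b c d → a ℚ.* b ℚ.* (c ℚ.* d) ≡ a ℚ.* c ℚ.* (b ℚ.* d)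
  interchange = solve-∀ ℚ-ring
  sums : ∣ ks ++ ks′ ∣ ℕ.+ ∣ ls ++ ls′ ∣ ≡ (∣ ks ∣ ℕ.+ ∣ ls ∣) ℕ.+ (∣ ks′ ∣ ℕ.+ ∣ ls′ ∣)
  sums rewrite sum-++ ks ks′ | sum-++ ls ls′ = swap (sum ks) (sum ks′) (sum ls) (sum ls′)
    where
    swap : ∀ a c b d → (a ℕ.+ c) ℕ.+ (b ℕ.+ d) ≡ (a ℕ.+ b) ℕ.+ (c ℕ.+ d)
    swap = ℕ-Solver.solve-∀

∸-+-distrib : ∀ a b c d → b ≤ a → d ≤ c → (a ℕ.+ c) ∸ (b ℕ.+ d) ≡ (a ∸ b) ℕ.+ (c ∸ d)
∸-+-distrib a b c d b≤a d≤c = begin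
  (a ℕ.+ c) ∸ (b ℕ.+ d)
    ≡⟨ cong₂ (λ x y → (x ℕ.+ y) ∸ (b ℕ.+ d)) (ℕP.m+[n∸m]≡n b≤a) (ℕP.m+[n∸m]≡n d≤c) ⟨
  (b ℕ.+ (a ∸ b) ℕ.+ (d ℕ.+ (c ∸ d))) ∸ (b ℕ.+ d)
    ≡⟨ cong (_∸ (b ℕ.+ d)) (regroup b (a ∸ b) d (c ∸ d)) ⟩
  (b ℕ.+ d ℕ.+ ((a ∸ b) ℕ.+ (c ∸ d))) ∸ (b ℕ.+ d)
    ≡⟨ ℕP.m+n∸m≡n (b ℕ.+ d) ((a ∸ b) ℕ.+ (c ∸ d)) ⟩
  (a ∸ b) ℕ.+ (c ∸ d) ∎
  where
  open ≡-Reasoning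
  regroup : ∀ b x d y → b ℕ.+ x ℕ.+ (d ℕ.+ y) ≡ b ℕ.+ d ℕ.+ (x ℕ.+ y)
  regroup = ℕ-Solver.solve-∀

-- Polynomials over M(V)_ℚ in a formal variable X; the basis element (e , t) stands for t Xᵉ.

Poly : Set
Poly = FV (ℕ × M)

δ-pair : ∀ e f t u → δ (e , t) (f , u) ≡ δ e f ℚ.* δ t u
δ-pair e f t u = by-cases (e ℕ.≟ f) (t ≟M u)
  where
  by-cases : Dec (e ≡ f) → Dec (t ≡ u) → δ (e , t) (f , u) ≡ δ e f ℚ.* δ t u
  by-cases (yes refl) (yes refl) = trans (δ-refl (e , t)) (sym (cong₂ ℚ._*_ (δ-refl e) (δ-refl t)))
  by-cases (no e≢f)   _          = trans (δ-≢ {w = e , t} {b = f , u} λ { refl → e≢f refl })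
                                         (sym (trans (cong (ℚ._* δ t u) (δ-≢ e≢f)) (ℚP.*-zeroˡ (δ t u))))
  by-cases (yes _)    (no t≢u)   = trans (δ-≢ {w = e , t} {b = f , u} λ { refl → t≢u refl })
                                         (sym (trans (cong (δ e f ℚ.*_) (δ-≢ t≢u)) (ℚP.*-zeroʳ (δ e f))))

infix 8 _·X^_
_·X^_ : Lin → ℕ → Poly
x ·X^ e = extend (λ t → ⟨ e , t ⟩) x

[X^_]ᴮ : ℕ → ℕ × M → Lin
[X^ e ]ᴮ (f , t) = δ e f • ⟦ t ⟧

[X^_]_ : ℕ → Poly → Lin
[X^ e ] G = extend [X^ e ]ᴮ G

·X^-isLinear : ∀ e → IsLinear (_·X^ e)
·X^-isLinear e = extend-isLinear (λ t → ⟨ e , t ⟩)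

[X^]-isLinear : ∀ e → IsLinear ([X^ e ]_)
[X^]-isLinear e = extend-isLinear [X^ e ]ᴮ

coef-[X^] : ∀ e t G → coef t ([X^ e ] G) ≡ coef (e , t) G
coef-[X^] e t []                  = refl
coef-[X^] e t ((a , (f , u)) ∷ G) = begin
  coef t (a • (δ e f • ⟦ u ⟧) ++ [X^ e ] G)
    ≡⟨ coef-++ t (a • (δ e f • ⟦ u ⟧)) ([X^ e ] G) ⟩
  coef t (a • (δ e f • ⟦ u ⟧)) ℚ.+ coef t ([X^ e ] G)
    ≡⟨ cong₂ ℚ._+_ (trans (coef-• t a (δ e f • ⟦ u ⟧)) (cong (a ℚ.*_) (coef-• t (δ e f) ⟦ u ⟧)))
                   (coef-[X^] e t G) ⟩
  a ℚ.* (δ e f ℚ.* (1ℚ ℚ.* δ t u ℚ.+ 0ℚ)) ℚ.+ coef (e , t) G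
    ≡⟨ cong (λ d → a ℚ.* d ℚ.+ coef (e , t) G)
        (trans (lemma (δ e f) (δ t u)) (sym (δ-pair e f t u))) ⟩
  a ℚ.* δ (e , t) (f , u) ℚ.+ coef (e , t) G ∎
  where
  open ≡-Reasoning
  lemma : ∀ d d′ → d ℚ.* (1ℚ ℚ.* d′ ℚ.+ 0ℚ) ≡ d ℚ.* d′
  lemma = solve-∀ ℚ-ring

≐-by-[X^] : ∀ {G H} → (∀ e → [X^ e ] G ≐ [X^ e ] H) → G ≐ H
≐-by-[X^] {G} {H} p = mk≐ λ { (e , t) → trans (sym (coef-[X^] e t G)) (trans (coef-≡ (p e) t) (coef-[X^] e t H)) }

[X^]-⟨⟩ : ∀ e f t → [X^ e ] ⟨ f , t ⟩ ≐ δ e f • ⟦ t ⟧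
[X^]-⟨⟩ e f t = extend-⟨⟩ [X^ e ]ᴮ (f , t)

[X^]-·X^ : ∀ e f x → [X^ e ] (x ·X^ f) ≐ δ e f • x
[X^]-·X^ e f = linear-unique (∘-isLinear ([X^]-isLinear e) (·X^-isLinear f)) (•-isLinear (δ e f) id-isLinear)
  (λ t → ≐-trans (≐-cong ([X^]-isLinear e) (extend-⟨⟩ (λ t → ⟨ f , t ⟩) t)) ([X^]-⟨⟩ e f t))

infixl 7 _⋆ₚ_
⋆ₚᴮ : ℕ × M → ℕ × M → Poly
⋆ₚᴮ (e , t) (f , u) = ⟨ e ℕ.+ f , t ⋆ u ⟩

_⋆ₚ_ : Poly → Poly → Poly
_⋆ₚ_ = extend₂ ⋆ₚᴮ

⋆ₚ-linearˡ : ∀ H → IsLinear (_⋆ₚ H)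
⋆ₚ-linearˡ = extend₂-linearˡ ⋆ₚᴮ

⋆ₚ-linearʳ : ∀ G → IsLinear (G ⋆ₚ_)
⋆ₚ-linearʳ = extend₂-linearʳ ⋆ₚᴮ

⟨⟩⋆ₚ⟨⟩ : ∀ e t f u → ⟨ e , t ⟩ ⋆ₚ ⟨ f , u ⟩ ≐ ⟨ e ℕ.+ f , t ⋆ u ⟩
⟨⟩⋆ₚ⟨⟩ e t f u = extend₂-⟨⟩ ⋆ₚᴮ (e , t) (f , u)

·X^-⋆ₚ : ∀ f g x y → (x ·X^ f) ⋆ₚ (y ·X^ g) ≐ (x ⋆ₗ y) ·X^ (f ℕ.+ g)
·X^-⋆ₚ f g = bilinear-unique
  (λ y → ∘-isLinear (⋆ₚ-linearˡ (y ·X^ g)) (·X^-isLinear f)) (λ x → ∘-isLinear (⋆ₚ-linearʳ (x ·X^ f)) (·X^-isLinear g))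
  (λ y → ∘-isLinear (·X^-isLinear (f ℕ.+ g)) (⋆-linearˡ y)) (λ x → ∘-isLinear (·X^-isLinear (f ℕ.+ g)) (⋆-linearʳ x))
  (λ t u → ≐-trans (≐-cong (⋆ₚ-linearˡ (⟦ u ⟧ ·X^ g)) (extend-⟨⟩ (λ t → ⟨ f , t ⟩) t))
           (≐-trans (≐-cong (⋆ₚ-linearʳ ⟨ f , t ⟩) (extend-⟨⟩ (λ t → ⟨ g , t ⟩) u))
           (≐-trans (⟨⟩⋆ₚ⟨⟩ f t g u) (≐-sym (extend-⟨⟩ (λ t → ⟨ f ℕ.+ g , t ⟩) (t ⋆ u))))))

[X^0]-⋆ₚ : ∀ G H → [X^ 0 ] (G ⋆ₚ H) ≐ [X^ 0 ] G ⋆ₗ [X^ 0 ] H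
[X^0]-⋆ₚ = bilinear-unique
  (λ H → ∘-isLinear ([X^]-isLinear 0) (⋆ₚ-linearˡ H)) (λ G → ∘-isLinear ([X^]-isLinear 0) (⋆ₚ-linearʳ G))
  (λ H → ∘-isLinear (⋆-linearˡ ([X^ 0 ] H)) ([X^]-isLinear 0)) (λ G → ∘-isLinear (⋆-linearʳ ([X^ 0 ] G)) ([X^]-isLinear 0))
  λ { (f , t) (g , u) → begin
      [X^ 0 ] (⟨ f , t ⟩ ⋆ₚ ⟨ g , u ⟩)
        ≋⟨ ≐-cong ([X^]-isLinear 0) (⟨⟩⋆ₚ⟨⟩ f t g u) ⟩
      [X^ 0 ] ⟨ f ℕ.+ g , t ⋆ u ⟩
        ≋⟨ [X^]-⟨⟩ 0 (f ℕ.+ g) (t ⋆ u) ⟩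
      δ 0 (f ℕ.+ g) • ⟦ t ⋆ u ⟧
        ≋⟨ •-cong-scalar ⟦ t ⋆ u ⟧ (δ0-+ f g) ⟨
      (δ 0 f ℚ.* δ 0 g) • (⟦ t ⟧ ⋆ₗ ⟦ u ⟧)
        ≋⟨ •-• (δ 0 f) (δ 0 g) (⟦ t ⟧ ⋆ₗ ⟦ u ⟧) ⟨
      δ 0 f • (δ 0 g • (⟦ t ⟧ ⋆ₗ ⟦ u ⟧))
        ≋⟨ •-cong (δ 0 f) (≐-sym (•-homo (⋆-linearʳ ⟦ t ⟧) (δ 0 g) ⟦ u ⟧)) ⟩
      δ 0 f • (⟦ t ⟧ ⋆ₗ (δ 0 g • ⟦ u ⟧))
        ≋⟨ •-homo (⋆-linearˡ (δ 0 g • ⟦ u ⟧)) (δ 0 f) ⟦ t ⟧ ⟨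
      (δ 0 f • ⟦ t ⟧) ⋆ₗ (δ 0 g • ⟦ u ⟧)
        ≋⟨ ≐-sym (⋆-cong≐ ([X^]-⟨⟩ 0 f t) ([X^]-⟨⟩ 0 g u)) ⟩
      [X^ 0 ] ⟨ f , t ⟩ ⋆ₗ [X^ 0 ] ⟨ g , u ⟩ ∎ }
  where
  open ≐-Reasoning
  δ0-+ : ∀ f g → δ 0 f ℚ.* δ 0 g ≡ δ 0 (f ℕ.+ g)
  δ0-+ zero    zero    = refl
  δ0-+ zero    (suc g) = refl
  δ0-+ (suc f) g       = ℚP.*-zeroˡ (δ 0 g)

∂Xᴮ : ℕ × M → Poly
∂Xᴮ (e , t) = ℕ→ℚ e • ⟨ e ∸ 1 , t ⟩

∂X : Poly → Poly
∂X = extend ∂Xᴮ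

∂X-isLinear : IsLinear ∂X
∂X-isLinear = extend-isLinear ∂Xᴮ

∂X-⟨⟩ : ∀ e t → ∂X ⟨ e , t ⟩ ≐ ℕ→ℚ e • ⟨ e ∸ 1 , t ⟩
∂X-⟨⟩ e t = extend-⟨⟩ ∂Xᴮ (e , t)

[X^]-∂X : ∀ e G → [X^ e ] (∂X G) ≐ ℕ→ℚ (suc e) • [X^ suc e ] G
[X^]-∂X e = linear-unique (∘-isLinear ([X^]-isLinear e) ∂X-isLinear) (•-isLinear (ℕ→ℚ (suc e)) ([X^]-isLinear (suc e)))
  λ { (f , t) → begin
      [X^ e ] (∂X ⟨ f , t ⟩)                       ≋⟨ ≐-cong ([X^]-isLinear e) (∂X-⟨⟩ f t) ⟩
      [X^ e ] (ℕ→ℚ f • ⟨ f ∸ 1 , t ⟩)              ≋⟨ •-homo ([X^]-isLinear e) (ℕ→ℚ f) ⟨ f ∸ 1 , t ⟩ ⟩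
      ℕ→ℚ f • [X^ e ] ⟨ f ∸ 1 , t ⟩                ≋⟨ •-cong (ℕ→ℚ f) ([X^]-⟨⟩ e (f ∸ 1) t) ⟩
      ℕ→ℚ f • (δ e (f ∸ 1) • ⟦ t ⟧)                ≋⟨ •-• (ℕ→ℚ f) (δ e (f ∸ 1)) ⟦ t ⟧ ⟩
      (ℕ→ℚ f ℚ.* δ e (f ∸ 1)) • ⟦ t ⟧              ≡⟨ cong (_• ⟦ t ⟧) (shift f) ⟩
      (ℕ→ℚ (suc e) ℚ.* δ (suc e) f) • ⟦ t ⟧        ≋⟨ •-• (ℕ→ℚ (suc e)) (δ (suc e) f) ⟦ t ⟧ ⟨
      ℕ→ℚ (suc e) • (δ (suc e) f • ⟦ t ⟧)          ≋⟨ •-cong (ℕ→ℚ (suc e)) ([X^]-⟨⟩ (suc e) f t) ⟨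
      ℕ→ℚ (suc e) • [X^ suc e ] ⟨ f , t ⟩          ∎ }
  where
  open ≐-Reasoning
  shift : ∀ f → ℕ→ℚ f ℚ.* δ e (f ∸ 1) ≡ ℕ→ℚ (suc e) ℚ.* δ (suc e) f
  shift zero    = trans (ℚP.*-zeroˡ (δ e 0)) (sym (ℚP.*-zeroʳ (ℕ→ℚ (suc e))))
  shift (suc f) with e ℕ.≟ f
  ... | yes refl = refl
  ... | no e≢f   = trans (cong (ℕ→ℚ (suc f) ℚ.*_) (δ-≢ e≢f))
                         (trans (ℚP.*-zeroʳ (ℕ→ℚ (suc f))) (sym (trans (cong (ℕ→ℚ (suc e) ℚ.*_) (δ-≢ e≢f)) (ℚP.*-zeroʳ (ℕ→ℚ (suc e))))))

∂X-⟨+⟩ : ∀ f g b → ∂X ⟨ f ℕ.+ g , b ⟩ ≐ ℕ→ℚ f • ⟨ f ∸ 1 ℕ.+ g , b ⟩ ++ ℕ→ℚ g • ⟨ f ℕ.+ (g ∸ 1) , b ⟩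
∂X-⟨+⟩ f g b = ≐-trans (∂X-⟨⟩ (f ℕ.+ g) b) (split f g)
  where
  split : ∀ f g → ℕ→ℚ (f ℕ.+ g) • ⟨ f ℕ.+ g ∸ 1 , b ⟩ ≐ ℕ→ℚ f • ⟨ f ∸ 1 ℕ.+ g , b ⟩ ++ ℕ→ℚ g • ⟨ f ℕ.+ (g ∸ 1) , b ⟩
  split zero    g       = ≐-sym (++-cong (0•-zero ⟨ g , b ⟩) ≐-refl)
  split (suc f) zero    = ≐-trans (≡⇒≐ (cong₂ (λ n m → ℕ→ℚ n • ⟨ m , b ⟩) (ℕP.+-identityʳ (suc f)) (ℕP.+-identityʳ f)))
                          (≐-sym (≐-trans (++-cong (≡⇒≐ (cong (λ m → ℕ→ℚ (suc f) • ⟨ m , b ⟩) (ℕP.+-identityʳ f)))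
                                                   (0•-zero ⟨ suc f ℕ.+ 0 , b ⟩))
                                          (≡⇒≐ (ListP.++-identityʳ _))))
  split (suc f) (suc g) = ≐-trans (•-cong-scalar ⟨ f ℕ.+ suc g , b ⟩ (ℕ→ℚ-+ (suc f) (suc g)))
                          (≐-trans (≐-sym (•-distribʳ (ℕ→ℚ (suc f)) (ℕ→ℚ (suc g)) ⟨ f ℕ.+ suc g , b ⟩))
                                   (++-congʳ (ℕ→ℚ (suc f) • ⟨ f ℕ.+ suc g , b ⟩)
                                             (≡⇒≐ (cong (λ m → ℕ→ℚ (suc g) • ⟨ m , b ⟩) (ℕP.+-suc f g)))))

∂X-leibniz : ∀ G H → ∂X (G ⋆ₚ H) ≐ ∂X G ⋆ₚ H ++ G ⋆ₚ ∂X H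
∂X-leibniz = leibniz-from-basis ⋆ₚ-linearˡ ⋆ₚ-linearʳ ∂X-isLinear
  λ { (f , t) (g , u) → begin
      ∂X (⟨ f , t ⟩ ⋆ₚ ⟨ g , u ⟩)                   ≋⟨ ≐-cong ∂X-isLinear (⟨⟩⋆ₚ⟨⟩ f t g u) ⟩
      ∂X ⟨ f ℕ.+ g , t ⋆ u ⟩                        ≋⟨ ∂X-⟨+⟩ f g (t ⋆ u) ⟩
      ℕ→ℚ f • ⟨ f ∸ 1 ℕ.+ g , t ⋆ u ⟩ ++ ℕ→ℚ g • ⟨ f ℕ.+ (g ∸ 1) , t ⋆ u ⟩
        ≋⟨ ++-cong (≐-trans (•-cong (ℕ→ℚ f) (≐-sym (⟨⟩⋆ₚ⟨⟩ (f ∸ 1) t g u)))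
                            (≐-sym (•-homo (⋆ₚ-linearˡ ⟨ g , u ⟩) (ℕ→ℚ f) ⟨ f ∸ 1 , t ⟩)))
                   (≐-trans (•-cong (ℕ→ℚ g) (≐-sym (⟨⟩⋆ₚ⟨⟩ f t (g ∸ 1) u)))
                            (≐-sym (•-homo (⋆ₚ-linearʳ ⟨ f , t ⟩) (ℕ→ℚ g) ⟨ g ∸ 1 , u ⟩))) ⟩
      (ℕ→ℚ f • ⟨ f ∸ 1 , t ⟩) ⋆ₚ ⟨ g , u ⟩ ++ ⟨ f , t ⟩ ⋆ₚ (ℕ→ℚ g • ⟨ g ∸ 1 , u ⟩)
        ≋⟨ ++-cong (≐-cong (⋆ₚ-linearˡ ⟨ g , u ⟩) (∂X-⟨⟩ f t)) (≐-cong (⋆ₚ-linearʳ ⟨ f , t ⟩) (∂X-⟨⟩ g u)) ⟨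
      ∂X ⟨ f , t ⟩ ⋆ₚ ⟨ g , u ⟩ ++ ⟨ f , t ⟩ ⋆ₚ ∂X ⟨ g , u ⟩ ∎ }
  where open ≐-Reasoning

coefficientwiseᴮ : (M → Lin) → ℕ × M → Poly
coefficientwiseᴮ d (e , t) = d t ·X^ e

coefficientwise : (M → Lin) → Poly → Poly
coefficientwise d = extend (coefficientwiseᴮ d)

coefficientwise-isLinear : ∀ d → IsLinear (coefficientwise d)
coefficientwise-isLinear d = extend-isLinear (coefficientwiseᴮ d)

coefficientwise-⟨⟩ : ∀ d e t → coefficientwise d ⟨ e , t ⟩ ≐ d t ·X^ e
coefficientwise-⟨⟩ d e t = extend-⟨⟩ (coefficientwiseᴮ d) (e , t)

⟦⟧·X^ : ∀ e t → ⟦ t ⟧ ·X^ e ≐ ⟨ e , t ⟩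
⟦⟧·X^ e t = extend-⟨⟩ (λ t → ⟨ e , t ⟩) t

[X^]-coefficientwise : ∀ d e G → [X^ e ] (coefficientwise d G) ≐ extend d ([X^ e ] G)
[X^]-coefficientwise d e = linear-unique
  (∘-isLinear ([X^]-isLinear e) (coefficientwise-isLinear d)) (∘-isLinear (extend-isLinear d) ([X^]-isLinear e))
  λ { (f , t) → begin
      [X^ e ] (coefficientwise d ⟨ f , t ⟩)     ≋⟨ ≐-cong ([X^]-isLinear e) (coefficientwise-⟨⟩ d f t) ⟩
      [X^ e ] (d t ·X^ f)                       ≋⟨ [X^]-·X^ e f (d t) ⟩
      δ e f • d t                               ≋⟨ •-cong (δ e f) (extend-⟨⟩ d t) ⟨
      δ e f • extend d ⟦ t ⟧                    ≋⟨ •-homo (extend-isLinear d) (δ e f) ⟦ t ⟧ ⟨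
      extend d (δ e f • ⟦ t ⟧)                  ≋⟨ ≐-cong (extend-isLinear d) ([X^]-⟨⟩ e f t) ⟨
      extend d ([X^ e ] ⟨ f , t ⟩)              ∎ }
  where open ≐-Reasoning

coefficientwise-leibniz : ∀ {d} → IsDerivationOnBasis d →
  ∀ G H → coefficientwise d (G ⋆ₚ H) ≐ coefficientwise d G ⋆ₚ H ++ G ⋆ₚ coefficientwise d H
coefficientwise-leibniz {d} d-⋆ = leibniz-from-basis ⋆ₚ-linearˡ ⋆ₚ-linearʳ (coefficientwise-isLinear d)
  λ { (f , t) (g , u) → begin
      coefficientwise d (⟨ f , t ⟩ ⋆ₚ ⟨ g , u ⟩)
        ≋⟨ ≐-cong (coefficientwise-isLinear d) (⟨⟩⋆ₚ⟨⟩ f t g u) ⟩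
      coefficientwise d ⟨ f ℕ.+ g , t ⋆ u ⟩
        ≋⟨ coefficientwise-⟨⟩ d (f ℕ.+ g) (t ⋆ u) ⟩
      d (t ⋆ u) ·X^ (f ℕ.+ g)
        ≋⟨ ≐-cong (·X^-isLinear (f ℕ.+ g)) (d-⋆ t u) ⟩
      (d t ⋆ₗ ⟦ u ⟧ ⊕ ⟦ t ⟧ ⋆ₗ d u) ·X^ (f ℕ.+ g)
        ≋⟨ ++-homo (·X^-isLinear (f ℕ.+ g)) (d t ⋆ₗ ⟦ u ⟧) (⟦ t ⟧ ⋆ₗ d u) ⟩
      (d t ⋆ₗ ⟦ u ⟧) ·X^ (f ℕ.+ g) ++ (⟦ t ⟧ ⋆ₗ d u) ·X^ (f ℕ.+ g)
        ≋⟨ ++-cong (·X^-⋆ₚ f g (d t) ⟦ u ⟧) (·X^-⋆ₚ f g ⟦ t ⟧ (d u)) ⟨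
      (d t ·X^ f) ⋆ₚ (⟦ u ⟧ ·X^ g) ++ (⟦ t ⟧ ·X^ f) ⋆ₚ (d u ·X^ g)
        ≋⟨ ++-cong (≐-trans (≐-cong (⋆ₚ-linearʳ (d t ·X^ f)) (⟦⟧·X^ g u))
                            (≐-cong (⋆ₚ-linearˡ ⟨ g , u ⟩) (≐-sym (coefficientwise-⟨⟩ d f t))))
                   (≐-trans (≐-cong (⋆ₚ-linearˡ (d u ·X^ g)) (⟦⟧·X^ f t))
                            (≐-cong (⋆ₚ-linearʳ ⟨ f , t ⟩) (≐-sym (coefficientwise-⟨⟩ d g u)))) ⟩
      coefficientwise d ⟨ f , t ⟩ ⋆ₚ ⟨ g , u ⟩ ++ ⟨ f , t ⟩ ⋆ₚ coefficientwise d ⟨ g , u ⟩ ∎ }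
  where open ≐-Reasoning

-- The derivation ∂ v_k = (k − 1) v_{k−1} of M(V)_ℚ (for k = 0 the coefficient is 0).
∂ᴹ : M → Lin
∂ᴹ (v k)   = (ℕ→ℚ (k ∸ 1) , v (k ∸ 1)) ∷ []
∂ᴹ (t ⋆ u) = ∂ᴹ t ⋆ₗ ⟦ u ⟧ ⊕ ⟦ t ⟧ ⋆ₗ ∂ᴹ u

∂ : Lin → Lin
∂ = extend ∂ᴹ

∂-isLinear : IsLinear ∂
∂-isLinear = extend-isLinear ∂ᴹ

∂ᴹ-derivation : IsDerivationOnBasis ∂ᴹ
∂ᴹ-derivation t u = ≐-refl

graftᴮ : ℕ → ℕ × M → Lin
graftᴮ n (e , t) = ⟦ v (n ℕ.+ e) ⋆ t ⟧

graft : ℕ → Poly → Lin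
graft n = extend (graftᴮ n)

graft-isLinear : ∀ n → IsLinear (graft n)
graft-isLinear n = extend-isLinear (graftᴮ n)

graft-⟨⟩ : ∀ n e t → graft n ⟨ e , t ⟩ ≐ ⟦ v (n ℕ.+ e) ⋆ t ⟧
graft-⟨⟩ n e t = extend-⟨⟩ (graftᴮ n) (e , t)

graft-·X^ : ∀ n e x → graft n (x ·X^ e) ≐ ⟦ v (n ℕ.+ e) ⟧ ⋆ₗ x
graft-·X^ n e = linear-unique (∘-isLinear (graft-isLinear n) (·X^-isLinear e)) (⋆-linearʳ ⟦ v (n ℕ.+ e) ⟧)
  (λ t → ≐-trans (≐-cong (graft-isLinear n) (⟦⟧·X^ e t)) (graft-⟨⟩ n e t))

-- exp∂ t = e^{−X∂} t, computed from the multiplicities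

expTerm : M → List ℕ → ℚ × (ℕ × M)
expTerm t ls = (mult (letters t) ls , (∣ letters t ∣ ∸ ∣ ls ∣ , relabel t ls))

exp∂ᴹ : M → Poly
exp∂ᴹ t = map (expTerm t) (box (letters t))

exp∂ : Lin → Poly
exp∂ = extend exp∂ᴹ

exp∂-isLinear : IsLinear exp∂
exp∂-isLinear = extend-isLinear exp∂ᴹ

exp∂-⟦⟧ : ∀ t → exp∂ ⟦ t ⟧ ≐ exp∂ᴹ t
exp∂-⟦⟧ = extend-⟨⟩ exp∂ᴹ

act-v≐graft : ∀ t s → act-v t (suc s) ≐ graft (suc s) (exp∂ᴹ t)
act-v≐graft t s = go (box ks) (box-inBox ks)
  where
  ks = letters t
  go : ∀ L → All (InBox ks) L →
       map (λ ls → (mult ks ls , v ((suc s ℕ.+ ∣ ks ∣) ∸ ∣ ls ∣) ⋆ relabel t ls)) L ≐ graft (suc s) (map (expTerm t) L)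
  go []        []          = ≐-refl
  go (ls ∷ L)  (ok ∷ oks)  = ++-cong head (go L oks)
    where
    head : (mult ks ls , v ((suc s ℕ.+ ∣ ks ∣) ∸ ∣ ls ∣) ⋆ relabel t ls) ∷ [] ≐
           mult ks ls • ⟦ v (suc s ℕ.+ (∣ ks ∣ ∸ ∣ ls ∣)) ⋆ relabel t ls ⟧
    head = ≐-trans (≡⇒≐ (cong (λ n → (mult ks ls , v n ⋆ relabel t ls) ∷ []) (ℕP.+-∸-assoc (suc s) (proj₂ ok))))
                   (single≐• (mult ks ls) _)

exp∂ᴹ-⋆ : ∀ t u → exp∂ᴹ (t ⋆ u) ≐ exp∂ᴹ t ⋆ₚ exp∂ᴹ u
exp∂ᴹ-⋆ t u = ≐-trans (≡⇒≐ (cong (map (expTerm (t ⋆ u))) (box-++ ks ks′))) (outer (box ks) (box-inBox ks))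
  where
  ks  = letters t
  ks′ = letters u
  F = ⋆ₚᴮ
  inner : ∀ ls → InBox ks ls → ∀ L′ → All (InBox ks′) L′ →
    map (expTerm (t ⋆ u)) (map (ls ++_) L′) ≐ mult ks ls • extend (F (proj₂ (expTerm t ls))) (map (expTerm u) L′)
  inner ls ok []          []           = ≐-refl
  inner ls ok (ls′ ∷ L′) (ok′ ∷ oks′) =
    ≐-trans (++-cong head (inner ls ok L′ oks′))
            (≡⇒≐ (sym (•-++ (mult ks ls) (mult ks′ ls′ • F (proj₂ (expTerm t ls)) (proj₂ (expTerm u ls′))) _)))
    where
    head : expTerm (t ⋆ u) (ls ++ ls′) ∷ [] ≐ mult ks ls • (mult ks′ ls′ • F (proj₂ (expTerm t ls)) (proj₂ (expTerm u ls′)))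
    head = ≐-trans (≡⇒≐ (cong₂ (λ a b → (a , b) ∷ []) (mult-++ ks ls ks′ ls′ (proj₁ ok))
                      (cong₂ _,_ (trans (cong₂ _∸_ (sum-++ ks ks′) (sum-++ ls ls′))
                                        (∸-+-distrib (sum ks) (sum ls) (sum ks′) (sum ls′) (proj₂ ok) (proj₂ ok′)))
                                 (relabel-⋆ t u ls ls′ (proj₁ ok) (proj₁ ok′)))))
             (≐-trans (single≐• _ _) (≐-sym (•-• (mult ks ls) (mult ks′ ls′) _)))
  outer : ∀ L → All (InBox ks) L →
    map (expTerm (t ⋆ u)) (concatMap (λ ls → map (ls ++_) (box ks′)) L) ≐
    extend (λ b → extend (F b) (exp∂ᴹ u)) (map (expTerm t) L)
  outer []       []         = ≐-refl
  outer (ls ∷ L) (ok ∷ oks) =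
    ≐-trans (≡⇒≐ (ListP.map-++ (expTerm (t ⋆ u)) (map (ls ++_) (box ks′)) (concatMap (λ ls → map (ls ++_) (box ks′)) L)))
            (++-cong (inner ls ok (box ks′) (box-inBox ks′)) (outer L oks))

exp∂-⋆ : ∀ x y → exp∂ (x ⋆ₗ y) ≐ exp∂ x ⋆ₚ exp∂ y
exp∂-⋆ = bilinear-unique
  (λ y → ∘-isLinear exp∂-isLinear (⋆-linearˡ y)) (λ x → ∘-isLinear exp∂-isLinear (⋆-linearʳ x))
  (λ y → ∘-isLinear (⋆ₚ-linearˡ (exp∂ y)) exp∂-isLinear) (λ x → ∘-isLinear (⋆ₚ-linearʳ (exp∂ x)) exp∂-isLinear)
  (λ t u → ≐-trans (exp∂-⟦⟧ (t ⋆ u)) (≐-trans (exp∂ᴹ-⋆ t u)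
           (≐-sym (≐-trans (≐-cong (⋆ₚ-linearˡ (exp∂ ⟦ u ⟧)) (exp∂-⟦⟧ t)) (≐-cong (⋆ₚ-linearʳ (exp∂ᴹ t)) (exp∂-⟦⟧ u))))))

module _ {B : Set} ⦃ _ : DecEq B ⦄ where

  Σ<_ : ℕ → (ℕ → FV B) → FV B
  (Σ< n) F = concatMap F (upTo n)

  Σ<-last : ∀ n F → (Σ< suc n) F ≡ (Σ< n) F ++ F n
  Σ<-last n F = trans (cong (concatMap F) (sym (ListP.upTo-∷ʳ n)))
    (trans (ListP.concatMap-++ F (upTo n) (n ∷ [])) (cong ((Σ< n) F ++_) (ListP.++-identityʳ (F n))))

  Σ<-first : ∀ n F → (Σ< suc n) F ≡ F 0 ++ (Σ< n) (F ∘ suc)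
  Σ<-first n F = cong (F 0 ++_) (trans (cong (concatMap F) (sym (ListP.map-applyUpTo (λ x → x) suc n)))
    (ListP.concatMap-map F suc (upTo n)))

  Σ<-cong : ∀ n {F G} → (∀ j → j < n → F j ≐ G j) → (Σ< n) F ≐ (Σ< n) G
  Σ<-cong zero    p = ≐-refl
  Σ<-cong (suc n) {F} {G} p = ≐-trans (≡⇒≐ (Σ<-last n F))
    (≐-trans (++-cong (Σ<-cong n (λ j j<n → p j (ℕP.m≤n⇒m≤1+n j<n))) (p n ℕP.≤-refl))
             (≡⇒≐ (sym (Σ<-last n G))))

  Σ<-zero : ∀ n {F} → (∀ j → j < n → F j ≐ []) → (Σ< n) F ≐ []
  Σ<-zero n {F} p = ≐-trans (Σ<-cong n p) (≡⇒≐ (empty (upTo n)))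
    where
    empty : ∀ (xs : List ℕ) → concatMap {B = ℚ × B} (λ _ → []) xs ≡ []
    empty []       = refl
    empty (_ ∷ xs) = empty xs

-- The exponent k − l of X at v_l, in the form produced by ∣ k ∷ [] ∣ and ∣ l ∷ [] ∣.
gap : ℕ → ℕ → ℕ
gap k l = (k ℕ.+ 0) ∸ (l ℕ.+ 0)

exp∂ᴹ-v : ∀ k → exp∂ᴹ (v k) ≡ map (λ l → (letterMult k l , (gap k l , v l))) (upTo (suc k))
exp∂ᴹ-v k = trans (cong (map (expTerm (v k))) (sym (ListP.concatMap-map (λ ls → ls ∷ []) (λ l → l ∷ []) (upTo (suc k)))))
  (trans (cong (map (expTerm (v k))) (ListP.concatMap-pure (map (λ l → l ∷ []) (upTo (suc k)))))
         (sym (ListP.map-∘ (upTo (suc k)))))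

extend-exp∂ᴹ-v : ∀ {C : Set} ⦃ _ : DecEq C ⦄ (f : ℕ × M → FV C) k →
  extend f (exp∂ᴹ (v k)) ≡ (Σ< suc k) (λ l → letterMult k l • f (gap k l , v l))
extend-exp∂ᴹ-v f k = trans (cong (extend f) (exp∂ᴹ-v k)) (ListP.concatMap-map _ _ (upTo (suc k)))

gap-diag : ∀ k → gap k k ≡ 0
gap-diag k = ℕP.n∸n≡0 (k ℕ.+ 0)

gap-suc : ∀ k j → gap k j ∸ 1 ≡ gap k (suc j)
gap-suc k j = trans (ℕP.∸-+-assoc (k ℕ.+ 0) (j ℕ.+ 0) 1) (cong ((k ℕ.+ 0) ∸_) (ℕP.+-comm (j ℕ.+ 0) 1))

exp∂ᴹ-v-ode : ∀ k → ∂X (exp∂ᴹ (v k)) ≐ (ℚ.- 1ℚ) • coefficientwise ∂ᴹ (exp∂ᴹ (v k))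
exp∂ᴹ-v-ode k = begin
  ∂X (exp∂ᴹ (v k))
    ≡⟨ trans (extend-exp∂ᴹ-v ∂Xᴮ k) (Σ<-last k A) ⟩
  (Σ< k) A ++ A k
    ≋⟨ ++-cong (Σ<-cong k A≐-B) A-last ⟩
  (Σ< k) (λ j → -B (suc j)) ++ []
    ≡⟨ ListP.++-identityʳ _ ⟩
  (Σ< k) (λ j → -B (suc j))
    ≋⟨ ++-cong -B-first ≐-refl ⟨
  -B 0 ++ (Σ< k) (λ j → -B (suc j))
    ≡⟨ Σ<-first k -B ⟨
  (Σ< suc k) -B
    ≡⟨ ListP.map-concatMap (λ p → (ℚ.- 1ℚ ℚ.* proj₁ p , proj₂ p)) B (upTo (suc k)) ⟨
  (ℚ.- 1ℚ) • (Σ< suc k) B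
    ≡⟨ cong ((ℚ.- 1ℚ) •_) (extend-exp∂ᴹ-v (coefficientwiseᴮ ∂ᴹ) k) ⟨
  (ℚ.- 1ℚ) • coefficientwise ∂ᴹ (exp∂ᴹ (v k)) ∎
  where
  open ≐-Reasoning
  A B -B : ℕ → Poly
  A l  = letterMult k l • (ℕ→ℚ (gap k l) • ⟨ gap k l ∸ 1 , v l ⟩)
  B l  = letterMult k l • (∂ᴹ (v l) ·X^ gap k l)
  -B l = (ℚ.- 1ℚ) • B l
  A-last : A k ≐ []
  A-last = •-cong (letterMult k k) (≐-trans (•-cong-scalar ⟨ gap k k ∸ 1 , v k ⟩ (cong ℕ→ℚ (gap-diag k)))
                                           (0•-zero ⟨ gap k k ∸ 1 , v k ⟩))
  -B-first : -B 0 ≐ []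
  -B-first = •-cong (ℚ.- 1ℚ) (•-cong (letterMult k 0) (≐-trans (≡⇒≐ (ListP.++-identityʳ (0ℚ • ⟨ gap k 0 , v 0 ⟩)))
                                                             (0•-zero ⟨ gap k 0 , v 0 ⟩)))
  A≐-B : ∀ j → j < k → A j ≐ -B (suc j)
  A≐-B j j<k = begin
    letterMult k j • (ℕ→ℚ (gap k j) • ⟨ gap k j ∸ 1 , v j ⟩)
      ≋⟨ •-• (letterMult k j) (ℕ→ℚ (gap k j)) ⟨ gap k j ∸ 1 , v j ⟩ ⟩
    (letterMult k j ℚ.* ℕ→ℚ (gap k j)) • ⟨ gap k j ∸ 1 , v j ⟩
      ≡⟨ cong₂ (λ a e → a • ⟨ e , v j ⟩) scalar (gap-suc k j) ⟩
    ((ℚ.- 1ℚ) ℚ.* (letterMult k (suc j) ℚ.* ℕ→ℚ j)) • ⟨ gap k (suc j) , v j ⟩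
      ≋⟨ ≐-trans (•-cong (ℚ.- 1ℚ) (≐-trans (•-cong (letterMult k (suc j)) (≡⇒≐ (ListP.++-identityʳ (ℕ→ℚ j • X))))
                                           (•-• (letterMult k (suc j)) (ℕ→ℚ j) X)))
                 (•-• (ℚ.- 1ℚ) (letterMult k (suc j) ℚ.* ℕ→ℚ j) X) ⟨
    -B (suc j) ∎
    where
    X = ⟨ gap k (suc j) , v j ⟩
    scalar : letterMult k j ℚ.* ℕ→ℚ (gap k j) ≡ (ℚ.- 1ℚ) ℚ.* (letterMult k (suc j) ℚ.* ℕ→ℚ j)
    scalar = trans (cong (λ n → letterMult k j ℚ.* ℕ→ℚ n) (cong₂ _∸_ (ℕP.+-identityʳ k) (ℕP.+-identityʳ j)))
                   (letterMult-step k j j<k)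

exp∂ᴹ-v-[X^0] : ∀ k → [X^ 0 ] (exp∂ᴹ (v k)) ≐ ⟦ v k ⟧
exp∂ᴹ-v-[X^0] k = begin
  [X^ 0 ] (exp∂ᴹ (v k))          ≡⟨ trans (extend-exp∂ᴹ-v [X^ 0 ]ᴮ k) (Σ<-last k C) ⟩
  (Σ< k) C ++ C k                ≋⟨ ++-cong (Σ<-zero k C-below) C-top ⟩
  ⟦ v k ⟧                        ∎
  where
  open ≐-Reasoning
  C : ℕ → Lin
  C l = letterMult k l • (δ 0 (gap k l) • ⟦ v l ⟧)
  C-top : C k ≐ ⟦ v k ⟧
  C-top = ≐-trans (≡⇒≐ (cong₂ (λ a e → a • (δ 0 e • ⟦ v k ⟧)) (letterMult-diag k) (gap-diag k)))
                  (≐-trans (1•-identity _) (1•-identity _))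
  C-below : ∀ j → j < k → C j ≐ []
  C-below j j<k = ≐-trans (•-cong (letterMult k j) (•-cong-scalar ⟦ v j ⟧ δ0≡0)) (•-cong (letterMult k j) (0•-zero ⟦ v j ⟧))
    where
    δ0≡0 : δ 0 (gap k j) ≡ 0ℚ
    δ0≡0 rewrite ℕP.+-identityʳ k | ℕP.+-identityʳ j | ℕP.+-∸-assoc 1 j<k = refl

-- exp∂ solves ∂X E = −∂ E with E(0) = id; hence it commutes with derivations commuting with ∂

exp∂ᴹ-ode : ∀ t → ∂X (exp∂ᴹ t) ≐ (ℚ.- 1ℚ) • coefficientwise ∂ᴹ (exp∂ᴹ t)
exp∂ᴹ-ode (v k)   = exp∂ᴹ-v-ode k
exp∂ᴹ-ode (t ⋆ u) = begin
  ∂X (exp∂ᴹ (t ⋆ u))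
    ≋⟨ ≐-cong ∂X-isLinear (exp∂ᴹ-⋆ t u) ⟩
  ∂X (Et ⋆ₚ Eu)
    ≋⟨ ∂X-leibniz Et Eu ⟩
  ∂X Et ⋆ₚ Eu ++ Et ⋆ₚ ∂X Eu
    ≋⟨ ++-cong (≐-cong (⋆ₚ-linearˡ Eu) (exp∂ᴹ-ode t)) (≐-cong (⋆ₚ-linearʳ Et) (exp∂ᴹ-ode u)) ⟩
  ((ℚ.- 1ℚ) • ∂Et) ⋆ₚ Eu ++ Et ⋆ₚ ((ℚ.- 1ℚ) • ∂Eu)
    ≋⟨ ++-cong (•-homo (⋆ₚ-linearˡ Eu) (ℚ.- 1ℚ) ∂Et) (•-homo (⋆ₚ-linearʳ Et) (ℚ.- 1ℚ) ∂Eu) ⟩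
  (ℚ.- 1ℚ) • (∂Et ⋆ₚ Eu) ++ (ℚ.- 1ℚ) • (Et ⋆ₚ ∂Eu)
    ≡⟨ •-++ (ℚ.- 1ℚ) (∂Et ⋆ₚ Eu) (Et ⋆ₚ ∂Eu) ⟨
  (ℚ.- 1ℚ) • (∂Et ⋆ₚ Eu ++ Et ⋆ₚ ∂Eu)
    ≋⟨ •-cong (ℚ.- 1ℚ) (coefficientwise-leibniz {∂ᴹ} ∂ᴹ-derivation Et Eu) ⟨
  (ℚ.- 1ℚ) • coefficientwise ∂ᴹ (Et ⋆ₚ Eu)
    ≋⟨ •-cong (ℚ.- 1ℚ) (≐-cong (coefficientwise-isLinear ∂ᴹ) (exp∂ᴹ-⋆ t u)) ⟨
  (ℚ.- 1ℚ) • coefficientwise ∂ᴹ (exp∂ᴹ (t ⋆ u)) ∎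
  where
  open ≐-Reasoning
  Et = exp∂ᴹ t
  Eu = exp∂ᴹ u
  ∂Et = coefficientwise ∂ᴹ Et
  ∂Eu = coefficientwise ∂ᴹ Eu

exp∂ᴹ-[X^0] : ∀ t → [X^ 0 ] (exp∂ᴹ t) ≐ ⟦ t ⟧
exp∂ᴹ-[X^0] (v k)   = exp∂ᴹ-v-[X^0] k
exp∂ᴹ-[X^0] (t ⋆ u) = ≐-trans (≐-cong ([X^]-isLinear 0) (exp∂ᴹ-⋆ t u))
                      (≐-trans ([X^0]-⋆ₚ (exp∂ᴹ t) (exp∂ᴹ u)) (⋆-cong≐ (exp∂ᴹ-[X^0] t) (exp∂ᴹ-[X^0] u)))

exp∂-ode : ∀ x → ∂X (exp∂ x) ≐ (ℚ.- 1ℚ) • coefficientwise ∂ᴹ (exp∂ x)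
exp∂-ode = linear-unique (∘-isLinear ∂X-isLinear exp∂-isLinear)
  (•-isLinear (ℚ.- 1ℚ) (∘-isLinear (coefficientwise-isLinear ∂ᴹ) exp∂-isLinear))
  (λ t → ≐-trans (≐-cong ∂X-isLinear (exp∂-⟦⟧ t))
         (≐-trans (exp∂ᴹ-ode t) (•-cong (ℚ.- 1ℚ) (≐-cong (coefficientwise-isLinear ∂ᴹ) (≐-sym (exp∂-⟦⟧ t))))))

exp∂-[X^0] : ∀ x → [X^ 0 ] (exp∂ x) ≐ x
exp∂-[X^0] = linear-unique (∘-isLinear ([X^]-isLinear 0) exp∂-isLinear) id-isLinear
  (λ t → ≐-trans (≐-cong ([X^]-isLinear 0) (exp∂-⟦⟧ t)) (exp∂ᴹ-[X^0] t))

exp∂-recursion : ∀ e x → ℕ→ℚ (suc e) • [X^ suc e ] (exp∂ x) ≐ (ℚ.- 1ℚ) • ∂ ([X^ e ] (exp∂ x))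
exp∂-recursion e x = begin
  ℕ→ℚ (suc e) • [X^ suc e ] (exp∂ x)
    ≋⟨ [X^]-∂X e (exp∂ x) ⟨
  [X^ e ] (∂X (exp∂ x))
    ≋⟨ ≐-cong ([X^]-isLinear e) (exp∂-ode x) ⟩
  [X^ e ] ((ℚ.- 1ℚ) • coefficientwise ∂ᴹ (exp∂ x))
    ≋⟨ •-homo ([X^]-isLinear e) (ℚ.- 1ℚ) (coefficientwise ∂ᴹ (exp∂ x)) ⟩
  (ℚ.- 1ℚ) • [X^ e ] (coefficientwise ∂ᴹ (exp∂ x))
    ≋⟨ •-cong (ℚ.- 1ℚ) ([X^]-coefficientwise ∂ᴹ e (exp∂ x)) ⟩
  (ℚ.- 1ℚ) • ∂ ([X^ e ] (exp∂ x)) ∎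
  where open ≐-Reasoning

act : M → Lin → Lin
act t = extend (act-M t)

act-isLinear : ∀ t → IsLinear (act t)
act-isLinear t = extend-isLinear (act-M t)

∂graftᴮ : ℕ → ℕ × M → Lin
∂graftᴮ n (e , t) = ∂ᴹ (v (n ℕ.+ e)) ⋆ₗ ⟦ t ⟧

∂graft : ℕ → Poly → Lin
∂graft n = extend (∂graftᴮ n)

∂-graft : ∀ n G → ∂ (graft n G) ≐ ∂graft n G ++ graft n (coefficientwise ∂ᴹ G)
∂-graft n = linear-unique (∘-isLinear ∂-isLinear (graft-isLinear n))
  (+-isLinear (extend-isLinear (∂graftᴮ n)) (∘-isLinear (graft-isLinear n) (coefficientwise-isLinear ∂ᴹ)))
  λ { (e , t) → begin
      ∂ (graft n ⟨ e , t ⟩)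
        ≋⟨ ≐-cong ∂-isLinear (graft-⟨⟩ n e t) ⟩
      ∂ ⟦ v (n ℕ.+ e) ⋆ t ⟧
        ≋⟨ extend-⟨⟩ ∂ᴹ (v (n ℕ.+ e) ⋆ t) ⟩
      ∂graftᴮ n (e , t) ++ ⟦ v (n ℕ.+ e) ⟧ ⋆ₗ ∂ᴹ t
        ≋⟨ ++-cong (≐-sym (extend-⟨⟩ (∂graftᴮ n) (e , t))) (≐-sym (graft-·X^ n e (∂ᴹ t))) ⟩
      ∂graft n ⟨ e , t ⟩ ++ graft n (∂ᴹ t ·X^ e)
        ≋⟨ ++-cong ≐-refl (≐-cong (graft-isLinear n) (coefficientwise-⟨⟩ ∂ᴹ e t)) ⟨
      ∂graft n ⟨ e , t ⟩ ++ graft n (coefficientwise ∂ᴹ ⟨ e , t ⟩) ∎ }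
  where open ≐-Reasoning

-- ∂ on the grafted letter gives (n + e − 1) v_{n−1+e}; the X-derivative takes away e of it (here n = s + 1).
∂graft-∂X : ∀ s G → ∂graft (suc s) G ++ graft (suc s) ((ℚ.- 1ℚ) • ∂X G) ≐ ℕ→ℚ s • graft s G
∂graft-∂X s = linear-unique
  (+-isLinear (extend-isLinear (∂graftᴮ (suc s))) (∘-isLinear (graft-isLinear (suc s)) (•-isLinear (ℚ.- 1ℚ) ∂X-isLinear)))
  (•-isLinear (ℕ→ℚ s) (graft-isLinear s))
  λ { (e , t) → begin
      ∂graft (suc s) ⟨ e , t ⟩ ++ graft (suc s) ((ℚ.- 1ℚ) • ∂X ⟨ e , t ⟩)
        ≋⟨ ++-cong (≐-trans (extend-⟨⟩ (∂graftᴮ (suc s)) (e , t)) (single≐• _ _))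
                   (≐-trans (•-homo (graft-isLinear (suc s)) (ℚ.- 1ℚ) (∂X ⟨ e , t ⟩))
                   (•-cong (ℚ.- 1ℚ) (≐-trans (≐-cong (graft-isLinear (suc s)) (∂X-⟨⟩ e t))
                   (≐-trans (•-homo (graft-isLinear (suc s)) (ℕ→ℚ e) ⟨ e ∸ 1 , t ⟩)
                            (•-cong (ℕ→ℚ e) (graft-⟨⟩ (suc s) (e ∸ 1) t)))))) ⟩
      (ℕ→ℚ (s ℕ.+ e) ℚ.* 1ℚ) • ⟦ v (s ℕ.+ e) ⋆ t ⟧ ++ (ℚ.- 1ℚ) • (ℕ→ℚ e • ⟦ v (suc s ℕ.+ (e ∸ 1)) ⋆ t ⟧)
        ≋⟨ combine e ⟩
      ℕ→ℚ s • ⟦ v (s ℕ.+ e) ⋆ t ⟧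
        ≋⟨ •-cong (ℕ→ℚ s) (graft-⟨⟩ s e t) ⟨
      ℕ→ℚ s • graft s ⟨ e , t ⟩ ∎ }
  where
  open ≐-Reasoning
  combine : ∀ {t} e → (ℕ→ℚ (s ℕ.+ e) ℚ.* 1ℚ) • ⟦ v (s ℕ.+ e) ⋆ t ⟧ ++ (ℚ.- 1ℚ) • (ℕ→ℚ e • ⟦ v (suc s ℕ.+ (e ∸ 1)) ⋆ t ⟧)
                      ≐ ℕ→ℚ s • ⟦ v (s ℕ.+ e) ⋆ t ⟧
  combine {t} zero    = ≐-trans (++-cong (•-cong-scalar ⟦ v (s ℕ.+ 0) ⋆ t ⟧ (trans (ℚP.*-identityʳ _) (cong ℕ→ℚ (ℕP.+-identityʳ s))))
                                         (•-cong (ℚ.- 1ℚ) (0•-zero ⟦ v (suc s ℕ.+ 0) ⋆ t ⟧)))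
                                (≡⇒≐ (ListP.++-identityʳ _))
  combine {t} (suc e) = begin
    (ℕ→ℚ (s ℕ.+ suc e) ℚ.* 1ℚ) • b ++ (ℚ.- 1ℚ) • (ℕ→ℚ (suc e) • ⟦ v (suc s ℕ.+ e) ⋆ t ⟧)
      ≡⟨ cong (λ n → (ℕ→ℚ (s ℕ.+ suc e) ℚ.* 1ℚ) • b ++ (ℚ.- 1ℚ) • (ℕ→ℚ (suc e) • ⟦ v n ⋆ t ⟧)) (sym (ℕP.+-suc s e)) ⟩
    (ℕ→ℚ (s ℕ.+ suc e) ℚ.* 1ℚ) • b ++ (ℚ.- 1ℚ) • (ℕ→ℚ (suc e) • b)
      ≋⟨ ++-congʳ ((ℕ→ℚ (s ℕ.+ suc e) ℚ.* 1ℚ) • b) (•-• (ℚ.- 1ℚ) (ℕ→ℚ (suc e)) b) ⟩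
    (ℕ→ℚ (s ℕ.+ suc e) ℚ.* 1ℚ) • b ++ ((ℚ.- 1ℚ) ℚ.* ℕ→ℚ (suc e)) • b
      ≋⟨ •-distribʳ (ℕ→ℚ (s ℕ.+ suc e) ℚ.* 1ℚ) ((ℚ.- 1ℚ) ℚ.* ℕ→ℚ (suc e)) b ⟩
    (ℕ→ℚ (s ℕ.+ suc e) ℚ.* 1ℚ ℚ.+ (ℚ.- 1ℚ) ℚ.* ℕ→ℚ (suc e)) • b
      ≡⟨ cong (_• b) (trans (cong (λ q → q ℚ.* 1ℚ ℚ.+ (ℚ.- 1ℚ) ℚ.* ℕ→ℚ (suc e)) (ℕ→ℚ-+ s (suc e)))
                            (cancel (ℕ→ℚ s) (ℕ→ℚ (suc e)))) ⟩
    ℕ→ℚ s • b ∎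
    where
    b = ⟦ v (s ℕ.+ suc e) ⋆ t ⟧
    cancel : ∀ a c → (a ℚ.+ c) ℚ.* 1ℚ ℚ.+ (ℚ.- 1ℚ) ℚ.* c ≡ a
    cancel = solve-∀ ℚ-ring

act-⟦⟧ : ∀ t u → act t ⟦ u ⟧ ≐ act-M t u
act-⟦⟧ t = extend-⟨⟩ (act-M t)

∂-act-M : ∀ t u → ∂ (act-M t u) ≐ act t (∂ᴹ u)
∂-act-M t (v zero)    = ≐-sym (≐-trans (linear-single (act-isLinear t) 0ℚ (v 0)) (0•-zero (act t ⟦ v 0 ⟧)))
∂-act-M t (v (suc s)) = begin
  ∂ (act-v t (suc s))
    ≋⟨ ≐-cong ∂-isLinear (act-v≐graft t s) ⟩
  ∂ (graft (suc s) E)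
    ≋⟨ ∂-graft (suc s) E ⟩
  ∂graft (suc s) E ++ graft (suc s) (coefficientwise ∂ᴹ E)
    ≋⟨ ++-congʳ (∂graft (suc s) E) (≐-cong (graft-isLinear (suc s)) ∂E≐-∂XE) ⟩
  ∂graft (suc s) E ++ graft (suc s) ((ℚ.- 1ℚ) • ∂X E)
    ≋⟨ ∂graft-∂X s E ⟩
  ℕ→ℚ s • graft s E
    ≋⟨ graft≐act-v s ⟩
  ℕ→ℚ s • act-v t s
    ≋⟨ •-cong (ℕ→ℚ s) (act-⟦⟧ t (v s)) ⟨
  ℕ→ℚ s • act t ⟦ v s ⟧
    ≋⟨ linear-single (act-isLinear t) (ℕ→ℚ s) (v s) ⟨
  act t (∂ᴹ (v (suc s))) ∎
  where
  open ≐-Reasoning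
  E = exp∂ᴹ t
  ∂E≐-∂XE : coefficientwise ∂ᴹ E ≐ (ℚ.- 1ℚ) • ∂X E
  ∂E≐-∂XE = begin
    coefficientwise ∂ᴹ E                          ≋⟨ 1•-identity _ ⟨
    1ℚ • coefficientwise ∂ᴹ E                     ≋⟨ •-• (ℚ.- 1ℚ) (ℚ.- 1ℚ) _ ⟨
    (ℚ.- 1ℚ) • ((ℚ.- 1ℚ) • coefficientwise ∂ᴹ E)  ≋⟨ •-cong (ℚ.- 1ℚ) (exp∂ᴹ-ode t) ⟨
    (ℚ.- 1ℚ) • ∂X E                               ∎
  graft≐act-v : ∀ s → ℕ→ℚ s • graft s E ≐ ℕ→ℚ s • act-v t s
  graft≐act-v zero     = ≐-trans (0•-zero (graft 0 E)) (≐-sym (0•-zero (act-v t 0)))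
  graft≐act-v (suc s′) = •-cong (ℕ→ℚ (suc s′)) (≐-sym (act-v≐graft t s′))
∂-act-M t (u₁ ⋆ u₂) = begin
  ∂ (a₁ ⋆ₗ U₂ ⊕ U₁ ⋆ₗ a₂)
    ≋⟨ ++-homo ∂-isLinear (a₁ ⋆ₗ U₂) (U₁ ⋆ₗ a₂) ⟩
  ∂ (a₁ ⋆ₗ U₂) ⊕ ∂ (U₁ ⋆ₗ a₂)
    ≋⟨ ++-cong (extend-leibniz {∂ᴹ} ∂ᴹ-derivation a₁ U₂)
               (extend-leibniz {∂ᴹ} ∂ᴹ-derivation U₁ a₂) ⟩
  (∂ a₁ ⋆ₗ U₂ ⊕ a₁ ⋆ₗ ∂ U₂) ⊕ (∂ U₁ ⋆ₗ a₂ ⊕ U₁ ⋆ₗ ∂ a₂)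
    ≋⟨ ++-cong (++-cong (≐-cong (⋆-linearˡ U₂) (∂-act-M t u₁)) (≐-cong (⋆-linearʳ a₁) (extend-⟨⟩ ∂ᴹ u₂)))
                (++-cong (≐-cong (⋆-linearˡ a₂) (extend-⟨⟩ ∂ᴹ u₁)) (≐-cong (⋆-linearʳ U₁) (∂-act-M t u₂))) ⟩
  (P ⊕ a₁ ⋆ₗ ∂ᴹ u₂) ⊕ (∂ᴹ u₁ ⋆ₗ a₂ ⊕ S)
    ≋⟨ ++-interchange P (a₁ ⋆ₗ ∂ᴹ u₂) (∂ᴹ u₁ ⋆ₗ a₂) S ⟩
  (P ⊕ ∂ᴹ u₁ ⋆ₗ a₂) ⊕ (a₁ ⋆ₗ ∂ᴹ u₂ ⊕ S)
    ≋⟨ ++-cong (++-congʳ P (≐-cong (⋆-linearʳ (∂ᴹ u₁)) (act-⟦⟧ t u₂)))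
              (++-congˡ S (≐-cong (⋆-linearˡ (∂ᴹ u₂)) (act-⟦⟧ t u₁))) ⟨
  (P ⊕ ∂ᴹ u₁ ⋆ₗ act t U₂) ⊕ (act t U₁ ⋆ₗ ∂ᴹ u₂ ⊕ S)
    ≋⟨ ++-cong (extend-leibniz {act-M t} (act-M-derivation t) (∂ᴹ u₁) U₂)
              (extend-leibniz {act-M t} (act-M-derivation t) U₁ (∂ᴹ u₂)) ⟨
  act t (∂ᴹ u₁ ⋆ₗ U₂) ⊕ act t (U₁ ⋆ₗ ∂ᴹ u₂)
    ≋⟨ ++-homo (act-isLinear t) (∂ᴹ u₁ ⋆ₗ U₂) (U₁ ⋆ₗ ∂ᴹ u₂) ⟨
  act t (∂ᴹ (u₁ ⋆ u₂)) ∎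
  where
  open ≐-Reasoning
  a₁ = act-M t u₁
  a₂ = act-M t u₂
  U₁ = ⟦ u₁ ⟧
  U₂ = ⟦ u₂ ⟧
  P = act t (∂ᴹ u₁) ⋆ₗ U₂
  S = U₁ ⋆ₗ act t (∂ᴹ u₂)

∂-act : ∀ t x → ∂ (act t x) ≐ act t (∂ x)
∂-act t = linear-unique (∘-isLinear ∂-isLinear (act-isLinear t)) (∘-isLinear (act-isLinear t) ∂-isLinear)
  (λ u → ≐-trans (≐-cong ∂-isLinear (act-⟦⟧ t u)) (≐-trans (∂-act-M t u) (≐-sym (≐-cong (act-isLinear t) (extend-⟨⟩ ∂ᴹ u)))))

[X^]-exp∂-act : ∀ e t x → [X^ e ] (exp∂ (act t x)) ≐ act t ([X^ e ] (exp∂ x))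
[X^]-exp∂-act zero    t x = ≐-trans (exp∂-[X^0] (act t x)) (≐-cong (act-isLinear t) (≐-sym (exp∂-[X^0] x)))
[X^]-exp∂-act (suc e) t x = •-cancel (ℕ→ℚ (suc e)) ⦃ ℚ.≢-nonZero (ℕ→ℚ-suc≢0 e) ⦄ (begin
  ℕ→ℚ (suc e) • [X^ suc e ] (exp∂ (act t x))
    ≋⟨ exp∂-recursion e (act t x) ⟩
  (ℚ.- 1ℚ) • ∂ ([X^ e ] (exp∂ (act t x)))
    ≋⟨ •-cong (ℚ.- 1ℚ) (≐-cong ∂-isLinear ([X^]-exp∂-act e t x)) ⟩
  (ℚ.- 1ℚ) • ∂ (act t ([X^ e ] (exp∂ x)))
    ≋⟨ •-cong (ℚ.- 1ℚ) (∂-act t ([X^ e ] (exp∂ x))) ⟩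
  (ℚ.- 1ℚ) • act t (∂ ([X^ e ] (exp∂ x)))
    ≋⟨ •-homo (act-isLinear t) (ℚ.- 1ℚ) (∂ ([X^ e ] (exp∂ x))) ⟨
  act t ((ℚ.- 1ℚ) • ∂ ([X^ e ] (exp∂ x)))
    ≋⟨ ≐-cong (act-isLinear t) (exp∂-recursion e x) ⟨
  act t (ℕ→ℚ (suc e) • [X^ suc e ] (exp∂ x))
    ≋⟨ •-homo (act-isLinear t) (ℕ→ℚ (suc e)) ([X^ suc e ] (exp∂ x)) ⟩
  ℕ→ℚ (suc e) • act t ([X^ suc e ] (exp∂ x)) ∎)
  where open ≐-Reasoning

exp∂-act : ∀ t x → exp∂ (act t x) ≐ coefficientwise (act-M t) (exp∂ x)
exp∂-act t x = ≐-by-[X^] λ e → ≐-trans ([X^]-exp∂-act e t x) (≐-sym ([X^]-coefficientwise (act-M t) e (exp∂ x)))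

-- The Lie relation ≈ applied coefficientwise to polynomials

infix 4 _≈ₚ_
data _≈ₚ_ : Poly → Poly → Set where
  ≈ₚ-refl    : ∀ {G} → G ≈ₚ G
  ≈ₚ-sym     : ∀ {G H} → G ≈ₚ H → H ≈ₚ G
  ≈ₚ-trans   : ∀ {G H K} → G ≈ₚ H → H ≈ₚ K → G ≈ₚ K
  ++-cong-≈ₚ : ∀ {G G′ H H′} → G ≈ₚ G′ → H ≈ₚ H′ → G ++ H ≈ₚ G′ ++ H′
  ++-comm-≈ₚ : ∀ G H → G ++ H ≈ₚ H ++ G
  merge-≈ₚ   : ∀ a c b → (a , b) ∷ (c , b) ∷ [] ≈ₚ (a ℚ.+ c , b) ∷ []
  zero-≈ₚ    : ∀ b → (0ℚ , b) ∷ [] ≈ₚ []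
  ·X^-cong   : ∀ e {x y} → x ≈ y → x ·X^ e ≈ₚ y ·X^ e

≈ₚ-isVectorRelation : IsVectorRelation _≈ₚ_
≈ₚ-isVectorRelation = record
  { refl′ = ≈ₚ-refl ; sym′ = ≈ₚ-sym ; trans′ = ≈ₚ-trans ; ++-cong′ = ++-cong-≈ₚ
  ; ++-comm′ = ++-comm-≈ₚ ; merge′ = merge-≈ₚ ; zero′ = zero-≈ₚ }

≐⇒≈ₚ : ∀ {G H} → G ≐ H → G ≈ₚ H
≐⇒≈ₚ = ≐⇒R ≈ₚ-isVectorRelation

module _ {C : Set} ⦃ _ : DecEq C ⦄ {R : FV C → FV C → Set} (isVR : IsVectorRelation R)
         {L : Poly → FV C} (L-lin : IsLinear L)
         (·X^-resp : ∀ e {x y} → x ≈ y → R (L (x ·X^ e)) (L (y ·X^ e))) where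
  open IsVectorRelation isVR

  linear-respects-≈ₚ : ∀ {G H} → G ≈ₚ H → R (L G) (L H)
  linear-respects-≈ₚ ≈ₚ-refl          = refl′
  linear-respects-≈ₚ (≈ₚ-sym p)       = sym′ (linear-respects-≈ₚ p)
  linear-respects-≈ₚ (≈ₚ-trans p q)   = trans′ (linear-respects-≈ₚ p) (linear-respects-≈ₚ q)
  linear-respects-≈ₚ (++-cong-≈ₚ {G} {G′} {H} {H′} p q) =
    trans′ (≐⇒R isVR (++-homo L-lin G H))
      (trans′ (++-cong′ (linear-respects-≈ₚ p) (linear-respects-≈ₚ q)) (≐⇒R isVR (≐-sym (++-homo L-lin G′ H′))))
  linear-respects-≈ₚ (++-comm-≈ₚ G H) =
    trans′ (≐⇒R isVR (++-homo L-lin G H)) (trans′ (++-comm′ (L G) (L H)) (≐⇒R isVR (≐-sym (++-homo L-lin H G))))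
  linear-respects-≈ₚ (merge-≈ₚ a c b) = ≐⇒R isVR (≐-cong L-lin (merge≐ a c b))
  linear-respects-≈ₚ (zero-≈ₚ b)      = ≐⇒R isVR (≐-cong L-lin (zero≐ b))
  linear-respects-≈ₚ (·X^-cong e p)   = ·X^-resp e p

•-cong-≈ₚ : ∀ q {G H} → G ≈ₚ H → q • G ≈ₚ q • H
•-cong-≈ₚ q = linear-respects-≈ₚ ≈ₚ-isVectorRelation (•-isLinear q id-isLinear)
  (λ e {x} {y} x≈y → ≈ₚ-trans (≐⇒≈ₚ (≐-sym (•-homo (·X^-isLinear e) q x)))
                       (≈ₚ-trans (·X^-cong e (·-cong q x≈y)) (≐⇒≈ₚ (•-homo (·X^-isLinear e) q y))))

≈ₚ-isLinearRelation : IsLinearRelation _≈ₚ_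
≈ₚ-isLinearRelation = record { isVectorRelation = ≈ₚ-isVectorRelation ; •-cong′ = •-cong-≈ₚ }

graft-cong : ∀ n {G H} → G ≈ₚ H → graft n G ≈ graft n H
graft-cong n = linear-respects-≈ₚ ≈-isVectorRelation (graft-isLinear n)
  (λ e {x} {y} x≈y → ≈-trans (≐⇒≈ (graft-·X^ n e x)) (≈-trans (⋆-congʳ ⟦ v (n ℕ.+ e) ⟧ x≈y) (≐⇒≈ (≐-sym (graft-·X^ n e y)))))

⋆ₚ-congˡ : ∀ H {G G′} → G ≈ₚ G′ → G ⋆ₚ H ≈ₚ G′ ⋆ₚ H
⋆ₚ-congˡ H = linear-respects-≈ₚ ≈ₚ-isVectorRelation (⋆ₚ-linearˡ H)
  (λ e {x} {y} x≈y → linear-unique-up-to ≈ₚ-isLinearRelation (⋆ₚ-linearʳ (x ·X^ e)) (⋆ₚ-linearʳ (y ·X^ e))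
     (λ { (f , u) → ≈ₚ-trans (≐⇒≈ₚ (monomial x))
                      (≈ₚ-trans (·X^-cong (e ℕ.+ f) (⋆-congˡ ⟦ u ⟧ x≈y)) (≐⇒≈ₚ (≐-sym (monomial y)))) }) H)
  where
  monomial : ∀ {e f u} x → (x ·X^ e) ⋆ₚ ⟨ f , u ⟩ ≐ (x ⋆ₗ ⟦ u ⟧) ·X^ (e ℕ.+ f)
  monomial {e} {f} {u} x = ≐-trans (≐-cong (⋆ₚ-linearʳ (x ·X^ e)) (≐-sym (⟦⟧·X^ f u))) (·X^-⋆ₚ e f x ⟦ u ⟧)

⋆ₚ-congʳ : ∀ G {H H′} → H ≈ₚ H′ → G ⋆ₚ H ≈ₚ G ⋆ₚ H′
⋆ₚ-congʳ G = linear-respects-≈ₚ ≈ₚ-isVectorRelation (⋆ₚ-linearʳ G)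
  (λ f {x} {y} x≈y → linear-unique-up-to ≈ₚ-isLinearRelation (⋆ₚ-linearˡ (x ·X^ f)) (⋆ₚ-linearˡ (y ·X^ f))
     (λ { (e , t) → ≈ₚ-trans (≐⇒≈ₚ (monomial x))
                      (≈ₚ-trans (·X^-cong (e ℕ.+ f) (⋆-congʳ ⟦ t ⟧ x≈y)) (≐⇒≈ₚ (≐-sym (monomial y)))) }) G)
  where
  monomial : ∀ {e f t} x → ⟨ e , t ⟩ ⋆ₚ (x ·X^ f) ≐ (⟦ t ⟧ ⋆ₗ x) ·X^ (e ℕ.+ f)
  monomial {e} {f} {t} x = ≐-trans (≐-cong (⋆ₚ-linearˡ (x ·X^ f)) (≐-sym (⟦⟧·X^ e t))) (·X^-⋆ₚ e f ⟦ t ⟧ x)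

⟨⟩⋆ₚ⟨⟩-·X^ : ∀ e t f u → ⟨ e , t ⟩ ⋆ₚ ⟨ f , u ⟩ ≐ (⟦ t ⟧ ⋆ₗ ⟦ u ⟧) ·X^ (e ℕ.+ f)
⟨⟩⋆ₚ⟨⟩-·X^ e t f u = ≐-trans (⟨⟩⋆ₚ⟨⟩ e t f u) (≐-sym (⟦⟧·X^ (e ℕ.+ f) (t ⋆ u)))

⋆ₚ-anticomm : ∀ G H → G ⋆ₚ H ++ H ⋆ₚ G ≈ₚ []
⋆ₚ-anticomm = bilinear-unique-up-to ≈ₚ-isLinearRelation
  (λ H → +-isLinear (⋆ₚ-linearˡ H) (⋆ₚ-linearʳ H)) (λ G → +-isLinear (⋆ₚ-linearʳ G) (⋆ₚ-linearˡ G))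
  (λ _ → []-isLinear) (λ _ → []-isLinear)
  λ { (e , t) (f , u) →
      ≈ₚ-trans (≐⇒≈ₚ (≐-trans (++-cong (⟨⟩⋆ₚ⟨⟩-·X^ e t f u)
                                        (≐-trans (⟨⟩⋆ₚ⟨⟩-·X^ f u e t)
                                                 (≡⇒≐ (cong ((⟦ u ⟧ ⋆ₗ ⟦ t ⟧) ·X^_) (ℕP.+-comm f e)))))
                              (≐-sym (++-homo (·X^-isLinear (e ℕ.+ f)) (⟦ t ⟧ ⋆ₗ ⟦ u ⟧) (⟦ u ⟧ ⋆ₗ ⟦ t ⟧)))))
               (·X^-cong (e ℕ.+ f) (⋆-anticomm ⟦ t ⟧ ⟦ u ⟧)) }

⋆ₚ-alt : ∀ G → G ⋆ₚ G ≈ₚ []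
⋆ₚ-alt []                  = ≈ₚ-refl
⋆ₚ-alt ((a , (e , t)) ∷ G) =
  ≈ₚ-trans (≐⇒≈ₚ expand) (++-cong-≈ₚ (++-cong-≈ₚ g⋆g (⋆ₚ-anticomm g G)) (⋆ₚ-alt G))
  where
  g = (a , (e , t)) ∷ []
  expand : (g ++ G) ⋆ₚ (g ++ G) ≐ (g ⋆ₚ g ++ (g ⋆ₚ G ++ G ⋆ₚ g)) ++ G ⋆ₚ G
  expand = ≐-trans (++-homo (⋆ₚ-linearˡ (g ++ G)) g G)
    (≐-trans (++-cong (++-homo (⋆ₚ-linearʳ g) g G) (++-homo (⋆ₚ-linearʳ G) g G))
             (≡⇒≐ (trans (ListP.++-assoc (g ⋆ₚ g) (g ⋆ₚ G) (G ⋆ₚ g ++ G ⋆ₚ G))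
                  (trans (cong (g ⋆ₚ g ++_) (sym (ListP.++-assoc (g ⋆ₚ G) (G ⋆ₚ g) (G ⋆ₚ G))))
                         (sym (ListP.++-assoc (g ⋆ₚ g) (g ⋆ₚ G ++ G ⋆ₚ g) (G ⋆ₚ G)))))))
  x = (a , t) ∷ []
  g≐x·X^e : g ≐ x ·X^ e
  g≐x·X^e = mk≐ λ w → cong (λ r → r ℚ.* δ w (e , t) ℚ.+ 0ℚ) (sym (ℚP.*-identityʳ a))
  g⋆g : g ⋆ₚ g ≈ₚ []
  g⋆g = ≈ₚ-trans (≐⇒≈ₚ (≐-trans (≐-cong (⋆ₚ-linearˡ g) g≐x·X^e)
                         (≐-trans (≐-cong (⋆ₚ-linearʳ (x ·X^ e)) g≐x·X^e) (·X^-⋆ₚ e e x x))))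
                 (·X^-cong (e ℕ.+ e) (alt x))

jacobiatorₚ : Poly → Poly → Poly → Poly
jacobiatorₚ G H K = (G ⋆ₚ (H ⋆ₚ K) ++ H ⋆ₚ (K ⋆ₚ G)) ++ K ⋆ₚ (G ⋆ₚ H)

⋆ₚ-jacobi : ∀ G H K → jacobiatorₚ G H K ≈ₚ []
⋆ₚ-jacobi G H K =
  linear-unique-up-to ≈ₚ-isLinearRelation (linear₁ H K) []-isLinear (λ b →
  linear-unique-up-to ≈ₚ-isLinearRelation (linear₂ ⟨ b ⟩ K) []-isLinear (λ c →
  linear-unique-up-to ≈ₚ-isLinearRelation (linear₃ ⟨ b ⟩ ⟨ c ⟩) []-isLinear (λ d → on-basis b c d) K) H) G
  where
  linear₁ : ∀ H K → IsLinear (λ G → jacobiatorₚ G H K)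
  linear₁ H K = +-isLinear (+-isLinear (⋆ₚ-linearˡ (H ⋆ₚ K)) (∘-isLinear (⋆ₚ-linearʳ H) (⋆ₚ-linearʳ K)))
                           (∘-isLinear (⋆ₚ-linearʳ K) (⋆ₚ-linearˡ H))
  linear₂ : ∀ G K → IsLinear (λ H → jacobiatorₚ G H K)
  linear₂ G K = +-isLinear (+-isLinear (∘-isLinear (⋆ₚ-linearʳ G) (⋆ₚ-linearˡ K)) (⋆ₚ-linearˡ (K ⋆ₚ G)))
                           (∘-isLinear (⋆ₚ-linearʳ K) (⋆ₚ-linearʳ G))
  linear₃ : ∀ G H → IsLinear (λ K → jacobiatorₚ G H K)
  linear₃ G H = +-isLinear (+-isLinear (∘-isLinear (⋆ₚ-linearʳ G) (⋆ₚ-linearʳ H)) (∘-isLinear (⋆ₚ-linearʳ H) (⋆ₚ-linearˡ G)))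
                           (⋆ₚ-linearˡ (G ⋆ₚ H))
  triple : ∀ e₁ t₁ e₂ t₂ e₃ t₃ → ⟨ e₁ , t₁ ⟩ ⋆ₚ (⟨ e₂ , t₂ ⟩ ⋆ₚ ⟨ e₃ , t₃ ⟩) ≐ ⟨ e₁ ℕ.+ (e₂ ℕ.+ e₃) , t₁ ⋆ (t₂ ⋆ t₃) ⟩
  triple e₁ t₁ e₂ t₂ e₃ t₃ =
    ≐-trans (≐-cong (⋆ₚ-linearʳ ⟨ e₁ , t₁ ⟩) (⟨⟩⋆ₚ⟨⟩ e₂ t₂ e₃ t₃)) (⟨⟩⋆ₚ⟨⟩ e₁ t₁ (e₂ ℕ.+ e₃) (t₂ ⋆ t₃))
  on-basis : ∀ b c d → jacobiatorₚ ⟨ b ⟩ ⟨ c ⟩ ⟨ d ⟩ ≈ₚ []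
  on-basis (e₁ , t₁) (e₂ , t₂) (e₃ , t₃) =
    ≈ₚ-trans (≐⇒≈ₚ (≐-trans (++-cong (++-cong (triple e₁ t₁ e₂ t₂ e₃ t₃)
                                               (≐-trans (triple e₂ t₂ e₃ t₃ e₁ t₁) (≡⇒≐ (cong (λ n → ⟨ n , t₂ ⋆ (t₃ ⋆ t₁) ⟩) (rotate₁ e₁ e₂ e₃)))))
                                      (≐-trans (triple e₃ t₃ e₁ t₁ e₂ t₂) (≡⇒≐ (cong (λ n → ⟨ n , t₃ ⋆ (t₁ ⋆ t₂) ⟩) (rotate₂ e₁ e₂ e₃)))))
                            (≐-sym (≐-trans (++-homo (·X^-isLinear E) (⟦ t₁ ⋆ (t₂ ⋆ t₃) ⟧ ⊕ ⟦ t₂ ⋆ (t₃ ⋆ t₁) ⟧) ⟦ t₃ ⋆ (t₁ ⋆ t₂) ⟧)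
                                            (++-cong (≐-trans (++-homo (·X^-isLinear E) ⟦ t₁ ⋆ (t₂ ⋆ t₃) ⟧ ⟦ t₂ ⋆ (t₃ ⋆ t₁) ⟧)
                                                              (++-cong (⟦⟧·X^ E _) (⟦⟧·X^ E _)))
                                                     (⟦⟧·X^ E _))))))
             (·X^-cong E (jacobi ⟦ t₁ ⟧ ⟦ t₂ ⟧ ⟦ t₃ ⟧))
    where
    E = e₁ ℕ.+ (e₂ ℕ.+ e₃)
    rotate₁ : ∀ a b c → b ℕ.+ (c ℕ.+ a) ≡ a ℕ.+ (b ℕ.+ c)
    rotate₁ = ℕ-Solver.solve-∀
    rotate₂ : ∀ a b c → c ℕ.+ (a ℕ.+ b) ≡ a ℕ.+ (b ℕ.+ c)
    rotate₂ = ℕ-Solver.solve-∀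

exp∂-cong : ∀ {x y} → x ≈ y → exp∂ x ≈ₚ exp∂ y
exp∂-cong = linear-respects-≈ ≈ₚ-isVectorRelation exp∂-isLinear
  (λ {x} {x′} y _ Ex≈Ex′ → ≈ₚ-trans (≐⇒≈ₚ (exp∂-⋆ x y)) (≈ₚ-trans (⋆ₚ-congˡ (exp∂ y) Ex≈Ex′) (≐⇒≈ₚ (≐-sym (exp∂-⋆ x′ y)))))
  (λ x {y} {y′} _ Ey≈Ey′ → ≈ₚ-trans (≐⇒≈ₚ (exp∂-⋆ x y)) (≈ₚ-trans (⋆ₚ-congʳ (exp∂ x) Ey≈Ey′) (≐⇒≈ₚ (≐-sym (exp∂-⋆ x y′)))))
  (λ x → ≈ₚ-trans (≐⇒≈ₚ (exp∂-⋆ x x)) (⋆ₚ-alt (exp∂ x)))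
  (λ x y z → ≈ₚ-trans (≐⇒≈ₚ (exp∂-jacobiator x y z)) (⋆ₚ-jacobi (exp∂ x) (exp∂ y) (exp∂ z)))
  where
  exp∂-⋆² : ∀ a b c → exp∂ (a ⋆ₗ (b ⋆ₗ c)) ≐ exp∂ a ⋆ₚ (exp∂ b ⋆ₚ exp∂ c)
  exp∂-⋆² a b c = ≐-trans (exp∂-⋆ a (b ⋆ₗ c)) (≐-cong (⋆ₚ-linearʳ (exp∂ a)) (exp∂-⋆ b c))
  exp∂-jacobiator : ∀ x y z → exp∂ (jacobiator x y z) ≐ jacobiatorₚ (exp∂ x) (exp∂ y) (exp∂ z)
  exp∂-jacobiator x y z =
    ≐-trans (++-homo exp∂-isLinear (x ⋆ₗ (y ⋆ₗ z) ⊕ y ⋆ₗ (z ⋆ₗ x)) (z ⋆ₗ (x ⋆ₗ y)))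
      (++-cong (≐-trans (++-homo exp∂-isLinear (x ⋆ₗ (y ⋆ₗ z)) (y ⋆ₗ (z ⋆ₗ x))) (++-cong (exp∂-⋆² x y z) (exp∂-⋆² y z x)))
               (exp∂-⋆² z x y))

-- Well-definedness of ▷ₐ in its left argument

▷-v₀ : ∀ x → x ▷ₐ ⟦ v 0 ⟧ ≐ []
▷-v₀ = linear-unique (▷-linearˡ ⟦ v 0 ⟧) []-isLinear (λ t → ⟦⟧▷⟦⟧ t (v 0))

▷-v : ∀ s x → x ▷ₐ ⟦ v (suc s) ⟧ ≐ graft (suc s) (exp∂ x)
▷-v s = linear-unique (▷-linearˡ ⟦ v (suc s) ⟧) (∘-isLinear (graft-isLinear (suc s)) exp∂-isLinear)
  (λ t → ≐-trans (⟦⟧▷⟦⟧ t (v (suc s))) (≐-trans (act-v≐graft t s) (≐-cong (graft-isLinear (suc s)) (≐-sym (exp∂-⟦⟧ t)))))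

▷-congˡ : ∀ {x x′} → x ≈ x′ → ∀ z → x ▷ₐ z ≈ x′ ▷ₐ z
▷-congˡ {x} {x′} x≈x′ = linear-unique-up-to ≈-isLinearRelation (▷-linearʳ x) (▷-linearʳ x′) on-tree
  where
  on-tree : ∀ w → x ▷ₐ ⟦ w ⟧ ≈ x′ ▷ₐ ⟦ w ⟧
  on-tree (v zero)    = ≐⇒≈ (≐-trans (▷-v₀ x) (≐-sym (▷-v₀ x′)))
  on-tree (v (suc s)) = ≈-trans (≐⇒≈ (▷-v s x)) (≈-trans (graft-cong (suc s) (exp∂-cong x≈x′)) (≐⇒≈ (≐-sym (▷-v s x′))))
  on-tree (w₁ ⋆ w₂)   = ≈-trans (≐⇒≈ (▷-leibniz x ⟦ w₁ ⟧ ⟦ w₂ ⟧))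
    (≈-trans (⊕-cong (⋆-congˡ ⟦ w₂ ⟧ (on-tree w₁)) (⋆-congʳ ⟦ w₁ ⟧ (on-tree w₂)))
             (≐⇒≈ (≐-sym (▷-leibniz x′ ⟦ w₁ ⟧ ⟦ w₂ ⟧))))

▷-cong : ∀ {x x′ y y′} → x ≈ x′ → y ≈ y′ → x ▷ₐ y ≈ x′ ▷ₐ y′
▷-cong {x′ = x′} {y = y} x≈x′ y≈y′ = ≈-trans (▷-congˡ x≈x′ y) (▷-congʳ x′ y≈y′)

-- The second post-Lie axiom

graft₂ᴮ : ℕ → ℕ × M → ℕ × M → Lin
graft₂ᴮ n (e , t) (f , u) = ⟦ (v (n ℕ.+ f ℕ.+ e) ⋆ t) ⋆ u ⟧

graft₂ : ℕ → Poly → Poly → Lin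
graft₂ n = extend₂ (graft₂ᴮ n)

graft₂-⟨⟩ : ∀ n G f u → graft₂ n G ⟨ f , u ⟩ ≐ graft (n ℕ.+ f) G ⋆ₗ ⟦ u ⟧
graft₂-⟨⟩ n G f u = linear-unique
  (extend₂-linearˡ (graft₂ᴮ n) ⟨ f , u ⟩) (∘-isLinear (⋆-linearˡ ⟦ u ⟧) (graft-isLinear (n ℕ.+ f)))
  (λ { (e , t) → ≐-trans (extend₂-⟨⟩ (graft₂ᴮ n) (e , t) (f , u))
                         (≐-cong (⋆-linearˡ ⟦ u ⟧) (≐-sym (graft-⟨⟩ (n ℕ.+ f) e t))) }) G

act-graft : ∀ t s G → act t (graft (suc s) G) ≐ graft₂ (suc s) (exp∂ᴹ t) G ++ graft (suc s) (coefficientwise (act-M t) G)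
act-graft t s = linear-unique (∘-isLinear (act-isLinear t) (graft-isLinear (suc s)))
  (+-isLinear (extend₂-linearʳ (graft₂ᴮ (suc s)) (exp∂ᴹ t))
              (∘-isLinear (graft-isLinear (suc s)) (coefficientwise-isLinear (act-M t))))
  λ { (f , u) → begin
      act t (graft (suc s) ⟨ f , u ⟩)
        ≋⟨ ≐-cong (act-isLinear t) (graft-⟨⟩ (suc s) f u) ⟩
      act t ⟦ v (suc s ℕ.+ f) ⋆ u ⟧
        ≋⟨ act-⟦⟧ t (v (suc s ℕ.+ f) ⋆ u) ⟩
      act-v t (suc (s ℕ.+ f)) ⋆ₗ ⟦ u ⟧ ⊕ ⟦ v (suc s ℕ.+ f) ⟧ ⋆ₗ act-M t u
        ≋⟨ ++-cong (≐-trans (≐-cong (⋆-linearˡ ⟦ u ⟧) (act-v≐graft t (s ℕ.+ f))) (≐-sym (graft₂-⟨⟩ (suc s) (exp∂ᴹ t) f u)))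
                   (≐-trans (≐-sym (graft-·X^ (suc s) f (act-M t u)))
                            (≐-cong (graft-isLinear (suc s)) (≐-sym (coefficientwise-⟨⟩ (act-M t) f u)))) ⟩
      graft₂ (suc s) (exp∂ᴹ t) ⟨ f , u ⟩ ++ graft (suc s) (coefficientwise (act-M t) ⟨ f , u ⟩) ∎ }
  where open ≐-Reasoning

graft-⋆ₚ : ∀ n G H → graft n (G ⋆ₚ H) ≈ graft₂ n G H ⊕ (ℚ.- 1ℚ) · graft₂ n H G
graft-⋆ₚ n = bilinear-unique-up-to ≈-isLinearRelation
  (λ H → ∘-isLinear (graft-isLinear n) (⋆ₚ-linearˡ H)) (λ G → ∘-isLinear (graft-isLinear n) (⋆ₚ-linearʳ G))
  (λ H → +-isLinear (extend₂-linearˡ (graft₂ᴮ n) H) (•-isLinear (ℚ.- 1ℚ) (extend₂-linearʳ (graft₂ᴮ n) H)))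
  (λ G → +-isLinear (extend₂-linearʳ (graft₂ᴮ n) G) (•-isLinear (ℚ.- 1ℚ) (extend₂-linearˡ (graft₂ᴮ n) G)))
  λ { (e , t) (f , u) → begin
      graft n (⟨ e , t ⟩ ⋆ₚ ⟨ f , u ⟩)
        ≈⟨ ≐⇒≈ (≐-trans (≐-cong (graft-isLinear n) (⟨⟩⋆ₚ⟨⟩ e t f u)) (graft-⟨⟩ n (e ℕ.+ f) (t ⋆ u))) ⟩
      ⟦ v (n ℕ.+ (e ℕ.+ f)) ⟧ ⋆ₗ (⟦ t ⟧ ⋆ₗ ⟦ u ⟧)
        ≈⟨ ⋆-jacobi-right ⟦ v (n ℕ.+ (e ℕ.+ f)) ⟧ ⟦ t ⟧ ⟦ u ⟧ ⟩
      ⟦ (v (n ℕ.+ (e ℕ.+ f)) ⋆ t) ⋆ u ⟧ ⊕ (ℚ.- 1ℚ) · ⟦ (v (n ℕ.+ (e ℕ.+ f)) ⋆ u) ⋆ t ⟧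
        ≈⟨ ≐⇒≈ (≡⇒≐ (cong₂ (λ i j → ⟦ (v i ⋆ t) ⋆ u ⟧ ⊕ (ℚ.- 1ℚ) · ⟦ (v j ⋆ u) ⋆ t ⟧) (index₁ n e f) (index₂ n e f))) ⟩
      graft₂ᴮ n (e , t) (f , u) ⊕ (ℚ.- 1ℚ) · graft₂ᴮ n (f , u) (e , t)
        ≈⟨ ≐⇒≈ (++-cong (extend₂-⟨⟩ (graft₂ᴮ n) (e , t) (f , u)) (•-cong (ℚ.- 1ℚ) (extend₂-⟨⟩ (graft₂ᴮ n) (f , u) (e , t)))) ⟨
      graft₂ n ⟨ e , t ⟩ ⟨ f , u ⟩ ⊕ (ℚ.- 1ℚ) · graft₂ n ⟨ f , u ⟩ ⟨ e , t ⟩ ∎ }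
  where
  open ≈-Reasoning
  index₁ : ∀ n e f → n ℕ.+ (e ℕ.+ f) ≡ n ℕ.+ f ℕ.+ e
  index₁ = ℕ-Solver.solve-∀
  index₂ : ∀ n e f → n ℕ.+ (e ℕ.+ f) ≡ n ℕ.+ e ℕ.+ f
  index₂ = ℕ-Solver.solve-∀

-- a(x, y, z) − a(y, x, z), where a(x, y, z) = x ▷ (y ▷ z) − (x ▷ y) ▷ z is the associator of ▷ₐ
skewAssociator : Lin → Lin → Lin → Lin
skewAssociator x y z =
  x ▷ₐ (y ▷ₐ z) ⊕ (ℚ.- 1ℚ) · ((x ▷ₐ y) ▷ₐ z) ⊕ (ℚ.- 1ℚ) · (y ▷ₐ (x ▷ₐ z)) ⊕ (y ▷ₐ x) ▷ₐ z

bracket-▷-letter : ∀ t u s → (⟦ t ⟧ ⋆ₗ ⟦ u ⟧) ▷ₐ ⟦ v (suc s) ⟧ ≈ skewAssociator ⟦ t ⟧ ⟦ u ⟧ ⟦ v (suc s) ⟧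
bracket-▷-letter t u s = begin
  (X ⋆ₗ Y) ▷ₐ V
    ≈⟨ ≐⇒≈ (≐-trans (▷-v s (X ⋆ₗ Y)) (≐-cong (graft-isLinear n) exp-XY)) ⟩
  graft n (Et ⋆ₚ Eu)
    ≈⟨ graft-⋆ₚ n Et Eu ⟩
  α ⊕ m1 · γ
    ≈⟨ ≐⇒≈ (≐-byCoef (‵ α ⊕ᴱ m1 ·ᴱ ‵ γ) ((((‵ α ⊕ᴱ ‵ β) ⊕ᴱ m1 ·ᴱ ‵ β) ⊕ᴱ m1 ·ᴱ (‵ γ ⊕ᴱ ‵ δ′)) ⊕ᴱ ‵ δ′)
             (λ w → cancel (coef w α) (coef w β) (coef w γ) (coef w δ′))) ⟩
  α ⊕ β ⊕ m1 · β ⊕ m1 · (γ ⊕ δ′) ⊕ δ′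
    ≈⟨ ≐⇒≈ (++-cong (++-cong (++-cong T₁ (•-cong m1 T₂)) (•-cong m1 T₃)) T₄) ⟨
  skewAssociator X Y V ∎
  where
  open ≈-Reasoning
  m1 = ℚ.- 1ℚ
  n = suc s
  X = ⟦ t ⟧
  Y = ⟦ u ⟧
  V = ⟦ v n ⟧
  Et = exp∂ᴹ t
  Eu = exp∂ᴹ u
  α = graft₂ n Et Eu
  γ = graft₂ n Eu Et
  β = graft n (coefficientwise (act-M t) Eu)
  δ′ = graft n (coefficientwise (act-M u) Et)
  cancel : ∀ a b c d → a ℚ.+ (ℚ.- 1ℚ) ℚ.* c ≡ (((a ℚ.+ b) ℚ.+ (ℚ.- 1ℚ) ℚ.* b) ℚ.+ (ℚ.- 1ℚ) ℚ.* (c ℚ.+ d)) ℚ.+ d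
  cancel = solve-∀ ℚ-ring
  exp-XY : exp∂ (X ⋆ₗ Y) ≐ Et ⋆ₚ Eu
  exp-XY = ≐-trans (exp∂-⋆ X Y) (≐-trans (≐-cong (⋆ₚ-linearˡ (exp∂ Y)) (exp∂-⟦⟧ t)) (≐-cong (⋆ₚ-linearʳ Et) (exp∂-⟦⟧ u)))
  ▷V : ∀ w → ⟦ w ⟧ ▷ₐ V ≐ graft n (exp∂ᴹ w)
  ▷V w = ≐-trans (▷-v s ⟦ w ⟧) (≐-cong (graft-isLinear n) (exp∂-⟦⟧ w))
  ▷▷V : ∀ w w′ → ⟦ w ⟧ ▷ₐ (⟦ w′ ⟧ ▷ₐ V) ≐ graft₂ n (exp∂ᴹ w) (exp∂ᴹ w′) ++ graft n (coefficientwise (act-M w) (exp∂ᴹ w′))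
  ▷▷V w w′ = ≐-trans (≐-cong (▷-linearʳ ⟦ w ⟧) (▷V w′))
                     (≐-trans (⟦⟧▷≐extend w (graft n (exp∂ᴹ w′))) (act-graft w s (exp∂ᴹ w′)))
  ▷-▷V : ∀ w w′ → (⟦ w ⟧ ▷ₐ ⟦ w′ ⟧) ▷ₐ V ≐ graft n (coefficientwise (act-M w) (exp∂ᴹ w′))
  ▷-▷V w w′ = ≐-trans (▷-v s (⟦ w ⟧ ▷ₐ ⟦ w′ ⟧)) (≐-cong (graft-isLinear n)
                 (≐-trans (≐-cong exp∂-isLinear (⟦⟧▷≐extend w ⟦ w′ ⟧))
                 (≐-trans (exp∂-act w ⟦ w′ ⟧) (≐-cong (coefficientwise-isLinear (act-M w)) (exp∂-⟦⟧ w′)))))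
  T₁ = ▷▷V t u
  T₂ = ▷-▷V t u
  T₃ = ▷▷V u t
  T₄ = ▷-▷V u t

skewAssociator-linear₃ : ∀ x y → IsLinear (skewAssociator x y)
skewAssociator-linear₃ x y =
  +-isLinear (+-isLinear (+-isLinear (∘-isLinear (▷-linearʳ x) (▷-linearʳ y)) (•-isLinear (ℚ.- 1ℚ) (▷-linearʳ (x ▷ₐ y))))
                         (•-isLinear (ℚ.- 1ℚ) (∘-isLinear (▷-linearʳ y) (▷-linearʳ x))))
             (▷-linearʳ (y ▷ₐ x))

skewAssociator-linear₁ : ∀ y z → IsLinear (λ x → skewAssociator x y z)
skewAssociator-linear₁ y z =
  +-isLinear (+-isLinear (+-isLinear (▷-linearˡ (y ▷ₐ z)) (•-isLinear (ℚ.- 1ℚ) (∘-isLinear (▷-linearˡ z) (▷-linearˡ y))))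
                         (•-isLinear (ℚ.- 1ℚ) (∘-isLinear (▷-linearʳ y) (▷-linearˡ z))))
             (∘-isLinear (▷-linearˡ z) (▷-linearʳ y))

skewAssociator-linear₂ : ∀ x z → IsLinear (λ y → skewAssociator x y z)
skewAssociator-linear₂ x z =
  +-isLinear (+-isLinear (+-isLinear (∘-isLinear (▷-linearʳ x) (▷-linearˡ z)) (•-isLinear (ℚ.- 1ℚ) (∘-isLinear (▷-linearˡ z) (▷-linearʳ x))))
                         (•-isLinear (ℚ.- 1ℚ) (▷-linearˡ (x ▷ₐ z))))
             (∘-isLinear (▷-linearˡ z) (▷-linearˡ x))

skewAssociator-v₀ : ∀ x y → skewAssociator x y ⟦ v 0 ⟧ ≐ []
skewAssociator-v₀ x y =
  ++-cong (++-cong (++-cong x▷y▷v₀ (•-cong (ℚ.- 1ℚ) (▷-v₀ (x ▷ₐ y)))) (•-cong (ℚ.- 1ℚ) y▷x▷v₀)) (▷-v₀ (y ▷ₐ x))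
  where
  x▷y▷v₀ : x ▷ₐ (y ▷ₐ ⟦ v 0 ⟧) ≐ []
  x▷y▷v₀ = ≐-trans (≐-cong (▷-linearʳ x) (▷-v₀ y)) ([]-homo (▷-linearʳ x))
  y▷x▷v₀ : y ▷ₐ (x ▷ₐ ⟦ v 0 ⟧) ≐ []
  y▷x▷v₀ = ≐-trans (≐-cong (▷-linearʳ y) (▷-v₀ x)) ([]-homo (▷-linearʳ y))

skewAssociator-leibniz : ∀ x y a b → skewAssociator x y (a ⋆ₗ b) ≐ skewAssociator x y a ⋆ₗ b ⊕ a ⋆ₗ skewAssociator x y b
skewAssociator-leibniz x y a b =
  ≐-trans (++-cong (++-cong (++-cong t₁ (•-cong m1 t₂)) (•-cong m1 t₃)) t₄) (≐-byCoef E₁ E₂ coefs)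
  where
  m1 = ℚ.- 1ℚ
  ya = y ▷ₐ a
  xa = x ▷ₐ a
  yb = y ▷ₐ b
  xb = x ▷ₐ b
  P₁ = x ▷ₐ ya
  P₂ = (x ▷ₐ y) ▷ₐ a
  P₃ = y ▷ₐ xa
  P₄ = (y ▷ₐ x) ▷ₐ a
  Q₁ = x ▷ₐ yb
  Q₂ = (x ▷ₐ y) ▷ₐ b
  Q₃ = y ▷ₐ xb
  Q₄ = (y ▷ₐ x) ▷ₐ b
  t₁ : x ▷ₐ (y ▷ₐ (a ⋆ₗ b)) ≐ ((P₁ ⋆ₗ b) ⊕ (ya ⋆ₗ xb)) ⊕ ((xa ⋆ₗ yb) ⊕ (a ⋆ₗ Q₁))
  t₁ = ≐-trans (≐-cong (▷-linearʳ x) (▷-leibniz y a b))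
         (≐-trans (++-homo (▷-linearʳ x) (ya ⋆ₗ b) (a ⋆ₗ yb)) (++-cong (▷-leibniz x ya b) (▷-leibniz x a yb)))
  t₂ : (x ▷ₐ y) ▷ₐ (a ⋆ₗ b) ≐ (P₂ ⋆ₗ b) ⊕ (a ⋆ₗ Q₂)
  t₂ = ▷-leibniz (x ▷ₐ y) a b
  t₃ : y ▷ₐ (x ▷ₐ (a ⋆ₗ b)) ≐ ((P₃ ⋆ₗ b) ⊕ (xa ⋆ₗ yb)) ⊕ ((ya ⋆ₗ xb) ⊕ (a ⋆ₗ Q₃))
  t₃ = ≐-trans (≐-cong (▷-linearʳ y) (▷-leibniz x a b))
         (≐-trans (++-homo (▷-linearʳ y) (xa ⋆ₗ b) (a ⋆ₗ xb)) (++-cong (▷-leibniz y xa b) (▷-leibniz y a xb)))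
  t₄ : (y ▷ₐ x) ▷ₐ (a ⋆ₗ b) ≐ (P₄ ⋆ₗ b) ⊕ (a ⋆ₗ Q₄)
  t₄ = ▷-leibniz (y ▷ₐ x) a b
  E₁ E₂ : Expr
  E₁ = ((((‵ P₁ ⋆ᴱ ‵ b) ⊕ᴱ (‵ ya ⋆ᴱ ‵ xb)) ⊕ᴱ ((‵ xa ⋆ᴱ ‵ yb) ⊕ᴱ (‵ a ⋆ᴱ ‵ Q₁)))
        ⊕ᴱ m1 ·ᴱ ((‵ P₂ ⋆ᴱ ‵ b) ⊕ᴱ (‵ a ⋆ᴱ ‵ Q₂))
        ⊕ᴱ m1 ·ᴱ (((‵ P₃ ⋆ᴱ ‵ b) ⊕ᴱ (‵ xa ⋆ᴱ ‵ yb)) ⊕ᴱ ((‵ ya ⋆ᴱ ‵ xb) ⊕ᴱ (‵ a ⋆ᴱ ‵ Q₃))))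
        ⊕ᴱ ((‵ P₄ ⋆ᴱ ‵ b) ⊕ᴱ (‵ a ⋆ᴱ ‵ Q₄))
  E₂ = (‵ P₁ ⊕ᴱ m1 ·ᴱ ‵ P₂ ⊕ᴱ m1 ·ᴱ ‵ P₃ ⊕ᴱ ‵ P₄) ⋆ᴱ ‵ b ⊕ᴱ ‵ a ⋆ᴱ (‵ Q₁ ⊕ᴱ m1 ·ᴱ ‵ Q₂ ⊕ᴱ m1 ·ᴱ ‵ Q₃ ⊕ᴱ ‵ Q₄)
  coefs : ∀ w → coefᴱ w E₁ ≡ coefᴱ w E₂
  coefs (v k)     = zeros
    where
    zeros : ((0ℚ ℚ.+ 0ℚ) ℚ.+ (0ℚ ℚ.+ 0ℚ)) ℚ.+ m1 ℚ.* (0ℚ ℚ.+ 0ℚ) ℚ.+ m1 ℚ.* ((0ℚ ℚ.+ 0ℚ) ℚ.+ (0ℚ ℚ.+ 0ℚ)) ℚ.+ (0ℚ ℚ.+ 0ℚ)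
            ≡ 0ℚ ℚ.+ 0ℚ
    zeros = refl
  coefs (w₁ ⋆ w₂) = expand (coef w₁ P₁) (coef w₁ P₂) (coef w₁ P₃) (coef w₁ P₄) (coef w₁ ya) (coef w₁ xa) (coef w₁ a)
                           (coef w₂ b) (coef w₂ xb) (coef w₂ yb) (coef w₂ Q₁) (coef w₂ Q₂) (coef w₂ Q₃) (coef w₂ Q₄)
    where
    expand : ∀ p₁ p₂ p₃ p₄ ya xa a b xb yb q₁ q₂ q₃ q₄ →
      ((p₁ ℚ.* b ℚ.+ ya ℚ.* xb) ℚ.+ (xa ℚ.* yb ℚ.+ a ℚ.* q₁)) ℚ.+ m1 ℚ.* (p₂ ℚ.* b ℚ.+ a ℚ.* q₂)
        ℚ.+ m1 ℚ.* ((p₃ ℚ.* b ℚ.+ xa ℚ.* yb) ℚ.+ (ya ℚ.* xb ℚ.+ a ℚ.* q₃)) ℚ.+ (p₄ ℚ.* b ℚ.+ a ℚ.* q₄)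
      ≡ (p₁ ℚ.+ m1 ℚ.* p₂ ℚ.+ m1 ℚ.* p₃ ℚ.+ p₄) ℚ.* b ℚ.+ a ℚ.* (q₁ ℚ.+ m1 ℚ.* q₂ ℚ.+ m1 ℚ.* q₃ ℚ.+ q₄)
    expand = solve-∀ ℚ-ring

bracket-▷-trees : ∀ t u w → (⟦ t ⟧ ⋆ₗ ⟦ u ⟧) ▷ₐ ⟦ w ⟧ ≈ skewAssociator ⟦ t ⟧ ⟦ u ⟧ ⟦ w ⟧
bracket-▷-trees t u (v zero)    = ≐⇒≈ (≐-trans (▷-v₀ (⟦ t ⟧ ⋆ₗ ⟦ u ⟧)) (≐-sym (skewAssociator-v₀ ⟦ t ⟧ ⟦ u ⟧)))
bracket-▷-trees t u (v (suc s)) = bracket-▷-letter t u s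
bracket-▷-trees t u (w₁ ⋆ w₂)   = begin
  (⟦ t ⟧ ⋆ₗ ⟦ u ⟧) ▷ₐ (⟦ w₁ ⟧ ⋆ₗ ⟦ w₂ ⟧)
    ≈⟨ ≐⇒≈ (▷-leibniz (⟦ t ⟧ ⋆ₗ ⟦ u ⟧) ⟦ w₁ ⟧ ⟦ w₂ ⟧) ⟩
  ((⟦ t ⟧ ⋆ₗ ⟦ u ⟧) ▷ₐ ⟦ w₁ ⟧) ⋆ₗ ⟦ w₂ ⟧ ⊕ ⟦ w₁ ⟧ ⋆ₗ ((⟦ t ⟧ ⋆ₗ ⟦ u ⟧) ▷ₐ ⟦ w₂ ⟧)
    ≈⟨ ⊕-cong (⋆-congˡ ⟦ w₂ ⟧ (bracket-▷-trees t u w₁)) (⋆-congʳ ⟦ w₁ ⟧ (bracket-▷-trees t u w₂)) ⟩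
  skewAssociator ⟦ t ⟧ ⟦ u ⟧ ⟦ w₁ ⟧ ⋆ₗ ⟦ w₂ ⟧ ⊕ ⟦ w₁ ⟧ ⋆ₗ skewAssociator ⟦ t ⟧ ⟦ u ⟧ ⟦ w₂ ⟧
    ≈⟨ ≐⇒≈ (skewAssociator-leibniz ⟦ t ⟧ ⟦ u ⟧ ⟦ w₁ ⟧ ⟦ w₂ ⟧) ⟨
  skewAssociator ⟦ t ⟧ ⟦ u ⟧ (⟦ w₁ ⟧ ⋆ₗ ⟦ w₂ ⟧) ∎
  where open ≈-Reasoning

bracket-▷ : ∀ x y z → (x ⋆ₗ y) ▷ₐ z ≈ skewAssociator x y z
bracket-▷ x y z =
  unique (∘-isLinear (▷-linearˡ z) (⋆-linearˡ y)) (skewAssociator-linear₁ y z) (λ t →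
  unique (∘-isLinear (▷-linearˡ z) (⋆-linearʳ ⟦ t ⟧)) (skewAssociator-linear₂ ⟦ t ⟧ z) (λ u →
  unique (▷-linearʳ (⟦ t ⟧ ⋆ₗ ⟦ u ⟧)) (skewAssociator-linear₃ ⟦ t ⟧ ⟦ u ⟧) (bracket-▷-trees t u) z) y) x
  where unique = linear-unique-up-to ≈-isLinearRelation

theorem4p13 : IsPostLie _≈_ _⊕_ 𝟘 _·_ _⋆ₗ_ _▷ₐ_
theorem4p13 = record
  { ⁅⁆-cong    = ⋆-cong
  ; ⁅⁆-alt     = alt
  ; ⁅⁆-jac     = jacobi
  ; ▷-cong     = ▷-cong
  ; ▷-+ˡ       = λ x y z → ≐⇒≈ (++-homo (▷-linearˡ z) x y)
  ; ▷-+ʳ       = λ x y z → ≐⇒≈ (++-homo (▷-linearʳ x) y z)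
  ; ▷-∙ˡ       = λ q x y → ≐⇒≈ (•-homo (▷-linearˡ y) q x)
  ; ▷-∙ʳ       = λ q x y → ≐⇒≈ (•-homo (▷-linearʳ x) q y)
  ; derivation = λ x y z → ≐⇒≈ (▷-leibniz x y z)
  ; bracket-▷  = bracket-▷
  }
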